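{- Let $R$ be a f.a.s. semiring and let $(!,\mathsf{p},\mathsf{d},\mathsf{c},\mathsf{w})$ be an $R$-graded coalgebra modality on an additive symmetric monoidal category $\mathcal{L}$ with finite biproducts. Suppose that the natural transformations $\chi^\otimes_r := \sum_{s+t=r}\mathsf{c}_{s,t};(!_s(\pi_0)\otimes !_t(\pi_1));\iota_{s,t}: !_r(A\oplus B)\to\bigoplus_{s+t=r} !_sA\otimes !_tB$ and $\chi^I := \mathsf{w}: !_0\mathsf{0}\to I$ are natural isomorphisms. Define $\overline{\mathsf{c}}_{r,s} := \iota_{r,s};{\chi^\otimes_{r+s}}^{ -1};!_{r+s}(\nabla): !_rA\otimes !_sA\to !_{r+s}A$ and $\overline{\mathsf{w}} := {\chi^I}^{ -1};!_0(0): I\to !_0A$, where $\nabla: A\oplus A\to A$ is the codiagonal. Then $(!,\mathsf{p},\mathsf{d},\mathsf{c},\mathsf{w},\overline{\mathsf{c}},\overline{\mathsf{w}})$ is an $R$-graded additive bialgebra modality.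
   Context: Composition is diagrammatic. An additive symmetric monoidal category is a strict symmetric monoidal category $(\mathcal{L},\otimes,I,\sigma)$ enriched over commutative monoids, with composition and $\otimes$ preserving sums and zeros; finite biproducts $\oplus$ have projections $\pi_j$, injections $\iota_j$, zero object $\mathsf{0}$, and $\iota_{s,t},\pi_{s,t}$ denote injection/projection of the $(s,t)$ summand over the finite index set $\{(s,t): s+t=r\}$. A semiring $R$ is finite additive split (f.a.s.) if each $r$ has finitely many decompositions $s+t=r$, $s+t=0$ forces $s=t=0$, $s+t=1$ forces $(s,t)\in\{(1,0),(0,1)\}$, and $R$ is additively cancellative. An $R$-graded coalgebra modality: endofunctors $!_r$ with natural $\mathsf{p}_{r,s}: !_{rs}A\to !_r!_sA$, $\mathsf{c}_{r,s}: !_{r+s}A\to !_rA\otimes !_sA$, $\mathsf{d}: !_1A\to A$, $\mathsf{w}: !_0A\to I$ forming a graded comonad, a graded cocommutative comonoid, with $\mathsf{p}$ a graded comonoid morphism. An $R$-graded additive bialgebra modality adds $\overline{\mathsf{c}}_{r,s}: !_rA\otimes !_sA\to !_{r+s}A$, $\overline{\mathsf{w}}: I\to !_0A$ forming a graded commutative monoid, satisfying the graded bimonoid laws $\overline{\mathsf{c}}_{r,s};\mathsf{c}_{t,u}=\sum_{a+b=r,c+d=s,a+c=t,b+d=u}(\mathsf{c}_{a,b}\otimes\mathsf{c}_{c,d});(1\otimes\sigma\otimes1);(\overline{\mathsf{c}}_{a,c}\otimes\overline{\mathsf{c}}_{b,d})$, $\overline{\mathsf{w}};\mathsf{w}=1$,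 $\overline{\mathsf{w}};\mathsf{c}_{0,0}=\overline{\mathsf{w}}\otimes\overline{\mathsf{w}}$, $\overline{\mathsf{c}}_{0,0};\mathsf{w}=\mathsf{w}\otimes\mathsf{w}$; $\overline{\mathsf{c}}_{r,s};\mathsf{d}=\delta_{r,0}\cdot(\mathsf{w}\otimes\mathsf{d})+\delta_{0,s}\cdot(\mathsf{d}\otimes\mathsf{w})$ for $r+s=1$; and $!_r(f+g)=\sum_{s+t=r}\mathsf{c}_{s,t};(!_s(f)\otimes !_t(g));\overline{\mathsf{c}}_{s,t}$, $!_r(0)=\mathsf{w};\overline{\mathsf{w}}$ if $r=0$, else $0$. -}

module Defs where

open import Level using (Level; _⊔_) renaming (suc to lsuc)
import Data.Nat as ℕ
open import Data.Nat using (ℕ)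
open import Data.Fin using (Fin; zero; suc)
import Data.Sum
open import Data.Product using (Σ; _×_; _,_; proj₁; proj₂)
open import Relation.Binary.PropositionalEquality
  using (_≡_; _≢_; refl; sym; trans; cong; subst)
open import Relation.Nullary using (¬_)
open import Function.Bundles using (_↔_; Inverse)
open import Algebra.Structures using (IsSemiring)

-- Finite additive split (f.a.s.) semirings.
-- "r has finitely many decompositions s + t = r" is rendered
-- constructively as an explicit enumeration  Fin (dec r) ↔ Decomp r.

record FASSemiring (a : Level) : Set (lsuc a) where
  infixl 7 _*_
  infixl 6 _+_
  field
    Carrier    : Set a
    _+_ _*_    : Carrier → Carrier → Carrier
    0# 1#      : Carrier
    isSemiring : IsSemiring _≡_ _+_ _*_ 0# 1#

  open IsSemiring isSemiring public
    using (+-assoc; +-comm; +-identityˡ; +-identityʳ;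
           *-assoc; *-identityˡ; *-identityʳ; distribʳ; zeroˡ)

  Decomp : Carrier → Set a
  Decomp r = Σ (Carrier × Carrier) (λ st → proj₁ st + proj₂ st ≡ r)

  field
    dec        : Carrier → ℕ
    enum       : ∀ r → Fin (dec r) ↔ Decomp r
    split-zero : ∀ s t → s + t ≡ 0# → (s ≡ 0#) × (t ≡ 0#)
    split-one  : ∀ s t → s + t ≡ 1# →
                 ((s ≡ 1#) × (t ≡ 0#)) Data.Sum.⊎ ((s ≡ 0#) × (t ≡ 1#))
    +-cancelˡ  : ∀ r s t → r + s ≡ r + t → s ≡ t

-- Categories enriched over commutative monoids (hom-equality is _≡_),
-- composition written diagrammatically:  f ⨾ g  means "f then g".

record AdditiveCategory (o ℓ : Level) : Set (lsuc (o ⊔ ℓ)) where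
  infixl 5 _⨾_
  infixl 6 _+ₕ_
  field
    Obj  : Set o
    Hom  : Obj → Obj → Set ℓ
    id   : ∀ {A} → Hom A A
    _⨾_  : ∀ {A B C} → Hom A B → Hom B C → Hom A C
    idˡ  : ∀ {A B} (f : Hom A B) → id ⨾ f ≡ f
    idʳ  : ∀ {A B} (f : Hom A B) → f ⨾ id ≡ f
    ⨾-assoc : ∀ {A B C D} (f : Hom A B) (g : Hom B C) (h : Hom C D) →
              (f ⨾ g) ⨾ h ≡ f ⨾ (g ⨾ h)
    _+ₕ_ : ∀ {A B} → Hom A B → Hom A B → Hom A B
    0ₕ   : ∀ {A B} → Hom A B
    +ₕ-assoc     : ∀ {A B} (f g h : Hom A B) → (f +ₕ g) +ₕ h ≡ f +ₕ (g +ₕ h)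
    +ₕ-comm      : ∀ {A B} (f g : Hom A B) → f +ₕ g ≡ g +ₕ f
    +ₕ-identityˡ : ∀ {A B} (f : Hom A B) → 0ₕ +ₕ f ≡ f
    ⨾-distribʳ : ∀ {A B C} (f g : Hom A B) (h : Hom B C) →
                 (f +ₕ g) ⨾ h ≡ (f ⨾ h) +ₕ (g ⨾ h)
    ⨾-distribˡ : ∀ {A B C} (f : Hom A B) (g h : Hom B C) →
                 f ⨾ (g +ₕ h) ≡ (f ⨾ g) +ₕ (f ⨾ h)
    ⨾-zeroˡ : ∀ {A B C} (f : Hom B C) → (0ₕ {A} {B}) ⨾ f ≡ 0ₕ
    ⨾-zeroʳ : ∀ {A B C} (f : Hom A B) → f ⨾ (0ₕ {B} {C}) ≡ 0ₕ

  coe : ∀ {A B} → A ≡ B → Hom A B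
  coe {A} p = subst (Hom A) p id

  Σₕ : ∀ {A B} (n : ℕ) → (Fin n → Hom A B) → Hom A B
  Σₕ ℕ.zero    f = 0ₕ
  Σₕ (ℕ.suc n) f = f zero +ₕ Σₕ n (λ i → f (suc i))

  IsIso : ∀ {A B} → Hom A B → Set ℓ
  IsIso {A} {B} f = Σ (Hom B A) (λ g → ((f ⨾ g) ≡ id) × ((g ⨾ f) ≡ id))

-- Strictness: the associativity / unit laws hold as
-- equalities of objects, and ⊗ on morphisms is strictly associative and
-- unital up to the (identity) coercions along these equalities.

record StrictSymmetricMonoidal {o ℓ} (C : AdditiveCategory o ℓ) : Set (o ⊔ ℓ) where
  open AdditiveCategory C
  infixr 8 _⊗₀_ _⊗₁_
  field
    _⊗₀_ : Obj → Obj → Obj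
    _⊗₁_ : ∀ {A B C D} → Hom A B → Hom C D → Hom (A ⊗₀ C) (B ⊗₀ D)
    I    : Obj
    ⊗-id   : ∀ {A B} → (id {A}) ⊗₁ (id {B}) ≡ id
    ⊗-comp : ∀ {A B C D E F} (f : Hom A B) (g : Hom B C) (h : Hom D E) (k : Hom E F) →
             (f ⨾ g) ⊗₁ (h ⨾ k) ≡ (f ⊗₁ h) ⨾ (g ⊗₁ k)
    assocₒ : ∀ {A B C} → (A ⊗₀ B) ⊗₀ C ≡ A ⊗₀ (B ⊗₀ C)
    unitˡₒ : ∀ {A} → I ⊗₀ A ≡ A
    unitʳₒ : ∀ {A} → A ⊗₀ I ≡ A
    assocₘ : ∀ {A B C D E F} (f : Hom A B) (g : Hom C D) (h : Hom E F) →
             ((f ⊗₁ g) ⊗₁ h) ⨾ coe assocₒ ≡ coe assocₒ ⨾ (f ⊗₁ (g ⊗₁ h))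
    unitˡₘ : ∀ {A B} (f : Hom A B) → ((id {I}) ⊗₁ f) ⨾ coe unitˡₒ ≡ coe unitˡₒ ⨾ f
    unitʳₘ : ∀ {A B} (f : Hom A B) → (f ⊗₁ (id {I})) ⨾ coe unitʳₒ ≡ coe unitʳₒ ⨾ f
    σ : ∀ {A B} → Hom (A ⊗₀ B) (B ⊗₀ A)
    σ-natural : ∀ {A B C D} (f : Hom A B) (g : Hom C D) →
                (f ⊗₁ g) ⨾ σ ≡ σ ⨾ (g ⊗₁ f)
    σ-invol   : ∀ {A B} → σ {A} {B} ⨾ σ ≡ id
    σ-hexagon : ∀ {A B C} →
                σ {A} {B ⊗₀ C} ≡ coe (sym assocₒ) ⨾ (σ ⊗₁ id) ⨾ coe assocₒ
                                   ⨾ (id ⊗₁ σ) ⨾ coe (sym assocₒ)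
    ⊗-distribʳ : ∀ {A B C D} (f g : Hom A B) (h : Hom C D) →
                 (f +ₕ g) ⊗₁ h ≡ (f ⊗₁ h) +ₕ (g ⊗₁ h)
    ⊗-distribˡ : ∀ {A B C D} (f : Hom A B) (g h : Hom C D) →
                 f ⊗₁ (g +ₕ h) ≡ (f ⊗₁ g) +ₕ (f ⊗₁ h)
    ⊗-zeroˡ : ∀ {A B C D} (h : Hom C D) → (0ₕ {A} {B}) ⊗₁ h ≡ 0ₕ
    ⊗-zeroʳ : ∀ {A B C D} (f : Hom A B) → f ⊗₁ (0ₕ {C} {D}) ≡ 0ₕ

  -- the strict "1 ⊗ σ ⊗ 1" : (W ⊗ X) ⊗ (Y ⊗ Z) → (W ⊗ Y) ⊗ (X ⊗ Z)
  mid : ∀ {W X Y Z} → Hom ((W ⊗₀ X) ⊗₀ (Y ⊗₀ Z)) ((W ⊗₀ Y) ⊗₀ (X ⊗₀ Z))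
  mid = coe assocₒ
        ⨾ (id ⊗₁ (coe (sym assocₒ) ⨾ (σ ⊗₁ id) ⨾ coe assocₒ))
        ⨾ coe (sym assocₒ)

record FiniteBiproducts {o ℓ} (C : AdditiveCategory o ℓ) : Set (o ⊔ ℓ) where
  open AdditiveCategory C
  field
    ⨁ : (n : ℕ) → (Fin n → Obj) → Obj
    π : ∀ {n} (X : Fin n → Obj) (i : Fin n) → Hom (⨁ n X) (X i)
    ι : ∀ {n} (X : Fin n → Obj) (i : Fin n) → Hom (X i) (⨁ n X)
    ι⨾π-same : ∀ {n} (X : Fin n → Obj) (i : Fin n) → ι X i ⨾ π X i ≡ id
    ι⨾π-diff : ∀ {n} (X : Fin n → Obj) (i j : Fin n) → i ≢ j → ι X i ⨾ π X j ≡ 0ₕ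
    Σπ⨾ι     : ∀ {n} (X : Fin n → Obj) → Σₕ n (λ i → π X i ⨾ ι X i) ≡ id

  pair : Obj → Obj → Fin 2 → Obj
  pair A B zero       = A
  pair A B (suc zero) = B

  _⊕_ : Obj → Obj → Obj
  A ⊕ B = ⨁ 2 (pair A B)

  π₀ : ∀ {A B} → Hom (A ⊕ B) A
  π₀ {A} {B} = π (pair A B) zero

  π₁ : ∀ {A B} → Hom (A ⊕ B) B
  π₁ {A} {B} = π (pair A B) (suc zero)

  ∇ : ∀ {A} → Hom (A ⊕ A) A
  ∇ = π₀ +ₕ π₁

  𝟘 : Obj
  𝟘 = ⨁ 0 (λ ())

record GradedCoalgebraModality {a o ℓ} (R : FASSemiring a)
         (C : AdditiveCategory o ℓ) (M : StrictSymmetricMonoidal C)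
         : Set (a ⊔ o ⊔ ℓ) where
  open FASSemiring R
  open AdditiveCategory C
  open StrictSymmetricMonoidal M
  field
    !₀ : Carrier → Obj → Obj
    !₁ : ∀ r {A B} → Hom A B → Hom (!₀ r A) (!₀ r B)
    !-id   : ∀ r {A} → !₁ r (id {A}) ≡ id
    !-comp : ∀ r {A B C} (f : Hom A B) (g : Hom B C) → !₁ r (f ⨾ g) ≡ !₁ r f ⨾ !₁ r g

  tr : ∀ {r r' A} → r ≡ r' → Hom (!₀ r A) (!₀ r' A)
  tr {A = A} e = coe (cong (λ x → !₀ x A) e)

  field
    p : ∀ r s A → Hom (!₀ (r * s) A) (!₀ r (!₀ s A))
    c : ∀ r s A → Hom (!₀ (r + s) A) (!₀ r A ⊗₀ !₀ s A)
    d : ∀ A → Hom (!₀ 1# A) A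
    w : ∀ A → Hom (!₀ 0# A) I
    p-natural : ∀ r s {A B} (f : Hom A B) → !₁ (r * s) f ⨾ p r s B ≡ p r s A ⨾ !₁ r (!₁ s f)
    c-natural : ∀ r s {A B} (f : Hom A B) → !₁ (r + s) f ⨾ c r s B ≡ c r s A ⨾ (!₁ r f ⊗₁ !₁ s f)
    d-natural : ∀ {A B} (f : Hom A B) → !₁ 1# f ⨾ d B ≡ d A ⨾ f
    w-natural : ∀ {A B} (f : Hom A B) → !₁ 0# f ⨾ w B ≡ w A
    p-assoc : ∀ r s t A →
      tr (*-assoc r s t) ⨾ p r (s * t) A ⨾ !₁ r (p s t A) ≡ p (r * s) t A ⨾ p r s (!₀ t A)
    p-counitˡ : ∀ r A → p 1# r A ⨾ d (!₀ r A) ≡ tr (*-identityˡ r)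
    p-counitʳ : ∀ r A → p r 1# A ⨾ !₁ r (d A) ≡ tr (*-identityʳ r)
    c-coassoc : ∀ r s t A →
      tr (sym (+-assoc r s t)) ⨾ c (r + s) t A ⨾ (c r s A ⊗₁ id) ⨾ coe assocₒ
        ≡ c r (s + t) A ⨾ (id ⊗₁ c s t A)
    c-counitˡ : ∀ r A → c 0# r A ⨾ (w A ⊗₁ id) ⨾ coe unitˡₒ ≡ tr (+-identityˡ r)
    c-counitʳ : ∀ r A → c r 0# A ⨾ (id ⊗₁ w A) ⨾ coe unitʳₒ ≡ tr (+-identityʳ r)
    c-cocomm  : ∀ r s A → c r s A ⨾ σ ≡ tr (+-comm r s) ⨾ c s r A
    p-c : ∀ r r' s A →
      p (r + r') s A ⨾ c r r' (!₀ s A)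
        ≡ tr (distribʳ s r r') ⨾ c (r * s) (r' * s) A ⨾ (p r s A ⊗₁ p r' s A)
    p-w : ∀ s A → p 0# s A ⨾ w (!₀ s A) ≡ tr (zeroˡ s) ⨾ w A

record Quad {a} (R : FASSemiring a) (r s t u : FASSemiring.Carrier R) : Set a where
  open FASSemiring R
  field
    qa qb qc qd : Carrier
    eab : qa + qb ≡ r
    ecd : qc + qd ≡ s
    eac : qa + qc ≡ t
    ebd : qb + qd ≡ u

record IsGradedAdditiveBialgebraModality {a o ℓ} (R : FASSemiring a)
         (C : AdditiveCategory o ℓ) (M : StrictSymmetricMonoidal C)
         (G : GradedCoalgebraModality R C M)
         (c̄ : ∀ r s A → AdditiveCategory.Hom C
                 (StrictSymmetricMonoidal._⊗₀_ M (GradedCoalgebraModality.!₀ G r A)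
                                                 (GradedCoalgebraModality.!₀ G s A))
                 (GradedCoalgebraModality.!₀ G (FASSemiring._+_ R r s) A))
         (w̄ : ∀ A → AdditiveCategory.Hom C (StrictSymmetricMonoidal.I M)
                 (GradedCoalgebraModality.!₀ G (FASSemiring.0# R) A))
         : Set (a ⊔ o ⊔ ℓ) where
  open FASSemiring R
  open AdditiveCategory C
  open StrictSymmetricMonoidal M
  open GradedCoalgebraModality G

  bimonoid-term : ∀ {r s t u} A → Quad R r s t u →
                  Hom (!₀ r A ⊗₀ !₀ s A) (!₀ t A ⊗₀ !₀ u A)
  bimonoid-term A q =
    (tr (sym (Quad.eab q)) ⊗₁ tr (sym (Quad.ecd q)))
    ⨾ (c (Quad.qa q) (Quad.qb q) A ⊗₁ c (Quad.qc q) (Quad.qd q) A)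
    ⨾ mid
    ⨾ (c̄ (Quad.qa q) (Quad.qc q) A ⊗₁ c̄ (Quad.qb q) (Quad.qd q) A)
    ⨾ (tr (Quad.eac q) ⊗₁ tr (Quad.ebd q))

  additive-term : ∀ {r A B} (f g : Hom A B) → Decomp r → Hom (!₀ r A) (!₀ r B)
  additive-term {A = A} {B} f g ((s , t) , e) =
    tr (sym e) ⨾ c s t A ⨾ (!₁ s f ⊗₁ !₁ t g) ⨾ c̄ s t B ⨾ tr e

  field
    c̄-natural : ∀ r s {A B} (f : Hom A B) →
      (!₁ r f ⊗₁ !₁ s f) ⨾ c̄ r s B ≡ c̄ r s A ⨾ !₁ (r + s) f
    w̄-natural : ∀ {A B} (f : Hom A B) → w̄ A ⨾ !₁ 0# f ≡ w̄ B
    c̄-assoc : ∀ r s t A →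
      (c̄ r s A ⊗₁ id) ⨾ c̄ (r + s) t A
        ≡ coe assocₒ ⨾ (id ⊗₁ c̄ s t A) ⨾ c̄ r (s + t) A ⨾ tr (sym (+-assoc r s t))
    c̄-unitˡ : ∀ r A → (w̄ A ⊗₁ id) ⨾ c̄ 0# r A ⨾ tr (+-identityˡ r) ≡ coe unitˡₒ
    c̄-unitʳ : ∀ r A → (id ⊗₁ w̄ A) ⨾ c̄ r 0# A ⨾ tr (+-identityʳ r) ≡ coe unitʳₒ
    c̄-comm  : ∀ r s A → σ ⨾ c̄ s r A ≡ c̄ r s A ⨾ tr (+-comm r s)
    -- graded bimonoid laws; the sum over the finite index set
    -- {(a,b,c,d) : a+b=r, c+d=s, a+c=t, b+d=u} is taken along any
    -- enumeration of that set
    bimonoid : ∀ r s t u A (h : r + s ≡ t + u) (n : ℕ) (e : Fin n ↔ Quad R r s t u) →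
      c̄ r s A ⨾ tr h ⨾ c t u A ≡ Σₕ n (λ i → bimonoid-term A (Inverse.to e i))
    w̄⨾w : ∀ A → w̄ A ⨾ w A ≡ id
    w̄⨾c : ∀ A → w̄ A ⨾ tr (sym (+-identityˡ 0#)) ⨾ c 0# 0# A
                 ≡ coe (sym unitˡₒ) ⨾ (w̄ A ⊗₁ w̄ A)
    c̄⨾w : ∀ A → c̄ 0# 0# A ⨾ tr (+-identityˡ 0#) ⨾ w A ≡ (w A ⊗₁ w A) ⨾ coe unitˡₒ
    -- c̄_{r,s} ; d = δ_{r,0}·(w ⊗ d) + δ_{0,s}·(d ⊗ w)   for r + s = 1,
    -- spelled out according to which of the Kronecker deltas are 1
    c̄⨾d-01 : ∀ r s A (h : r + s ≡ 1#) (e0 : r ≡ 0#) (e1 : s ≡ 1#) → s ≢ 0# →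
      c̄ r s A ⨾ tr h ⨾ d A ≡ (tr e0 ⊗₁ tr e1) ⨾ (w A ⊗₁ d A) ⨾ coe unitˡₒ
    c̄⨾d-10 : ∀ r s A (h : r + s ≡ 1#) (e1 : r ≡ 1#) (e0 : s ≡ 0#) → r ≢ 0# →
      c̄ r s A ⨾ tr h ⨾ d A ≡ (tr e1 ⊗₁ tr e0) ⨾ (d A ⊗₁ w A) ⨾ coe unitʳₒ
    c̄⨾d-both : ∀ r s A (h : r + s ≡ 1#) (r0 : r ≡ 0#) (s1 : s ≡ 1#) (r1 : r ≡ 1#) (s0 : s ≡ 0#) →
      c̄ r s A ⨾ tr h ⨾ d A
        ≡ ((tr r0 ⊗₁ tr s1) ⨾ (w A ⊗₁ d A) ⨾ coe unitˡₒ)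
          +ₕ ((tr r1 ⊗₁ tr s0) ⨾ (d A ⊗₁ w A) ⨾ coe unitʳₒ)
    c̄⨾d-none : ∀ r s A (h : r + s ≡ 1#) → r ≢ 0# → s ≢ 0# → c̄ r s A ⨾ tr h ⨾ d A ≡ 0ₕ
    !-+ : ∀ r {A B} (f g : Hom A B) →
      !₁ r (f +ₕ g) ≡ Σₕ (dec r) (λ i → additive-term f g (Inverse.to (enum r) i))
    !-0-zero : ∀ {A B} → !₁ 0# (0ₕ {A} {B}) ≡ w A ⨾ w̄ B
    !-0-nonzero : ∀ r {A B} → r ≢ 0# → !₁ r (0ₕ {A} {B}) ≡ 0ₕ

module Construction {a o ℓ} (R : FASSemiring a) (C : AdditiveCategory o ℓ)
         (M : StrictSymmetricMonoidal C) (B : FiniteBiproducts C)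
         (G : GradedCoalgebraModality R C M) where
  open FASSemiring R
  open AdditiveCategory C
  open StrictSymmetricMonoidal M
  open FiniteBiproducts B
  open GradedCoalgebraModality G

  Summand : ∀ {r} → Obj → Obj → Decomp r → Obj
  Summand A B' ((s , t) , _) = !₀ s A ⊗₀ !₀ t B'

  Bigsum : Carrier → Obj → Obj → Obj
  Bigsum r A B' = ⨁ (dec r) (λ i → Summand A B' (Inverse.to (enum r) i))

  ιD : ∀ r A B' (x : Decomp r) → Hom (Summand A B' x) (Bigsum r A B')
  ιD r A B' x =
    coe (cong (Summand A B') (sym (Inverse.strictlyInverseˡ (enum r) x)))
    ⨾ ι (λ i → Summand A B' (Inverse.to (enum r) i)) (Inverse.from (enum r) x)

  χ-term : ∀ {r} A B' (x : Decomp r) → Hom (!₀ r (A ⊕ B')) (Summand A B' x)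
  χ-term A B' ((s , t) , e) = tr (sym e) ⨾ c s t (A ⊕ B') ⨾ (!₁ s π₀ ⊗₁ !₁ t π₁)

  χ⊗ : ∀ r A B' → Hom (!₀ r (A ⊕ B')) (Bigsum r A B')
  χ⊗ r A B' = Σₕ (dec r) (λ i →
    χ-term A B' (Inverse.to (enum r) i)
    ⨾ ι (λ j → Summand A B' (Inverse.to (enum r) j)) i)

  χI : Hom (!₀ 0# 𝟘) I
  χI = w 𝟘

  c̄ : (∀ r A B' → IsIso (χ⊗ r A B')) →
      ∀ r s A → Hom (!₀ r A ⊗₀ !₀ s A) (!₀ (r + s) A)
  c̄ isoχ r s A = ιD (r + s) A A ((r , s) , refl) ⨾ proj₁ (isoχ (r + s) A A) ⨾ !₁ (r + s) ∇

  w̄ : IsIso χI → ∀ A → Hom I (!₀ 0# A)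
  w̄ isoI A = proj₁ isoI ⨾ !₁ 0# (0ₕ {𝟘} {A})

-- Because χ^⊗_r is invertible, a map into !_r (A ⊕ B) is determined by its components
-- χ_{s,t} = c_{s,t} ; (!_s π₀ ⊗ !_t π₁), s + t = r, and ι_{s,t} ; (χ^⊗_r)⁻¹ ; χ_{s',t'} is the
-- identity when (s , t) = (s' , t') and 0 otherwise.  Each axiom is checked componentwise.
-- Naturality of ι ; χ⁻¹ in A and B moves !(f ⊕ g) across the injections, so naturality,
-- unitality, commutativity and associativity of c̄ reduce to the laws ∇ ; f = (f ⊕ f) ; ∇,
-- (id ⊕ 0) ; ∇ = π₀, ⊕-swap ; ∇ = ∇ and ⊕-assoc ; (id ⊕ ∇) ; ∇ = (∇ ⊕ id) ; ∇ of the codiagonal,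
-- combined with the counit, cocommutativity and coassociativity of c.  Additivity of ! follows
-- from f + g = Δ ; (f ⊕ g) ; ∇ and !_r Δ = Σ_{s+t=r} c_{s,t} ; ι_{s,t} ; χ⁻¹.  The bimonoid law
-- comes from writing !∇ = χ ; χ⁻¹ ; !∇ on both factors of c_{t,u} and the interchange law
-- c_{a+c,b+d} ; (c_{a,c} ⊗ c_{b,d}) = c_{a+b,c+d} ; (c_{a,b} ⊗ c_{c,d}) ; (1 ⊗ σ ⊗ 1), and
-- !_r 0 = 0 for r ≠ 0 from !_r 𝟘 being a zero object.  The laws of w̄ use χ^I = w instead.

module Submission where

open import Defs
open import Data.Nat using (ℕ; zero; suc)
open import Data.Fin using (Fin; zero; suc)
import Data.Fin.Properties as FinP
open import Data.Product using (Σ; _×_; _,_; proj₁; proj₂)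
open import Data.Product.Properties using (≡-dec)
open import Data.Sum using (_⊎_; inj₁; inj₂)
open import Relation.Nullary using (Dec; yes; no; contradiction)
open import Relation.Binary.PropositionalEquality
open import Function.Bundles using (_↔_; Inverse)
open import Axiom.UniquenessOfIdentityProofs.WithK using (uip)

module CategoryLemmas {o ℓ} (C : AdditiveCategory o ℓ) where
  open AdditiveCategory C
  open ≡-Reasoning

  pullʳ : ∀ {A B C D} {f : Hom A B} {g : Hom B C} {h : Hom C D} {k : Hom B D} →
          g ⨾ h ≡ k → f ⨾ g ⨾ h ≡ f ⨾ k
  pullʳ {f = f} {g} {h} eq = trans (⨾-assoc f g h) (cong (f ⨾_) eq)

  pullʳ₃ : ∀ {A B C D E} {f : Hom A B} {g : Hom B C} {h : Hom C D} {i : Hom D E} {k : Hom B E} →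
           g ⨾ h ⨾ i ≡ k → f ⨾ g ⨾ h ⨾ i ≡ f ⨾ k
  pullʳ₃ eq = trans (cong (_⨾ _) (⨾-assoc _ _ _)) (pullʳ eq)

  pullʳ₄ : ∀ {A B C D E F} {f : Hom A B} {g : Hom B C} {h : Hom C D} {i : Hom D E} {j : Hom E F}
           {k : Hom B F} → g ⨾ h ⨾ i ⨾ j ≡ k → f ⨾ g ⨾ h ⨾ i ⨾ j ≡ f ⨾ k
  pullʳ₄ eq = trans (cong (_⨾ _) (pullʳ₃ refl)) (pullʳ eq)

  inverse-unique : ∀ {A B} {u φ' : Hom A B} {φ : Hom B A} → u ⨾ φ ≡ id → φ ⨾ φ' ≡ id → u ≡ φ'
  inverse-unique {u = u} {φ'} {φ} u⨾φ φ⨾φ' = begin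
    u              ≡⟨ sym (idʳ u) ⟩
    u ⨾ id         ≡⟨ cong (u ⨾_) (sym φ⨾φ') ⟩
    u ⨾ (φ ⨾ φ')   ≡⟨ sym (⨾-assoc _ _ _) ⟩
    u ⨾ φ ⨾ φ'     ≡⟨ cong (_⨾ φ') u⨾φ ⟩
    id ⨾ φ'        ≡⟨ idˡ φ' ⟩
    φ'             ∎

  +ₕ-identityʳ : ∀ {A B} (f : Hom A B) → f +ₕ 0ₕ ≡ f
  +ₕ-identityʳ f = trans (+ₕ-comm f 0ₕ) (+ₕ-identityˡ f)

  coe-inverseʳ : ∀ {X Y} (p : X ≡ Y) → coe p ⨾ coe (sym p) ≡ id
  coe-inverseʳ refl = idˡ id

  coe-inverseˡ : ∀ {X Y} (p : X ≡ Y) → coe (sym p) ⨾ coe p ≡ id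
  coe-inverseˡ refl = idˡ id

  Σₕ-cong : ∀ {A B} n {f g : Fin n → Hom A B} → (∀ i → f i ≡ g i) → Σₕ n f ≡ Σₕ n g
  Σₕ-cong zero    eq = refl
  Σₕ-cong (suc n) eq = cong₂ _+ₕ_ (eq zero) (Σₕ-cong n (λ i → eq (suc i)))

  ⨾-distribˡ-Σₕ : ∀ {X A B} n (h : Hom X A) (f : Fin n → Hom A B) →
                  h ⨾ Σₕ n f ≡ Σₕ n (λ i → h ⨾ f i)
  ⨾-distribˡ-Σₕ zero    h f = ⨾-zeroʳ h
  ⨾-distribˡ-Σₕ (suc n) h f =
    trans (⨾-distribˡ h _ _) (cong ((h ⨾ f zero) +ₕ_) (⨾-distribˡ-Σₕ n h (λ i → f (suc i))))

  ⨾-distribʳ-Σₕ : ∀ {X A B} n (f : Fin n → Hom X A) (h : Hom A B) →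
                  Σₕ n f ⨾ h ≡ Σₕ n (λ i → f i ⨾ h)
  ⨾-distribʳ-Σₕ zero    f h = ⨾-zeroˡ h
  ⨾-distribʳ-Σₕ (suc n) f h =
    trans (⨾-distribʳ _ _ h) (cong ((f zero ⨾ h) +ₕ_) (⨾-distribʳ-Σₕ n (λ i → f (suc i)) h))

  Σₕ-0ₕ : ∀ {A B} n (f : Fin n → Hom A B) → (∀ i → f i ≡ 0ₕ) → Σₕ n f ≡ 0ₕ
  Σₕ-0ₕ zero    f eq = refl
  Σₕ-0ₕ (suc n) f eq =
    trans (cong₂ _+ₕ_ (eq zero) (Σₕ-0ₕ n _ (λ i → eq (suc i)))) (+ₕ-identityˡ 0ₕ)

  Σₕ-single : ∀ {A B} n (f : Fin n → Hom A B) (k : Fin n) →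
              (∀ i → i ≢ k → f i ≡ 0ₕ) → Σₕ n f ≡ f k
  Σₕ-single (suc n) f zero eq =
    trans (cong (f zero +ₕ_) (Σₕ-0ₕ n _ (λ i → eq (suc i) (λ ())))) (+ₕ-identityʳ _)
  Σₕ-single (suc n) f (suc k) eq =
    trans (cong₂ _+ₕ_ (eq zero (λ ()))
                      (Σₕ-single n (λ i → f (suc i)) k
                        (λ i i≢k → eq (suc i) (λ q → i≢k (FinP.suc-injective q)))))
          (+ₕ-identityˡ _)

  +ₕ-interchange : ∀ {A B} (f g h k : Hom A B) → (f +ₕ g) +ₕ (h +ₕ k) ≡ (f +ₕ h) +ₕ (g +ₕ k)
  +ₕ-interchange f g h k = begin
    (f +ₕ g) +ₕ (h +ₕ k)   ≡⟨ +ₕ-assoc f g _ ⟩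
    f +ₕ (g +ₕ (h +ₕ k))   ≡⟨ cong (f +ₕ_) (sym (+ₕ-assoc g h k)) ⟩
    f +ₕ ((g +ₕ h) +ₕ k)   ≡⟨ cong (λ x → f +ₕ (x +ₕ k)) (+ₕ-comm g h) ⟩
    f +ₕ ((h +ₕ g) +ₕ k)   ≡⟨ cong (f +ₕ_) (+ₕ-assoc h g k) ⟩
    f +ₕ (h +ₕ (g +ₕ k))   ≡⟨ sym (+ₕ-assoc f h _) ⟩
    (f +ₕ h) +ₕ (g +ₕ k)   ∎

  Σₕ-distrib-+ₕ : ∀ {A B} n (f g : Fin n → Hom A B) →
                  Σₕ n (λ i → f i +ₕ g i) ≡ Σₕ n f +ₕ Σₕ n g
  Σₕ-distrib-+ₕ zero    f g = sym (+ₕ-identityˡ 0ₕ)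
  Σₕ-distrib-+ₕ (suc n) f g =
    trans (cong (f zero +ₕ g zero +ₕ_) (Σₕ-distrib-+ₕ n (λ i → f (suc i)) (λ i → g (suc i))))
          (+ₕ-interchange _ _ _ _)

  Σₕ-comm : ∀ {A B} n m (f : Fin n → Fin m → Hom A B) →
            Σₕ n (λ i → Σₕ m (f i)) ≡ Σₕ m (λ j → Σₕ n (λ i → f i j))
  Σₕ-comm zero    m f = sym (Σₕ-0ₕ m _ (λ _ → refl))
  Σₕ-comm (suc n) m f =
    trans (cong (Σₕ m (f zero) +ₕ_) (Σₕ-comm n m (λ i → f (suc i))))
          (sym (Σₕ-distrib-+ₕ m _ _))

  -- Both sides equal the triple sum of H i j k = [ρ (to k) ≡ (i , j)] · F (to k), summed in two orders.
  Σₕ-reindex : ∀ {X Y} {q} {Q : Set q} n (e : Fin n ↔ Q) (F : Q → Hom X Y)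
    m₁ m₂ (G : Fin m₁ → Fin m₂ → Hom X Y) (ρ : Q → Fin m₁ × Fin m₂) →
    (∀ q q' → ρ q ≡ ρ q' → q ≡ q') →
    (∀ q → G (proj₁ (ρ q)) (proj₂ (ρ q)) ≡ F q) →
    (∀ i j → (G i j ≡ 0ₕ) ⊎ (Σ Q λ q → ρ q ≡ (i , j))) →
    Σₕ n (λ k → F (Inverse.to e k)) ≡ Σₕ m₁ (λ i → Σₕ m₂ (λ j → G i j))
  Σₕ-reindex {X} {Y} n e F m₁ m₂ G ρ ρ-injective hit miss = begin
    Σₕ n (λ k → F (to k))
      ≡⟨ Σₕ-cong n (λ k → sym (column k)) ⟩
    Σₕ n (λ k → Σₕ m₁ (λ i → Σₕ m₂ (λ j → H i j k)))
      ≡⟨ Σₕ-comm n m₁ _ ⟩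
    Σₕ m₁ (λ i → Σₕ n (λ k → Σₕ m₂ (λ j → H i j k)))
      ≡⟨ Σₕ-cong m₁ (λ i → Σₕ-comm n m₂ _) ⟩
    Σₕ m₁ (λ i → Σₕ m₂ (λ j → Σₕ n (H i j)))
      ≡⟨ Σₕ-cong m₁ (λ i → Σₕ-cong m₂ (λ j → sym (row i j))) ⟩
    Σₕ m₁ (λ i → Σₕ m₂ (λ j → G i j)) ∎
    where
    open Inverse e using (to; from; strictlyInverseˡ; strictlyInverseʳ)
    _≟₂_ = ≡-dec FinP._≟_ FinP._≟_

    if : ∀ {p} {P : Set p} → Dec P → Hom X Y → Hom X Y
    if (yes _) f = f
    if (no _)  f = 0ₕ

    H : Fin m₁ → Fin m₂ → Fin n → Hom X Y
    H i j k = if (ρ (to k) ≟₂ (i , j)) (F (to k))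

    H-off : ∀ i j k → ρ (to k) ≢ (i , j) → H i j k ≡ 0ₕ
    H-off i j k ne with ρ (to k) ≟₂ (i , j)
    ... | yes eq = contradiction eq ne
    ... | no  _  = refl

    H-on : ∀ i j k → ρ (to k) ≡ (i , j) → H i j k ≡ F (to k)
    H-on i j k eq with ρ (to k) ≟₂ (i , j)
    ... | yes _ = refl
    ... | no ne = contradiction eq ne

    G-on : ∀ q {i j} → ρ q ≡ (i , j) → G i j ≡ F q
    G-on q eq = trans (sym (cong (λ z → G (proj₁ z) (proj₂ z)) eq)) (hit q)

    column : ∀ k → Σₕ m₁ (λ i → Σₕ m₂ (λ j → H i j k)) ≡ F (to k)
    column k = begin
      Σₕ m₁ (λ i → Σₕ m₂ (λ j → H i j k))
        ≡⟨ Σₕ-single m₁ _ i₀ (λ i ne →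
             Σₕ-0ₕ m₂ _ (λ j → H-off i j k (λ eq → ne (sym (cong proj₁ eq))))) ⟩
      Σₕ m₂ (λ j → H i₀ j k)
        ≡⟨ Σₕ-single m₂ _ j₀ (λ j ne → H-off i₀ j k (λ eq → ne (sym (cong proj₂ eq)))) ⟩
      H i₀ j₀ k
        ≡⟨ H-on i₀ j₀ k refl ⟩
      F (to k) ∎
      where i₀ = proj₁ (ρ (to k)); j₀ = proj₂ (ρ (to k))

    row : ∀ i j → G i j ≡ Σₕ n (H i j)
    row i j with miss i j
    ... | inj₁ G≡0 =
      trans G≡0 (sym (Σₕ-0ₕ n _ (λ k → H≡0 k (ρ (to k) ≟₂ (i , j)))))
      where
      H≡0 : ∀ k → Dec (ρ (to k) ≡ (i , j)) → H i j k ≡ 0ₕ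
      H≡0 k (yes eq) = trans (H-on i j k eq) (trans (sym (G-on (to k) eq)) G≡0)
      H≡0 k (no ne)  = H-off i j k ne
    ... | inj₂ (q , eq) = sym (begin
      Σₕ n (H i j)
        ≡⟨ Σₕ-single n _ (from q) (λ k ne → H-off i j k (λ eq' → ne (
             trans (sym (strictlyInverseʳ k))
                   (cong from (ρ-injective _ _ (trans eq' (sym eq))))))) ⟩
      H i j (from q)
        ≡⟨ H-on i j (from q) (trans (cong ρ (strictlyInverseˡ q)) eq) ⟩
      F (to (from q))
        ≡⟨ cong F (strictlyInverseˡ q) ⟩
      F q
        ≡⟨ sym (G-on q eq) ⟩
      G i j ∎)

module BiproductLemmas {o ℓ} (C : AdditiveCategory o ℓ) (B : FiniteBiproducts C) where
  open AdditiveCategory C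
  open FiniteBiproducts B
  open CategoryLemmas C
  open ≡-Reasoning

  ⨁-ext : ∀ {n X Y} (P Q : Hom Y (⨁ n X)) → (∀ i → P ⨾ π X i ≡ Q ⨾ π X i) → P ≡ Q
  ⨁-ext {n} {X} P Q eq = begin
    P                                   ≡⟨ expand P ⟩
    Σₕ n (λ i → P ⨾ π X i ⨾ ι X i)      ≡⟨ Σₕ-cong n (λ i → cong (_⨾ ι X i) (eq i)) ⟩
    Σₕ n (λ i → Q ⨾ π X i ⨾ ι X i)      ≡⟨ sym (expand Q) ⟩
    Q                                   ∎
    where
    expand : ∀ P → P ≡ Σₕ n (λ i → P ⨾ π X i ⨾ ι X i)
    expand P = begin
      P                                 ≡⟨ sym (idʳ P) ⟩
      P ⨾ id                            ≡⟨ cong (P ⨾_) (sym (Σπ⨾ι X)) ⟩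
      P ⨾ Σₕ n (λ i → π X i ⨾ ι X i)    ≡⟨ ⨾-distribˡ-Σₕ n P _ ⟩
      Σₕ n (λ i → P ⨾ (π X i ⨾ ι X i))  ≡⟨ Σₕ-cong n (λ i → sym (⨾-assoc _ _ _)) ⟩
      Σₕ n (λ i → P ⨾ π X i ⨾ ι X i)    ∎

  into-𝟘-zero : ∀ {X} (f : Hom X 𝟘) → f ≡ 0ₕ
  into-𝟘-zero f = begin
    f         ≡⟨ sym (idʳ f) ⟩
    f ⨾ id    ≡⟨ cong (f ⨾_) (sym (Σπ⨾ι (λ ()))) ⟩
    f ⨾ 0ₕ    ≡⟨ ⨾-zeroʳ f ⟩
    0ₕ        ∎

  ι₀ : ∀ {A B} → Hom A (A ⊕ B)
  ι₀ {A} {B} = ι (pair A B) zero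

  ι₁ : ∀ {A B} → Hom B (A ⊕ B)
  ι₁ {A} {B} = ι (pair A B) (suc zero)

  ⟨_,_⟩ : ∀ {Y A B} → Hom Y A → Hom Y B → Hom Y (A ⊕ B)
  ⟨ f , g ⟩ = (f ⨾ ι₀) +ₕ (g ⨾ ι₁)

  ⟨,⟩⨾π₀ : ∀ {Y A B} (f : Hom Y A) (g : Hom Y B) → ⟨ f , g ⟩ ⨾ π₀ ≡ f
  ⟨,⟩⨾π₀ f g = begin
    ⟨ f , g ⟩ ⨾ π₀                    ≡⟨ ⨾-distribʳ _ _ _ ⟩
    (f ⨾ ι₀ ⨾ π₀) +ₕ (g ⨾ ι₁ ⨾ π₀)    ≡⟨ cong₂ _+ₕ_ (⨾-assoc _ _ _) (⨾-assoc _ _ _) ⟩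
    (f ⨾ (ι₀ ⨾ π₀)) +ₕ (g ⨾ (ι₁ ⨾ π₀)) ≡⟨ cong₂ (λ x y → (f ⨾ x) +ₕ (g ⨾ y))
                                            (ι⨾π-same _ zero) (ι⨾π-diff _ (suc zero) zero (λ ())) ⟩
    (f ⨾ id) +ₕ (g ⨾ 0ₕ)              ≡⟨ cong₂ _+ₕ_ (idʳ f) (⨾-zeroʳ g) ⟩
    f +ₕ 0ₕ                           ≡⟨ +ₕ-identityʳ f ⟩
    f                                 ∎

  ⟨,⟩⨾π₁ : ∀ {Y A B} (f : Hom Y A) (g : Hom Y B) → ⟨ f , g ⟩ ⨾ π₁ ≡ g
  ⟨,⟩⨾π₁ f g = begin
    ⟨ f , g ⟩ ⨾ π₁
      ≡⟨ ⨾-distribʳ _ _ _ ⟩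
    (f ⨾ ι₀ ⨾ π₁) +ₕ (g ⨾ ι₁ ⨾ π₁)
      ≡⟨ cong₂ _+ₕ_ (⨾-assoc _ _ _) (⨾-assoc _ _ _) ⟩
    (f ⨾ (ι₀ ⨾ π₁)) +ₕ (g ⨾ (ι₁ ⨾ π₁)) ≡⟨ cong₂ (λ x y → (f ⨾ x) +ₕ (g ⨾ y))
                                            (ι⨾π-diff _ zero (suc zero) (λ ())) (ι⨾π-same _ (suc zero)) ⟩
    (f ⨾ 0ₕ) +ₕ (g ⨾ id)
      ≡⟨ cong₂ _+ₕ_ (⨾-zeroʳ f) (idʳ g) ⟩
    0ₕ +ₕ g
      ≡⟨ +ₕ-identityˡ g ⟩
    g                                 ∎

  ∇-components : ∀ {Y A} (f g : Hom Y A) → ⟨ f , g ⟩ ⨾ ∇ ≡ f +ₕ g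
  ∇-components f g = trans (⨾-distribˡ _ _ _) (cong₂ _+ₕ_ (⟨,⟩⨾π₀ f g) (⟨,⟩⨾π₁ f g))

  infixr 7 _⊕₁_
  _⊕₁_ : ∀ {A B C D} → Hom A C → Hom B D → Hom (A ⊕ B) (C ⊕ D)
  f ⊕₁ g = ⟨ π₀ ⨾ f , π₁ ⨾ g ⟩

  Δ : ∀ {A} → Hom A (A ⊕ A)
  Δ = ⟨ id , id ⟩

  +ₕ-via-∇ : ∀ {A B} (f g : Hom A B) → f +ₕ g ≡ Δ ⨾ (f ⊕₁ g ⨾ ∇)
  +ₕ-via-∇ f g = sym (begin
    Δ ⨾ (f ⊕₁ g ⨾ ∇)
      ≡⟨ cong (Δ ⨾_) (∇-components _ _) ⟩
    Δ ⨾ ((π₀ ⨾ f) +ₕ (π₁ ⨾ g))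
      ≡⟨ ⨾-distribˡ _ _ _ ⟩
    (Δ ⨾ (π₀ ⨾ f)) +ₕ (Δ ⨾ (π₁ ⨾ g))
      ≡⟨ cong₂ _+ₕ_ (sym (⨾-assoc _ _ _)) (sym (⨾-assoc _ _ _)) ⟩
    (Δ ⨾ π₀ ⨾ f) +ₕ (Δ ⨾ π₁ ⨾ g)
      ≡⟨ cong₂ (λ x y → (x ⨾ f) +ₕ (y ⨾ g)) (⟨,⟩⨾π₀ id id) (⟨,⟩⨾π₁ id id) ⟩
    (id ⨾ f) +ₕ (id ⨾ g)
      ≡⟨ cong₂ _+ₕ_ (idˡ f) (idˡ g) ⟩
    f +ₕ g ∎)

  ∇-natural : ∀ {A B} (f : Hom A B) → ∇ ⨾ f ≡ f ⊕₁ f ⨾ ∇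
  ∇-natural f = trans (⨾-distribʳ _ _ _) (sym (∇-components _ _))

  ⊕-swap : ∀ {A B} → Hom (A ⊕ B) (B ⊕ A)
  ⊕-swap = ⟨ π₁ , π₀ ⟩

  ⊕-swap⨾∇ : ∀ {A} → ⊕-swap {A} {A} ⨾ ∇ ≡ ∇
  ⊕-swap⨾∇ = trans (∇-components _ _) (+ₕ-comm _ _)

  ⊕-assoc : ∀ {A B C} → Hom ((A ⊕ B) ⊕ C) (A ⊕ (B ⊕ C))
  ⊕-assoc = ⟨ π₀ ⨾ π₀ , ⟨ π₀ ⨾ π₁ , π₁ ⟩ ⟩

  ⊕-assoc⨾∇ : ∀ {A} → ⊕-assoc {A} {A} {A} ⨾ (id ⊕₁ ∇ ⨾ ∇) ≡ ∇ ⊕₁ id ⨾ ∇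
  ⊕-assoc⨾∇ = begin
    ⊕-assoc ⨾ (id ⊕₁ ∇ ⨾ ∇)
      ≡⟨ cong (⊕-assoc ⨾_) (∇-components _ _) ⟩
    ⊕-assoc ⨾ ((π₀ ⨾ id) +ₕ (π₁ ⨾ ∇))
      ≡⟨ ⨾-distribˡ _ _ _ ⟩
    (⊕-assoc ⨾ (π₀ ⨾ id)) +ₕ (⊕-assoc ⨾ (π₁ ⨾ ∇))
      ≡⟨ cong₂ _+ₕ_ (sym (⨾-assoc _ _ _)) (sym (⨾-assoc _ _ _)) ⟩
    (⊕-assoc ⨾ π₀ ⨾ id) +ₕ (⊕-assoc ⨾ π₁ ⨾ ∇)
      ≡⟨ cong₂ _+ₕ_ (trans (idʳ _) (⟨,⟩⨾π₀ _ _))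
           (trans (cong (_⨾ ∇) (⟨,⟩⨾π₁ _ _)) (∇-components _ _)) ⟩
    (π₀ ⨾ π₀) +ₕ ((π₀ ⨾ π₁) +ₕ π₁)
      ≡⟨ sym (+ₕ-assoc _ _ _) ⟩
    ((π₀ ⨾ π₀) +ₕ (π₀ ⨾ π₁)) +ₕ π₁
      ≡⟨ cong₂ _+ₕ_ (sym (⨾-distribˡ _ _ _)) (sym (idʳ _)) ⟩
    (π₀ ⨾ ∇) +ₕ (π₁ ⨾ id)
      ≡⟨ sym (∇-components _ _) ⟩
    ∇ ⊕₁ id ⨾ ∇ ∎

module MonoidalLemmas {o ℓ} (C : AdditiveCategory o ℓ) (M : StrictSymmetricMonoidal C) where
  open AdditiveCategory C
  open StrictSymmetricMonoidal M
  open CategoryLemmas C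
  open ≡-Reasoning

  infixr 8 _⟨⊗⟩_
  _⟨⊗⟩_ : ∀ {X Y Z W} {f f' : Hom X Y} {g g' : Hom Z W} → f ≡ f' → g ≡ g' → f ⊗₁ g ≡ f' ⊗₁ g'
  _⟨⊗⟩_ = cong₂ _⊗₁_

  ⊗-fuse : ∀ {A B C D E F} (f : Hom A B) (g : Hom B C) (h : Hom D E) (k : Hom E F) →
           (f ⊗₁ h) ⨾ (g ⊗₁ k) ≡ (f ⨾ g) ⊗₁ (h ⨾ k)
  ⊗-fuse f g h k = sym (⊗-comp f g h k)

  id⊗-fuse : ∀ {A B C D} (f : Hom B C) (g : Hom C D) → (id {A} ⊗₁ f) ⨾ (id ⊗₁ g) ≡ id ⊗₁ (f ⨾ g)
  id⊗-fuse f g = trans (⊗-fuse _ _ _ _) (cong (_⊗₁ (f ⨾ g)) (idˡ id))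

  ⊗id-fuse : ∀ {A B C D} (f : Hom B C) (g : Hom C D) → (f ⊗₁ id {A}) ⨾ (g ⊗₁ id) ≡ (f ⨾ g) ⊗₁ id
  ⊗id-fuse f g = trans (⊗-fuse _ _ _ _) (cong ((f ⨾ g) ⊗₁_) (idˡ id))

  ⊗-split : ∀ {A B C D} (f : Hom A B) (g : Hom C D) → f ⊗₁ g ≡ (f ⊗₁ id) ⨾ (id ⊗₁ g)
  ⊗-split f g = trans (sym (idʳ f) ⟨⊗⟩ sym (idˡ g)) (⊗-comp f id id g)

  ⊗-distribʳ-Σₕ : ∀ {A B X Y} n (f : Fin n → Hom A B) (h : Hom X Y) →
                  Σₕ n f ⊗₁ h ≡ Σₕ n (λ i → f i ⊗₁ h)
  ⊗-distribʳ-Σₕ zero    f h = ⊗-zeroˡ h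
  ⊗-distribʳ-Σₕ (suc n) f h =
    trans (⊗-distribʳ _ _ h) (cong ((f zero ⊗₁ h) +ₕ_) (⊗-distribʳ-Σₕ n (λ i → f (suc i)) h))

  ⊗-distribˡ-Σₕ : ∀ {A B X Y} n (h : Hom X Y) (f : Fin n → Hom A B) →
                  h ⊗₁ Σₕ n f ≡ Σₕ n (λ i → h ⊗₁ f i)
  ⊗-distribˡ-Σₕ zero    h f = ⊗-zeroʳ h
  ⊗-distribˡ-Σₕ (suc n) h f =
    trans (⊗-distribˡ h _ _) (cong ((h ⊗₁ f zero) +ₕ_) (⊗-distribˡ-Σₕ n h (λ i → f (suc i))))

  α⇒ : ∀ {A B C} → Hom ((A ⊗₀ B) ⊗₀ C) (A ⊗₀ (B ⊗₀ C))
  α⇒ = coe assocₒ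

  α⇐ : ∀ {A B C} → Hom (A ⊗₀ (B ⊗₀ C)) ((A ⊗₀ B) ⊗₀ C)
  α⇐ = coe (sym assocₒ)

  assocₘ⁻¹ : ∀ {A B C D E F} (f : Hom A B) (g : Hom C D) (h : Hom E F) →
             (f ⊗₁ (g ⊗₁ h)) ⨾ α⇐ ≡ α⇐ ⨾ ((f ⊗₁ g) ⊗₁ h)
  assocₘ⁻¹ f g h = begin
    (f ⊗₁ (g ⊗₁ h)) ⨾ α⇐
      ≡⟨ sym (idˡ _) ⟩
    id ⨾ ((f ⊗₁ (g ⊗₁ h)) ⨾ α⇐)
      ≡⟨ cong (_⨾ ((f ⊗₁ (g ⊗₁ h)) ⨾ α⇐)) (sym (coe-inverseˡ assocₒ)) ⟩
    α⇐ ⨾ α⇒ ⨾ ((f ⊗₁ (g ⊗₁ h)) ⨾ α⇐)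
      ≡⟨ trans (⨾-assoc _ _ _) (cong (α⇐ ⨾_) (sym (⨾-assoc _ _ _))) ⟩
    α⇐ ⨾ (α⇒ ⨾ (f ⊗₁ (g ⊗₁ h)) ⨾ α⇐)
      ≡⟨ cong (λ x → α⇐ ⨾ (x ⨾ α⇐)) (sym (assocₘ f g h)) ⟩
    α⇐ ⨾ (((f ⊗₁ g) ⊗₁ h) ⨾ α⇒ ⨾ α⇐)
      ≡⟨ cong (α⇐ ⨾_) (trans (pullʳ (coe-inverseʳ assocₒ)) (idʳ _)) ⟩
    α⇐ ⨾ ((f ⊗₁ g) ⊗₁ h) ∎

  swap₁₂ : ∀ {X Y Z} → Hom (X ⊗₀ (Y ⊗₀ Z)) (Y ⊗₀ (X ⊗₀ Z))
  swap₁₂ = α⇐ ⨾ (σ ⊗₁ id) ⨾ α⇒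

  swap₁₂-natural : ∀ {A B C D E F} (f : Hom A B) (g : Hom C D) (h : Hom E F) →
                   (f ⊗₁ (g ⊗₁ h)) ⨾ swap₁₂ ≡ swap₁₂ ⨾ (g ⊗₁ (f ⊗₁ h))
  swap₁₂-natural f g h = begin
    (f ⊗₁ (g ⊗₁ h)) ⨾ (α⇐ ⨾ (σ ⊗₁ id) ⨾ α⇒)
      ≡⟨ trans (sym (⨾-assoc _ _ _)) (cong (_⨾ α⇒) (sym (⨾-assoc _ _ _))) ⟩
    (f ⊗₁ (g ⊗₁ h)) ⨾ α⇐ ⨾ (σ ⊗₁ id) ⨾ α⇒
      ≡⟨ cong (λ x → x ⨾ (σ ⊗₁ id) ⨾ α⇒) (assocₘ⁻¹ f g h) ⟩
    α⇐ ⨾ ((f ⊗₁ g) ⊗₁ h) ⨾ (σ ⊗₁ id) ⨾ α⇒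
      ≡⟨ cong (_⨾ α⇒) (pullʳ (trans (⊗-fuse _ _ _ _)
           (trans (σ-natural f g ⟨⊗⟩ trans (idʳ h) (sym (idˡ h)))
           (⊗-comp _ _ _ _)))) ⟩
    α⇐ ⨾ ((σ ⊗₁ id) ⨾ ((g ⊗₁ f) ⊗₁ h)) ⨾ α⇒
      ≡⟨ cong (_⨾ α⇒) (sym (⨾-assoc _ _ _)) ⟩
    α⇐ ⨾ (σ ⊗₁ id) ⨾ ((g ⊗₁ f) ⊗₁ h) ⨾ α⇒
      ≡⟨ pullʳ (assocₘ g f h) ⟩
    α⇐ ⨾ (σ ⊗₁ id) ⨾ (α⇒ ⨾ (g ⊗₁ (f ⊗₁ h)))
      ≡⟨ sym (⨾-assoc _ _ _) ⟩
    α⇐ ⨾ (σ ⊗₁ id) ⨾ α⇒ ⨾ (g ⊗₁ (f ⊗₁ h)) ∎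

  mid-natural : ∀ {A B C D E F G H} (f : Hom A B) (g : Hom C D) (h : Hom E F) (k : Hom G H) →
                ((f ⊗₁ g) ⊗₁ (h ⊗₁ k)) ⨾ mid ≡ mid ⨾ ((f ⊗₁ h) ⊗₁ (g ⊗₁ k))
  mid-natural f g h k = begin
    ((f ⊗₁ g) ⊗₁ (h ⊗₁ k)) ⨾ (α⇒ ⨾ (id ⊗₁ swap₁₂) ⨾ α⇐)
      ≡⟨ trans (sym (⨾-assoc _ _ _)) (cong (_⨾ α⇐) (sym (⨾-assoc _ _ _))) ⟩
    ((f ⊗₁ g) ⊗₁ (h ⊗₁ k)) ⨾ α⇒ ⨾ (id ⊗₁ swap₁₂) ⨾ α⇐
      ≡⟨ cong (λ x → x ⨾ (id ⊗₁ swap₁₂) ⨾ α⇐) (assocₘ f g (h ⊗₁ k)) ⟩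
    α⇒ ⨾ (f ⊗₁ (g ⊗₁ (h ⊗₁ k))) ⨾ (id ⊗₁ swap₁₂) ⨾ α⇐
      ≡⟨ cong (_⨾ α⇐) (pullʳ (trans (⊗-fuse _ _ _ _)
           (trans (trans (idʳ f) (sym (idˡ f)) ⟨⊗⟩ swap₁₂-natural g h k) (⊗-comp _ _ _ _)))) ⟩
    α⇒ ⨾ ((id ⊗₁ swap₁₂) ⨾ (f ⊗₁ (h ⊗₁ (g ⊗₁ k)))) ⨾ α⇐
      ≡⟨ cong (_⨾ α⇐) (sym (⨾-assoc _ _ _)) ⟩
    α⇒ ⨾ (id ⊗₁ swap₁₂) ⨾ (f ⊗₁ (h ⊗₁ (g ⊗₁ k))) ⨾ α⇐
      ≡⟨ pullʳ (assocₘ⁻¹ f h (g ⊗₁ k)) ⟩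
    α⇒ ⨾ (id ⊗₁ swap₁₂) ⨾ (α⇐ ⨾ ((f ⊗₁ h) ⊗₁ (g ⊗₁ k)))
      ≡⟨ sym (⨾-assoc _ _ _) ⟩
    α⇒ ⨾ (id ⊗₁ swap₁₂) ⨾ α⇐ ⨾ ((f ⊗₁ h) ⊗₁ (g ⊗₁ k)) ∎

module Decompositions {a} (R : FASSemiring a) where
  open FASSemiring R

  +-interchange : ∀ a b c d → (a + b) + (c + d) ≡ (a + c) + (b + d)
  +-interchange a b c d = begin
    (a + b) + (c + d)   ≡⟨ +-assoc a b (c + d) ⟩
    a + (b + (c + d))   ≡⟨ cong (a +_) (sym (+-assoc b c d)) ⟩
    a + ((b + c) + d)   ≡⟨ cong (λ x → a + (x + d)) (+-comm b c) ⟩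
    a + ((c + b) + d)   ≡⟨ cong (a +_) (+-assoc c b d) ⟩
    a + (c + (b + d))   ≡⟨ sym (+-assoc a c (b + d)) ⟩
    (a + c) + (b + d)   ∎
    where open ≡-Reasoning

  left right : ∀ {r} → Decomp r → Carrier
  left  ((s , _) , _) = s
  right ((_ , t) , _) = t

  Decomp-≡ : ∀ {r s t s' t'} {e : s + t ≡ r} {e' : s' + t' ≡ r} → s ≡ s' → t ≡ t' →
             _≡_ {A = Decomp r} ((s , t) , e) ((s' , t') , e')
  Decomp-≡ refl refl = cong ((_ , _) ,_) (uip _ _)

  pairD : ∀ s t → Decomp (s + t)
  pairD s t = ((s , t) , refl)

  D₁₀ D₀₁ : ∀ {m} → m ≡ 1# → Decomp m
  D₁₀ h = ((1# , 0#) , trans (+-identityʳ 1#) (sym h))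
  D₀₁ h = ((0# , 1#) , trans (+-identityˡ 1#) (sym h))

  swapD : ∀ {r} → Decomp r → Decomp r
  swapD ((s , t) , e) = ((t , s) , trans (+-comm t s) e)

  decomp : ∀ r → Fin (dec r) → Decomp r
  decomp r = Inverse.to (enum r)

  index : ∀ r → Decomp r → Fin (dec r)
  index r = Inverse.from (enum r)

  decomp-index : ∀ r x → decomp r (index r x) ≡ x
  decomp-index r = Inverse.strictlyInverseˡ (enum r)

  index-decomp : ∀ r i → index r (decomp r i) ≡ i
  index-decomp r = Inverse.strictlyInverseʳ (enum r)

  index-injective : ∀ r {x y} → index r x ≡ index r y → x ≡ y
  index-injective r {x} {y} p =
    trans (sym (decomp-index r x)) (trans (cong (decomp r) p) (decomp-index r y))

  Decomp-≟ : ∀ r (x y : Decomp r) → Dec (x ≡ y)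
  Decomp-≟ r x y with index r x FinP.≟ index r y
  ... | yes p = yes (index-injective r p)
  ... | no ¬p = no (λ q → ¬p (cong (index r) q))

module ModalityLemmas {a o ℓ} (R : FASSemiring a) (C : AdditiveCategory o ℓ)
         (M : StrictSymmetricMonoidal C) (G : GradedCoalgebraModality R C M) where
  open FASSemiring R
  open AdditiveCategory C
  open StrictSymmetricMonoidal M
  open GradedCoalgebraModality G
  open CategoryLemmas C
  open MonoidalLemmas C M
  open ≡-Reasoning

  tr-irrelevant : ∀ {r r' A} (e e' : r ≡ r') → tr {A = A} e ≡ tr e'
  tr-irrelevant e e' = cong tr (uip e e')

  tr-⨾ : ∀ {r r' r'' A} (e : r ≡ r') (e' : r' ≡ r'') (e'' : r ≡ r'') → tr {A = A} e ⨾ tr e' ≡ tr e''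
  tr-⨾ refl e' e'' = trans (idˡ _) (tr-irrelevant e' e'')

  tr-natural : ∀ {r r' A B} (e : r ≡ r') (f : Hom A B) → tr e ⨾ !₁ r' f ≡ !₁ r f ⨾ tr e
  tr-natural refl f = trans (idˡ _) (sym (idʳ _))

  c-trˡ : ∀ {m m' n X} (q : m ≡ m') → c m n X ⨾ (tr q ⊗₁ id) ≡ tr (cong (_+ n) q) ⨾ c m' n X
  c-trˡ refl = trans (cong (c _ _ _ ⨾_) ⊗-id) (trans (idʳ _) (sym (idˡ _)))

  c-trʳ : ∀ {n m m' X} (q : m ≡ m') → c n m X ⨾ (id ⊗₁ tr q) ≡ tr (cong (n +_) q) ⨾ c n m' X
  c-trʳ refl = trans (cong (c _ _ _ ⨾_) ⊗-id) (trans (idʳ _) (sym (idˡ _)))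

  !⊗!-fuse : ∀ s t {A B C D E F} (f : Hom A B) (g : Hom B C) (h : Hom D E) (k : Hom E F) →
             (!₁ s f ⊗₁ !₁ t h) ⨾ (!₁ s g ⊗₁ !₁ t k) ≡ !₁ s (f ⨾ g) ⊗₁ !₁ t (h ⨾ k)
  !⊗!-fuse s t f g h k = trans (⊗-fuse _ _ _ _) (sym (!-comp s f g) ⟨⊗⟩ sym (!-comp t h k))

  c-counitʳ-natural : ∀ r {X A B} (f : Hom X A) (g : Hom X B) →
    tr (+-identityʳ r) ⨾ !₁ r f ≡ c r 0# X ⨾ (!₁ r f ⊗₁ !₁ 0# g) ⨾ (id ⊗₁ w B) ⨾ coe unitʳₒ
  c-counitʳ-natural r {X} f g = begin
    tr (+-identityʳ r) ⨾ !₁ r f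
      ≡⟨ cong (_⨾ !₁ r f) (sym (c-counitʳ r X)) ⟩
    c r 0# X ⨾ (id ⊗₁ w X) ⨾ coe unitʳₒ ⨾ !₁ r f
      ≡⟨ pullʳ (sym (unitʳₘ _)) ⟩
    c r 0# X ⨾ (id ⊗₁ w X) ⨾ ((!₁ r f ⊗₁ id) ⨾ coe unitʳₒ)
      ≡⟨ sym (⨾-assoc _ _ _) ⟩
    c r 0# X ⨾ (id ⊗₁ w X) ⨾ (!₁ r f ⊗₁ id) ⨾ coe unitʳₒ
      ≡⟨ cong (_⨾ coe unitʳₒ) (pullʳ interchange) ⟩
    c r 0# X ⨾ ((!₁ r f ⊗₁ !₁ 0# g) ⨾ (id ⊗₁ w _)) ⨾ coe unitʳₒ
      ≡⟨ cong (_⨾ coe unitʳₒ) (sym (⨾-assoc _ _ _)) ⟩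
    c r 0# X ⨾ (!₁ r f ⊗₁ !₁ 0# g) ⨾ (id ⊗₁ w _) ⨾ coe unitʳₒ ∎
    where
    interchange : (id ⊗₁ w X) ⨾ (!₁ r f ⊗₁ id) ≡ (!₁ r f ⊗₁ !₁ 0# g) ⨾ (id ⊗₁ w _)
    interchange = trans (⊗-fuse _ _ _ _)
      (trans (trans (idˡ _) (sym (idʳ _)) ⟨⊗⟩ trans (idʳ _) (sym (w-natural g))) (⊗-comp _ _ _ _))

  c-counitˡ-natural : ∀ r {X A B} (f : Hom X A) (g : Hom X B) →
    tr (+-identityˡ r) ⨾ !₁ r g ≡ c 0# r X ⨾ (!₁ 0# f ⊗₁ !₁ r g) ⨾ (w A ⊗₁ id) ⨾ coe unitˡₒ
  c-counitˡ-natural r {X} f g = begin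
    tr (+-identityˡ r) ⨾ !₁ r g
      ≡⟨ cong (_⨾ !₁ r g) (sym (c-counitˡ r X)) ⟩
    c 0# r X ⨾ (w X ⊗₁ id) ⨾ coe unitˡₒ ⨾ !₁ r g
      ≡⟨ pullʳ (sym (unitˡₘ _)) ⟩
    c 0# r X ⨾ (w X ⊗₁ id) ⨾ ((id ⊗₁ !₁ r g) ⨾ coe unitˡₒ)
      ≡⟨ sym (⨾-assoc _ _ _) ⟩
    c 0# r X ⨾ (w X ⊗₁ id) ⨾ (id ⊗₁ !₁ r g) ⨾ coe unitˡₒ
      ≡⟨ cong (_⨾ coe unitˡₒ) (pullʳ interchange) ⟩
    c 0# r X ⨾ ((!₁ 0# f ⊗₁ !₁ r g) ⨾ (w _ ⊗₁ id)) ⨾ coe unitˡₒ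
      ≡⟨ cong (_⨾ coe unitˡₒ) (sym (⨾-assoc _ _ _)) ⟩
    c 0# r X ⨾ (!₁ 0# f ⊗₁ !₁ r g) ⨾ (w _ ⊗₁ id) ⨾ coe unitˡₒ ∎
    where
    interchange : (w X ⊗₁ id) ⨾ (id ⊗₁ !₁ r g) ≡ (!₁ 0# f ⊗₁ !₁ r g) ⨾ (w _ ⊗₁ id)
    interchange = trans (⊗-fuse _ _ _ _)
      (trans (trans (idʳ _) (sym (w-natural f)) ⟨⊗⟩ trans (idˡ _) (sym (idʳ _))) (⊗-comp _ _ _ _))

  w-comultiplicative : ∀ A → tr (+-identityˡ 0#) ⨾ w A ≡ c 0# 0# A ⨾ (w A ⊗₁ w A) ⨾ coe unitˡₒ
  w-comultiplicative A = begin
    tr (+-identityˡ 0#) ⨾ w A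
      ≡⟨ cong (_⨾ w A) (sym (c-counitˡ 0# A)) ⟩
    c 0# 0# A ⨾ (w A ⊗₁ id) ⨾ coe unitˡₒ ⨾ w A
      ≡⟨ pullʳ (sym (unitˡₘ _)) ⟩
    c 0# 0# A ⨾ (w A ⊗₁ id) ⨾ ((id ⊗₁ w A) ⨾ coe unitˡₒ)
      ≡⟨ sym (⨾-assoc _ _ _) ⟩
    c 0# 0# A ⨾ (w A ⊗₁ id) ⨾ (id ⊗₁ w A) ⨾ coe unitˡₒ   ≡⟨ cong (_⨾ coe unitˡₒ) (pullʳ
                                                              (trans (⊗-fuse _ _ _ _) (idʳ _ ⟨⊗⟩ idˡ _))) ⟩
    c 0# 0# A ⨾ (w A ⊗₁ w A) ⨾ coe unitˡₒ ∎

  tr-trans : ∀ {r r' r'' A} (e : r ≡ r') (e' : r' ≡ r'') → tr {A = A} e ⨾ tr e' ≡ tr (trans e e')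
  tr-trans refl e' = idˡ _

  c-coassocʳ : ∀ a b m X →
    c a (b + m) X ⨾ (id ⊗₁ c b m X) ⨾ α⇐ ≡ tr (sym (+-assoc a b m)) ⨾ c (a + b) m X ⨾ (c a b X ⊗₁ id)
  c-coassocʳ a b m X =
    trans (cong (_⨾ α⇐) (sym (c-coassoc a b m X))) (trans (pullʳ (coe-inverseʳ assocₒ)) (idʳ _))

  c-coassocˡ : ∀ a b m X →
    c (a + b) m X ⨾ (c a b X ⊗₁ id) ⨾ α⇒ ≡ tr (+-assoc a b m) ⨾ c a (b + m) X ⨾ (id ⊗₁ c b m X)
  c-coassocˡ a b m X = begin
    c (a + b) m X ⨾ (c a b X ⊗₁ id) ⨾ α⇒
      ≡⟨ cong (λ x → x ⨾ (c a b X ⊗₁ id) ⨾ α⇒) (sym (idˡ _)) ⟩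
    id ⨾ c (a + b) m X ⨾ (c a b X ⊗₁ id) ⨾ α⇒
      ≡⟨ cong (λ x → x ⨾ c (a + b) m X ⨾ (c a b X ⊗₁ id) ⨾ α⇒) (sym (tr-⨾ (+-assoc a b m) _ refl)) ⟩
    tr (+-assoc a b m) ⨾ tr (sym (+-assoc a b m)) ⨾ c (a + b) m X ⨾ (c a b X ⊗₁ id) ⨾ α⇒
      ≡⟨ pullʳ₄ (c-coassoc a b m X) ⟩
    tr (+-assoc a b m) ⨾ (c a (b + m) X ⨾ (id ⊗₁ c b m X))
      ≡⟨ sym (⨾-assoc _ _ _) ⟩
    tr (+-assoc a b m) ⨾ c a (b + m) X ⨾ (id ⊗₁ c b m X) ∎

  c-exchange : ∀ a b m X (e : a + (b + m) ≡ b + (a + m)) →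
    c a (b + m) X ⨾ (id ⊗₁ c b m X) ⨾ swap₁₂ ≡ tr e ⨾ c b (a + m) X ⨾ (id ⊗₁ c a m X)
  c-exchange a b m X e = begin
    c a (b + m) X ⨾ (id ⊗₁ c b m X) ⨾ (α⇐ ⨾ (σ ⊗₁ id) ⨾ α⇒)
      ≡⟨ trans (sym (⨾-assoc _ _ _)) (cong (_⨾ α⇒) (sym (⨾-assoc _ _ _))) ⟩
    c a (b + m) X ⨾ (id ⊗₁ c b m X) ⨾ α⇐ ⨾ (σ ⊗₁ id) ⨾ α⇒
      ≡⟨ cong (λ x → x ⨾ (σ ⊗₁ id) ⨾ α⇒) (c-coassocʳ a b m X) ⟩
    tr e₁ ⨾ c (a + b) m X ⨾ (c a b X ⊗₁ id) ⨾ (σ ⊗₁ id) ⨾ α⇒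
      ≡⟨ cong (_⨾ α⇒) (pullʳ (trans (⊗id-fuse _ _) (trans (cong (_⊗₁ id) (c-cocomm a b X))
                                                       (sym (⊗id-fuse _ _))))) ⟩
    tr e₁ ⨾ c (a + b) m X ⨾ ((tr (+-comm a b) ⊗₁ id) ⨾ (c b a X ⊗₁ id)) ⨾ α⇒
      ≡⟨ cong (_⨾ α⇒) (trans (sym (⨾-assoc _ _ _)) (cong (_⨾ (c b a X ⊗₁ id)) (pullʳ (c-trˡ (+-comm a b))))) ⟩
    tr e₁ ⨾ (tr e₂ ⨾ c (b + a) m X) ⨾ (c b a X ⊗₁ id) ⨾ α⇒
      ≡⟨ cong (_⨾ α⇒) (cong (_⨾ (c b a X ⊗₁ id)) (sym (⨾-assoc _ _ _))) ⟩
    tr e₁ ⨾ tr e₂ ⨾ c (b + a) m X ⨾ (c b a X ⊗₁ id) ⨾ α⇒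
      ≡⟨ pullʳ₃ (c-coassocˡ b a m X) ⟩
    tr e₁ ⨾ tr e₂ ⨾ (tr (+-assoc b a m) ⨾ c b (a + m) X ⨾ (id ⊗₁ c a m X))
      ≡⟨ trans (sym (⨾-assoc _ _ _)) (cong (_⨾ (id ⊗₁ c a m X)) (sym (⨾-assoc _ _ _))) ⟩
    tr e₁ ⨾ tr e₂ ⨾ tr (+-assoc b a m) ⨾ c b (a + m) X ⨾ (id ⊗₁ c a m X)
      ≡⟨ cong (λ x → x ⨾ c b (a + m) X ⨾ (id ⊗₁ c a m X))
              (trans (cong (_⨾ tr (+-assoc b a m)) (tr-trans e₁ e₂)) (tr-⨾ _ _ e)) ⟩
    tr e ⨾ c b (a + m) X ⨾ (id ⊗₁ c a m X) ∎
    where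
    e₁ = sym (+-assoc a b m)
    e₂ = cong (_+ m) (+-comm a b)

  c-interchange : ∀ s t u v X (e : (s + u) + (t + v) ≡ (s + t) + (u + v)) →
    c (s + u) (t + v) X ⨾ (c s u X ⊗₁ c t v X)
      ≡ tr e ⨾ c (s + t) (u + v) X ⨾ (c s t X ⊗₁ c u v X) ⨾ mid
  c-interchange s t u v X e = sym (begin
    tr e ⨾ c (s + t) (u + v) X ⨾ (c s t X ⊗₁ c u v X) ⨾ (α⇒ ⨾ (id ⊗₁ swap₁₂) ⨾ α⇐)
      ≡⟨ trans (sym (⨾-assoc _ _ _)) (cong (_⨾ α⇐) (sym (⨾-assoc _ _ _))) ⟩
    tr e ⨾ c (s + t) (u + v) X ⨾ (c s t X ⊗₁ c u v X) ⨾ α⇒ ⨾ (id ⊗₁ swap₁₂) ⨾ α⇐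
      ≡⟨ cong (λ x → x ⨾ (id ⊗₁ swap₁₂) ⨾ α⇐) (trans (pullʳ split⇒) (sym (⨾-assoc _ _ _))) ⟩
    tr e ⨾ c (s + t) (u + v) X ⨾ ((c s t X ⊗₁ id) ⨾ α⇒) ⨾ (id ⊗₁ (id ⊗₁ c u v X)) ⨾ (id ⊗₁ swap₁₂) ⨾ α⇐
      ≡⟨ cong (λ x → x ⨾ (id ⊗₁ (id ⊗₁ c u v X)) ⨾ (id ⊗₁ swap₁₂) ⨾ α⇐)
              (trans (sym (⨾-assoc _ _ _)) (pullʳ₃ (c-coassocˡ s t (u + v) X))) ⟩
    tr e ⨾ (tr e₁ ⨾ c s (t + (u + v)) X ⨾ (id ⊗₁ c t (u + v) X))
      ⨾ (id ⊗₁ (id ⊗₁ c u v X)) ⨾ (id ⊗₁ swap₁₂) ⨾ α⇐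
      ≡⟨ cong (λ x → x ⨾ (id ⊗₁ (id ⊗₁ c u v X)) ⨾ (id ⊗₁ swap₁₂) ⨾ α⇐)
              (trans (sym (⨾-assoc _ _ _)) (cong (_⨾ (id ⊗₁ c t (u + v) X)) (sym (⨾-assoc _ _ _)))) ⟩
    tr e ⨾ tr e₁ ⨾ c s (t + (u + v)) X ⨾ (id ⊗₁ c t (u + v) X)
      ⨾ (id ⊗₁ (id ⊗₁ c u v X)) ⨾ (id ⊗₁ swap₁₂) ⨾ α⇐
      ≡⟨ cong (_⨾ α⇐) (pullʳ₃ exchange) ⟩
    tr e ⨾ tr e₁ ⨾ c s (t + (u + v)) X
      ⨾ ((id ⊗₁ tr e₂) ⨾ (id ⊗₁ c u (t + v) X) ⨾ (id ⊗₁ (id ⊗₁ c t v X))) ⨾ α⇐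
      ≡⟨ cong (_⨾ α⇐) (trans (sym (⨾-assoc _ _ _)) (cong (_⨾ (id ⊗₁ (id ⊗₁ c t v X)))
           (trans (sym (⨾-assoc _ _ _)) (cong (_⨾ (id ⊗₁ c u (t + v) X)) (pullʳ (c-trʳ e₂)))))) ⟩
    tr e ⨾ tr e₁ ⨾ (tr e₃ ⨾ c s (u + (t + v)) X) ⨾ (id ⊗₁ c u (t + v) X)
      ⨾ (id ⊗₁ (id ⊗₁ c t v X)) ⨾ α⇐
      ≡⟨ pullʳ split⇐ ⟩
    tr e ⨾ tr e₁ ⨾ (tr e₃ ⨾ c s (u + (t + v)) X) ⨾ (id ⊗₁ c u (t + v) X) ⨾ (α⇐ ⨾ (id ⊗₁ c t v X))
      ≡⟨ trans (sym (⨾-assoc _ _ _)) (cong (_⨾ (id ⊗₁ c t v X))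
           (cong (λ x → x ⨾ (id ⊗₁ c u (t + v) X) ⨾ α⇐) (sym (⨾-assoc _ _ _)))) ⟩
    tr e ⨾ tr e₁ ⨾ tr e₃ ⨾ c s (u + (t + v)) X ⨾ (id ⊗₁ c u (t + v) X) ⨾ α⇐ ⨾ (id ⊗₁ c t v X)
      ≡⟨ cong (_⨾ (id ⊗₁ c t v X)) (pullʳ₃ (c-coassocʳ s u (t + v) X)) ⟩
    tr e ⨾ tr e₁ ⨾ tr e₃ ⨾ (tr e₄ ⨾ c (s + u) (t + v) X ⨾ (c s u X ⊗₁ id)) ⨾ (id ⊗₁ c t v X)
      ≡⟨ trans (cong (_⨾ (id ⊗₁ c t v X)) (trans (sym (⨾-assoc _ _ _)) (cong (_⨾ (c s u X ⊗₁ id)) (sym (⨾-assoc _ _ _)))))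
               (⨾-assoc _ _ _) ⟩
    tr e ⨾ tr e₁ ⨾ tr e₃ ⨾ tr e₄ ⨾ c (s + u) (t + v) X ⨾ ((c s u X ⊗₁ id) ⨾ (id ⊗₁ c t v X))
      ≡⟨ cong₂ (λ x y → x ⨾ c (s + u) (t + v) X ⨾ y) trivial-tr (trans (⊗-fuse _ _ _ _) (idʳ _ ⟨⊗⟩ idˡ _)) ⟩
    id ⨾ c (s + u) (t + v) X ⨾ (c s u X ⊗₁ c t v X)
      ≡⟨ cong (_⨾ (c s u X ⊗₁ c t v X)) (idˡ _) ⟩
    c (s + u) (t + v) X ⨾ (c s u X ⊗₁ c t v X) ∎)
    where
    e₁ = +-assoc s t (u + v)
    e₂ = trans (sym (+-assoc t u v)) (trans (cong (_+ v) (+-comm t u)) (+-assoc u t v))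
    e₃ = cong (s +_) e₂
    e₄ = sym (+-assoc s u (t + v))

    split⇒ : (c s t X ⊗₁ c u v X) ⨾ α⇒ ≡ (c s t X ⊗₁ id) ⨾ α⇒ ⨾ (id ⊗₁ (id ⊗₁ c u v X))
    split⇒ = begin
      (c s t X ⊗₁ c u v X) ⨾ α⇒
        ≡⟨ cong (_⨾ α⇒) (⊗-split _ _) ⟩
      (c s t X ⊗₁ id) ⨾ (id ⊗₁ c u v X) ⨾ α⇒
        ≡⟨ cong (λ x → (c s t X ⊗₁ id) ⨾ (x ⊗₁ c u v X) ⨾ α⇒) (sym ⊗-id) ⟩
      (c s t X ⊗₁ id) ⨾ ((id ⊗₁ id) ⊗₁ c u v X) ⨾ α⇒
        ≡⟨ pullʳ (assocₘ _ _ _) ⟩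
      (c s t X ⊗₁ id) ⨾ (α⇒ ⨾ (id ⊗₁ (id ⊗₁ c u v X)))
        ≡⟨ sym (⨾-assoc _ _ _) ⟩
      (c s t X ⊗₁ id) ⨾ α⇒ ⨾ (id ⊗₁ (id ⊗₁ c u v X)) ∎

    exchange : (id ⊗₁ c t (u + v) X) ⨾ (id ⊗₁ (id ⊗₁ c u v X)) ⨾ (id ⊗₁ swap₁₂)
               ≡ (id ⊗₁ tr e₂) ⨾ (id ⊗₁ c u (t + v) X) ⨾ (id ⊗₁ (id ⊗₁ c t v X))
    exchange = begin
      (id ⊗₁ c t (u + v) X) ⨾ (id ⊗₁ (id ⊗₁ c u v X)) ⨾ (id ⊗₁ swap₁₂)
        ≡⟨ trans (cong (_⨾ (id ⊗₁ swap₁₂)) (id⊗-fuse _ _)) (id⊗-fuse _ _) ⟩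
      id ⊗₁ (c t (u + v) X ⨾ (id ⊗₁ c u v X) ⨾ swap₁₂)
        ≡⟨ cong (id ⊗₁_) (c-exchange t u v X e₂) ⟩
      id ⊗₁ (tr e₂ ⨾ c u (t + v) X ⨾ (id ⊗₁ c t v X))
        ≡⟨ sym (trans (cong (_⨾ (id ⊗₁ (id ⊗₁ c t v X))) (id⊗-fuse _ _)) (id⊗-fuse _ _)) ⟩
      (id ⊗₁ tr e₂) ⨾ (id ⊗₁ c u (t + v) X) ⨾ (id ⊗₁ (id ⊗₁ c t v X)) ∎

    split⇐ : (id ⊗₁ (id ⊗₁ c t v X)) ⨾ α⇐ ≡ α⇐ ⨾ (id ⊗₁ c t v X)
    split⇐ = trans (assocₘ⁻¹ _ _ _) (cong (α⇐ ⨾_) (⊗-id ⟨⊗⟩ refl))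

    trivial-tr : tr e ⨾ tr e₁ ⨾ tr e₃ ⨾ tr e₄ ≡ id
    trivial-tr = trans (cong (_⨾ tr e₄) (trans (cong (_⨾ tr e₃) (tr-trans e e₁)) (tr-trans _ e₃)))
                       (tr-⨾ _ e₄ refl)

  c-coassoc-natural : ∀ {X A B D} s u v {b} (e : u + v ≡ b) (e' : s + b ≡ (s + u) + v)
    (f : Hom X A) (g : Hom X B) (h : Hom X D) →
    c s b X ⨾ (!₁ s f ⊗₁ (tr (sym e) ⨾ c u v X ⨾ (!₁ u g ⊗₁ !₁ v h)))
      ≡ tr e' ⨾ c (s + u) v X ⨾ ((c s u X ⨾ (!₁ s f ⊗₁ !₁ u g)) ⊗₁ !₁ v h) ⨾ α⇒
  c-coassoc-natural {X} s u v refl e' f g h = begin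
    c s (u + v) X ⨾ (!₁ s f ⊗₁ (id ⨾ c u v X ⨾ (!₁ u g ⊗₁ !₁ v h)))
      ≡⟨ cong (λ x → c s (u + v) X ⨾ (!₁ s f ⊗₁ (x ⨾ (!₁ u g ⊗₁ !₁ v h)))) (idˡ _) ⟩
    c s (u + v) X ⨾ (!₁ s f ⊗₁ (c u v X ⨾ (!₁ u g ⊗₁ !₁ v h)))
      ≡⟨ cong (c s (u + v) X ⨾_) (trans (sym (idˡ _) ⟨⊗⟩ refl) (⊗-comp _ _ _ _)) ⟩
    c s (u + v) X ⨾ ((id ⊗₁ c u v X) ⨾ (!₁ s f ⊗₁ (!₁ u g ⊗₁ !₁ v h)))
      ≡⟨ sym (⨾-assoc _ _ _) ⟩
    c s (u + v) X ⨾ (id ⊗₁ c u v X) ⨾ (!₁ s f ⊗₁ (!₁ u g ⊗₁ !₁ v h))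
      ≡⟨ cong (_⨾ (!₁ s f ⊗₁ (!₁ u g ⊗₁ !₁ v h))) (sym (c-coassoc s u v X)) ⟩
    tr (sym (+-assoc s u v)) ⨾ c (s + u) v X ⨾ (c s u X ⊗₁ id) ⨾ α⇒ ⨾ (!₁ s f ⊗₁ (!₁ u g ⊗₁ !₁ v h))
      ≡⟨ trans (pullʳ (sym (assocₘ _ _ _))) (sym (⨾-assoc _ _ _)) ⟩
    tr (sym (+-assoc s u v)) ⨾ c (s + u) v X ⨾ (c s u X ⊗₁ id) ⨾ ((!₁ s f ⊗₁ !₁ u g) ⊗₁ !₁ v h) ⨾ α⇒
      ≡⟨ cong (_⨾ α⇒) (trans (⨾-assoc _ _ _)
           (cong₂ _⨾_ (cong (_⨾ c (s + u) v X) (tr-irrelevant _ _)) (trans (⊗-fuse _ _ _ _) (refl ⟨⊗⟩ idˡ _)))) ⟩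
    tr e' ⨾ c (s + u) v X ⨾ ((c s u X ⨾ (!₁ s f ⊗₁ !₁ u g)) ⊗₁ !₁ v h) ⨾ α⇒ ∎

module TensorBiproductLemmas {o ℓ} (C : AdditiveCategory o ℓ) (M : StrictSymmetricMonoidal C)
         (B : FiniteBiproducts C) where
  open AdditiveCategory C
  open StrictSymmetricMonoidal M
  open FiniteBiproducts B
  open CategoryLemmas C
  open MonoidalLemmas C M
  open ≡-Reasoning

  ⊗⨁-ext : ∀ {n X Y Z} (P Q : Hom Y (Z ⊗₀ ⨁ n X)) →
           (∀ i → P ⨾ (id ⊗₁ π X i) ≡ Q ⨾ (id ⊗₁ π X i)) → P ≡ Q
  ⊗⨁-ext {n} {X} P Q eq = begin
    P                                                  ≡⟨ expand P ⟩
    Σₕ n (λ i → P ⨾ (id ⊗₁ π X i) ⨾ (id ⊗₁ ι X i))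
      ≡⟨ Σₕ-cong n (λ i → cong (_⨾ (id ⊗₁ ι X i)) (eq i)) ⟩
    Σₕ n (λ i → Q ⨾ (id ⊗₁ π X i) ⨾ (id ⊗₁ ι X i))
      ≡⟨ sym (expand Q) ⟩
    Q                                                  ∎
    where
    expand : ∀ P → P ≡ Σₕ n (λ i → P ⨾ (id ⊗₁ π X i) ⨾ (id ⊗₁ ι X i))
    expand P = begin
      P                                                 ≡⟨ sym (idʳ P) ⟩
      P ⨾ id
        ≡⟨ cong (P ⨾_) (sym ⊗-id) ⟩
      P ⨾ (id ⊗₁ id)
        ≡⟨ cong (λ f → P ⨾ (id ⊗₁ f)) (sym (Σπ⨾ι X)) ⟩
      P ⨾ (id ⊗₁ Σₕ n (λ i → π X i ⨾ ι X i))
        ≡⟨ cong (P ⨾_) (⊗-distribˡ-Σₕ n id _) ⟩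
      P ⨾ Σₕ n (λ i → id ⊗₁ (π X i ⨾ ι X i))
        ≡⟨ ⨾-distribˡ-Σₕ n P _ ⟩
      Σₕ n (λ i → P ⨾ (id ⊗₁ (π X i ⨾ ι X i)))
        ≡⟨ Σₕ-cong n (λ i → trans (cong (P ⨾_) (sym (id⊗-fuse _ _)))
             (sym (⨾-assoc _ _ _))) ⟩
      Σₕ n (λ i → P ⨾ (id ⊗₁ π X i) ⨾ (id ⊗₁ ι X i)) ∎

module ChiLemmas {a o ℓ} (R : FASSemiring a) (C : AdditiveCategory o ℓ)
         (M : StrictSymmetricMonoidal C) (B : FiniteBiproducts C)
         (G : GradedCoalgebraModality R C M) where
  open FASSemiring R
  open AdditiveCategory C
  open StrictSymmetricMonoidal M
  open FiniteBiproducts B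
  open GradedCoalgebraModality G
  open Construction R C M B G using (Summand; Bigsum; ιD; χ-term; χ⊗)
  open CategoryLemmas C
  open BiproductLemmas C B
  open MonoidalLemmas C M
  open Decompositions R
  open ModalityLemmas R C M G
  open ≡-Reasoning

  Summands : ∀ r A B' → Fin (dec r) → Obj
  Summands r A B' i = Summand A B' (decomp r i)

  πD : ∀ r A B' (x : Decomp r) → Hom (Bigsum r A B') (Summand A B' x)
  πD r A B' x = π (Summands r A B') (index r x) ⨾ coe (cong (Summand A B') (decomp-index r x))

  ιD-decomp : ∀ r A B' i → ιD r A B' (decomp r i) ≡ ι (Summands r A B') i
  ιD-decomp r A B' i = go (index r (decomp r i)) (index-decomp r i) (decomp-index r (decomp r i))
    where
    go : ∀ j → j ≡ i → (P : decomp r j ≡ decomp r i) →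
         coe (cong (Summand A B') (sym P)) ⨾ ι (Summands r A B') j ≡ ι (Summands r A B') i
    go j refl refl = idˡ _

  πD-decomp : ∀ r A B' i → πD r A B' (decomp r i) ≡ π (Summands r A B') i
  πD-decomp r A B' i = go (index r (decomp r i)) (index-decomp r i) (decomp-index r (decomp r i))
    where
    go : ∀ j → j ≡ i → (P : decomp r j ≡ decomp r i) →
         π (Summands r A B') j ⨾ coe (cong (Summand A B') P) ≡ π (Summands r A B') i
    go j refl refl = idʳ _

  ιD⨾πD : ∀ r A B' x → ιD r A B' x ⨾ πD r A B' x ≡ id
  ιD⨾πD r A B' x = begin
    coe (cong S (sym P)) ⨾ ι X j ⨾ (π X j ⨾ coe (cong S P))
      ≡⟨ pullʳ (sym (⨾-assoc _ _ _)) ⟩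
    coe (cong S (sym P)) ⨾ (ι X j ⨾ π X j ⨾ coe (cong S P))
      ≡⟨ cong (λ f → coe (cong S (sym P)) ⨾ (f ⨾ coe (cong S P))) (ι⨾π-same X j) ⟩
    coe (cong S (sym P)) ⨾ (id ⨾ coe (cong S P))
      ≡⟨ cong (coe (cong S (sym P)) ⨾_) (idˡ _) ⟩
    coe (cong S (sym P)) ⨾ coe (cong S P)
      ≡⟨ cancel P ⟩
    id ∎
    where
    S = Summand A B'
    X = Summands r A B'
    j = index r x
    P = decomp-index r x
    cancel : ∀ {y z} (p : y ≡ z) → coe (cong S (sym p)) ⨾ coe (cong S p) ≡ id
    cancel refl = idˡ id

  ιD⨾πD-≢ : ∀ r A B' x y → x ≢ y → ιD r A B' x ⨾ πD r A B' y ≡ 0ₕ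
  ιD⨾πD-≢ r A B' x y x≢y = begin
    coe (cong S (sym P)) ⨾ ι X (index r x) ⨾ (π X (index r y) ⨾ Q)
      ≡⟨ pullʳ (sym (⨾-assoc _ _ _)) ⟩
    coe (cong S (sym P)) ⨾ (ι X (index r x) ⨾ π X (index r y) ⨾ Q)
      ≡⟨ cong (λ f → coe (cong S (sym P)) ⨾ (f ⨾ Q))
           (ι⨾π-diff X _ _ (λ q → x≢y (index-injective r q))) ⟩
    coe (cong S (sym P)) ⨾ (0ₕ ⨾ Q)
      ≡⟨ cong (coe (cong S (sym P)) ⨾_) (⨾-zeroˡ Q) ⟩
    coe (cong S (sym P)) ⨾ 0ₕ
      ≡⟨ ⨾-zeroʳ _ ⟩
    0ₕ ∎
    where
    S = Summand A B'
    X = Summands r A B'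
    P = decomp-index r x
    Q = coe (cong S (decomp-index r y))

  Bigsum-ext : ∀ {Y} r A B' (P Q : Hom Y (Bigsum r A B')) →
               (∀ x → P ⨾ πD r A B' x ≡ Q ⨾ πD r A B' x) → P ≡ Q
  Bigsum-ext r A B' P Q eq = ⨁-ext P Q λ i →
    subst (λ p → P ⨾ p ≡ Q ⨾ p) (πD-decomp r A B' i) (eq (decomp r i))

  χ⊗-as-Σ : ∀ r A B' → χ⊗ r A B' ≡ Σₕ (dec r) (λ i → χ-term A B' (decomp r i) ⨾ ιD r A B' (decomp r i))
  χ⊗-as-Σ r A B' = Σₕ-cong (dec r) (λ i → cong (χ-term A B' (decomp r i) ⨾_) (sym (ιD-decomp r A B' i)))

  Σₕ-Decomp-single : ∀ {X Y} r (F : Decomp r → Hom X Y) y → (∀ z → z ≢ y → F z ≡ 0ₕ) →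
                     Σₕ (dec r) (λ i → F (decomp r i)) ≡ F y
  Σₕ-Decomp-single r F y eq =
    trans (Σₕ-single (dec r) _ (index r y)
            (λ i ne → eq (decomp r i) (λ q → ne (trans (sym (index-decomp r i)) (cong (index r) q)))))
          (cong F (decomp-index r y))

  χ⊗⨾πD : ∀ r A B' y → χ⊗ r A B' ⨾ πD r A B' y ≡ χ-term A B' y
  χ⊗⨾πD r A B' y = begin
    χ⊗ r A B' ⨾ πD r A B' y
      ≡⟨ cong (_⨾ πD r A B' y) (χ⊗-as-Σ r A B') ⟩
    Σₕ (dec r) (λ i → χ-term A B' (decomp r i) ⨾ ιD r A B' (decomp r i)) ⨾ πD r A B' y
      ≡⟨ ⨾-distribʳ-Σₕ (dec r) _ _ ⟩
    Σₕ (dec r) (λ i → χ-term A B' (decomp r i) ⨾ ιD r A B' (decomp r i) ⨾ πD r A B' y)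
      ≡⟨ Σₕ-Decomp-single r (λ z → χ-term A B' z ⨾ ιD r A B' z ⨾ πD r A B' y) y
           (λ z z≢y → trans (pullʳ (ιD⨾πD-≢ r A B' z y z≢y)) (⨾-zeroʳ _)) ⟩
    χ-term A B' y ⨾ ιD r A B' y ⨾ πD r A B' y
      ≡⟨ trans (pullʳ (ιD⨾πD r A B' y)) (idʳ _) ⟩
    χ-term A B' y ∎

  -- χ-term A B' y is definitionally χ-along π₀ π₁ y.
  χ-along : ∀ {r X A B'} → Hom X A → Hom X B' → (y : Decomp r) → Hom (!₀ r X) (Summand A B' y)
  χ-along {X = X} f g ((s , t) , e) = tr (sym e) ⨾ c s t X ⨾ (!₁ s f ⊗₁ !₁ t g)


  !⨾χ-along : ∀ {r X Y A B'} (h : Hom X Y) (f : Hom Y A) (g : Hom Y B') (y : Decomp r) →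
              !₁ r h ⨾ χ-along f g y ≡ χ-along (h ⨾ f) (h ⨾ g) y
  !⨾χ-along h f g ((s , t) , refl) = begin
    !₁ (s + t) h ⨾ (id ⨾ c s t _ ⨾ (!₁ s f ⊗₁ !₁ t g))
      ≡⟨ cong (!₁ (s + t) h ⨾_) (cong (_⨾ _) (idˡ _)) ⟩
    !₁ (s + t) h ⨾ (c s t _ ⨾ (!₁ s f ⊗₁ !₁ t g))
      ≡⟨ sym (⨾-assoc _ _ _) ⟩
    !₁ (s + t) h ⨾ c s t _ ⨾ (!₁ s f ⊗₁ !₁ t g)
      ≡⟨ cong (_⨾ _) (c-natural s t h) ⟩
    c s t _ ⨾ (!₁ s h ⊗₁ !₁ t h) ⨾ (!₁ s f ⊗₁ !₁ t g)
      ≡⟨ pullʳ (!⊗!-fuse s t _ _ _ _) ⟩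
    c s t _ ⨾ (!₁ s (h ⨾ f) ⊗₁ !₁ t (h ⨾ g))
      ≡⟨ cong (_⨾ _) (sym (idˡ _)) ⟩
    id ⨾ c s t _ ⨾ (!₁ s (h ⨾ f) ⊗₁ !₁ t (h ⨾ g)) ∎

  χ-along⨾ : ∀ {r X A B' A' B''} (f : Hom X A) (g : Hom X B') (f' : Hom A A') (g' : Hom B' B'')
             (y : Decomp r) → χ-along f g y ⨾ (!₁ (left y) f' ⊗₁ !₁ (right y) g') ≡ χ-along (f ⨾ f') (g ⨾ g') y
  χ-along⨾ f g f' g' ((s , t) , e) = pullʳ (!⊗!-fuse s t _ _ _ _)

  χ-along⨾σ : ∀ {r X A B'} (f : Hom X A) (g : Hom X B') (y : Decomp r) →
              χ-along f g y ⨾ σ ≡ χ-along g f (swapD y)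
  χ-along⨾σ {X = X} f g ((s , t) , e) = begin
    tr (sym e) ⨾ c s t X ⨾ (!₁ s f ⊗₁ !₁ t g) ⨾ σ
      ≡⟨ pullʳ (σ-natural _ _) ⟩
    tr (sym e) ⨾ c s t X ⨾ (σ ⨾ (!₁ t g ⊗₁ !₁ s f))
      ≡⟨ sym (⨾-assoc _ _ _) ⟩
    tr (sym e) ⨾ c s t X ⨾ σ ⨾ (!₁ t g ⊗₁ !₁ s f)
      ≡⟨ cong (_⨾ (!₁ t g ⊗₁ !₁ s f)) (pullʳ (c-cocomm s t X)) ⟩
    tr (sym e) ⨾ (tr (+-comm s t) ⨾ c t s X) ⨾ (!₁ t g ⊗₁ !₁ s f)
      ≡⟨ cong (_⨾ (!₁ t g ⊗₁ !₁ s f)) (trans (sym (⨾-assoc _ _ _)) (cong (_⨾ c t s X) (tr-⨾ _ _ _))) ⟩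
    tr (sym (trans (+-comm t s) e)) ⨾ c t s X ⨾ (!₁ t g ⊗₁ !₁ s f) ∎

  χ-along-swapD⨾σ : ∀ {r X A B'} (f : Hom X A) (g : Hom X B') (y : Decomp r) →
                    χ-along f g (swapD y) ⨾ σ ≡ χ-along g f y
  χ-along-swapD⨾σ {X = X} f g y@((s , t) , e) =
    trans (χ-along⨾σ f g (swapD y)) (cong (λ h → h ⨾ c s t X ⨾ (!₁ s g ⊗₁ !₁ t f)) (tr-irrelevant _ _))

  χ-term-natural : ∀ {r A B' C' D'} (f : Hom A C') (g : Hom B' D') (y : Decomp r) →
    !₁ r (f ⊕₁ g) ⨾ χ-term C' D' y ≡ χ-term A B' y ⨾ (!₁ (left y) f ⊗₁ !₁ (right y) g)
  χ-term-natural f g y = begin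
    !₁ _ (f ⊕₁ g) ⨾ χ-along π₀ π₁ y
      ≡⟨ !⨾χ-along (f ⊕₁ g) π₀ π₁ y ⟩
    χ-along (f ⊕₁ g ⨾ π₀) (f ⊕₁ g ⨾ π₁) y
      ≡⟨ cong₂ (λ f' g' → χ-along f' g' y) (⟨,⟩⨾π₀ _ _) (⟨,⟩⨾π₁ _ _) ⟩
    χ-along (π₀ ⨾ f) (π₁ ⨾ g) y
      ≡⟨ sym (χ-along⨾ π₀ π₁ f g y) ⟩
    χ-along π₀ π₁ y ⨾ (!₁ (left y) f ⊗₁ !₁ (right y) g) ∎

  χ-term-pairD : ∀ s t A B' → χ-term A B' (pairD s t) ≡ c s t (A ⊕ B') ⨾ (!₁ s π₀ ⊗₁ !₁ t π₁)
  χ-term-pairD s t A B' = trans (⨾-assoc _ _ _) (idˡ _)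

  ⊕-assoc⨾χ-term₃ : ∀ {m A B' D} a b u v (e : a + b ≡ m) (e₂ : u + v ≡ b) (e₃ : (a + u) + v ≡ m) →
    !₁ m (⊕-assoc {A} {B'} {D}) ⨾ χ-term A (B' ⊕ D) ((a , b) , e) ⨾ (id ⊗₁ χ-term B' D ((u , v) , e₂))
      ≡ χ-term (A ⊕ B') D ((a + u , v) , e₃) ⨾ (χ-term A B' (pairD a u) ⊗₁ id) ⨾ α⇒
  ⊕-assoc⨾χ-term₃ {m} {A} {B'} {D} a b u v e e₂ e₃ = begin
    !₁ m ⊕-assoc ⨾ χ-term A (B' ⊕ D) y ⨾ (id ⊗₁ χ-term B' D z)
      ≡⟨ cong (_⨾ (id ⊗₁ χ-term B' D z)) (trans (!⨾χ-along ⊕-assoc π₀ π₁ y)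
           (cong₂ (λ f g → χ-along f g y) (⟨,⟩⨾π₀ _ _) (⟨,⟩⨾π₁ _ _))) ⟩
    tr (sym e) ⨾ c a b X ⨾ (!₁ a (π₀ ⨾ π₀) ⊗₁ !₁ b β) ⨾ (id ⊗₁ χ-term B' D z)
      ≡⟨ pullʳ (trans (⊗-fuse _ _ _ _) (cong₂ _⊗₁_ (idʳ _) (trans (!⨾χ-along β π₀ π₁ z)
           (cong₂ (λ f g → χ-along f g z) (⟨,⟩⨾π₀ _ _) (⟨,⟩⨾π₁ _ _))))) ⟩
    tr (sym e) ⨾ c a b X ⨾ (!₁ a (π₀ ⨾ π₀) ⊗₁ (tr (sym e₂) ⨾ c u v X ⨾ (!₁ u (π₀ ⨾ π₁) ⊗₁ !₁ v π₁)))
      ≡⟨ pullʳ (c-coassoc-natural a u v e₂ e₁ _ _ _) ⟩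
    tr (sym e) ⨾ (tr e₁ ⨾ c (a + u) v X ⨾ ((c a u X ⨾ (!₁ a (π₀ ⨾ π₀) ⊗₁ !₁ u (π₀ ⨾ π₁))) ⊗₁ !₁ v π₁) ⨾ α⇒)
      ≡⟨ cong (λ f → tr (sym e) ⨾ (tr e₁ ⨾ c (a + u) v X ⨾ f ⨾ α⇒)) inner ⟩
    tr (sym e) ⨾ (tr e₁ ⨾ c (a + u) v X ⨾ ((!₁ (a + u) π₀ ⊗₁ !₁ v π₁) ⨾ (χ-term A B' (pairD a u) ⊗₁ id)) ⨾ α⇒)
      ≡⟨ sym (pullʳ₄ refl) ⟩
    tr (sym e) ⨾ tr e₁ ⨾ c (a + u) v X ⨾ ((!₁ (a + u) π₀ ⊗₁ !₁ v π₁) ⨾ (χ-term A B' (pairD a u) ⊗₁ id)) ⨾ α⇒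
      ≡⟨ cong (_⨾ α⇒) (trans (sym (⨾-assoc _ _ _)) (cong (λ f → f ⨾ c (a + u) v X ⨾ _ ⨾ _) (tr-⨾ _ _ _))) ⟩
    χ-term (A ⊕ B') D ((a + u , v) , e₃) ⨾ (χ-term A B' (pairD a u) ⊗₁ id) ⨾ α⇒ ∎
    where
    X = (A ⊕ B') ⊕ D
    y = ((a , b) , e)
    z = ((u , v) , e₂)
    β : Hom X (B' ⊕ D)
    β = ⟨ π₀ ⨾ π₁ , π₁ ⟩
    e₁ = trans (cong (a +_) (sym e₂)) (sym (+-assoc a u v))

    inner : (c a u X ⨾ (!₁ a (π₀ ⨾ π₀) ⊗₁ !₁ u (π₀ ⨾ π₁))) ⊗₁ !₁ v π₁
            ≡ (!₁ (a + u) π₀ ⊗₁ !₁ v π₁) ⨾ (χ-term A B' (pairD a u) ⊗₁ id)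
    inner = begin
      (c a u X ⨾ (!₁ a (π₀ ⨾ π₀) ⊗₁ !₁ u (π₀ ⨾ π₁))) ⊗₁ !₁ v π₁
        ≡⟨ cong (_⊗₁ !₁ v π₁) (sym (trans (!⨾χ-along π₀ π₀ π₁ (pairD a u)) (trans (⨾-assoc _ _ _) (idˡ _)))) ⟩
      (!₁ (a + u) π₀ ⨾ χ-term A B' (pairD a u)) ⊗₁ !₁ v π₁
        ≡⟨ trans (refl ⟨⊗⟩ sym (idʳ _)) (⊗-comp _ _ _ _) ⟩
      (!₁ (a + u) π₀ ⊗₁ !₁ v π₁) ⨾ (χ-term A B' (pairD a u) ⊗₁ id) ∎

  tr⨾χ-term : ∀ {m m' A B'} (k : m ≡ m') (y : Decomp m') →
              tr k ⨾ χ-term A B' y ≡ χ-term A B' (proj₁ y , trans (proj₂ y) (sym k))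
  tr⨾χ-term k ((s , t) , e) =
    trans (sym (⨾-assoc _ _ _)) (cong (_⨾ (!₁ s π₀ ⊗₁ !₁ t π₁))
      (trans (sym (⨾-assoc _ _ _)) (cong (_⨾ c s t _) (tr-⨾ _ _ _))))

  tr⨾!π₀⨾d : ∀ {m A B'} (h : m ≡ 1#) →
    tr h ⨾ !₁ 1# (π₀ {A} {B'}) ⨾ d A ≡ χ-term A B' (D₁₀ h) ⨾ ((d A ⊗₁ w B') ⨾ coe unitʳₒ)
  tr⨾!π₀⨾d {A = A} {B'} h = begin
    tr h ⨾ !₁ 1# π₀ ⨾ d A
      ≡⟨ cong (λ f → f ⨾ !₁ 1# π₀ ⨾ d A) (sym (tr-⨾ (sym e) (+-identityʳ 1#) h)) ⟩
    tr (sym e) ⨾ tr (+-identityʳ 1#) ⨾ !₁ 1# π₀ ⨾ d A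
      ≡⟨ cong (_⨾ d A) (pullʳ (c-counitʳ-natural 1# π₀ π₁)) ⟩
    tr (sym e) ⨾ (c 1# 0# _ ⨾ (!₁ 1# π₀ ⊗₁ !₁ 0# π₁) ⨾ (id ⊗₁ w B') ⨾ coe unitʳₒ) ⨾ d A
      ≡⟨ trans (cong (_⨾ d A) (sym (pullʳ₄ refl))) (trans (⨾-assoc _ _ _) (⨾-assoc _ _ _)) ⟩
    χ-term A B' (D₁₀ h) ⨾ ((id ⊗₁ w B') ⨾ (coe unitʳₒ ⨾ d A))
      ≡⟨ cong (χ-term A B' (D₁₀ h) ⨾_) (trans (cong ((id ⊗₁ w B') ⨾_) (sym (unitʳₘ (d A))))
           (trans (sym (⨾-assoc _ _ _)) (cong (_⨾ coe unitʳₒ) (trans (⊗-fuse _ _ _ _) (idˡ _ ⟨⊗⟩ idʳ _))))) ⟩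
    χ-term A B' (D₁₀ h) ⨾ ((d A ⊗₁ w B') ⨾ coe unitʳₒ) ∎
    where e = proj₂ (D₁₀ h)

  tr⨾!π₁⨾d : ∀ {m A B'} (h : m ≡ 1#) →
    tr h ⨾ !₁ 1# (π₁ {A} {B'}) ⨾ d B' ≡ χ-term A B' (D₀₁ h) ⨾ ((w A ⊗₁ d B') ⨾ coe unitˡₒ)
  tr⨾!π₁⨾d {A = A} {B'} h = begin
    tr h ⨾ !₁ 1# π₁ ⨾ d B'
      ≡⟨ cong (λ f → f ⨾ !₁ 1# π₁ ⨾ d B') (sym (tr-⨾ (sym e) (+-identityˡ 1#) h)) ⟩
    tr (sym e) ⨾ tr (+-identityˡ 1#) ⨾ !₁ 1# π₁ ⨾ d B'
      ≡⟨ cong (_⨾ d B') (pullʳ (c-counitˡ-natural 1# π₀ π₁)) ⟩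
    tr (sym e) ⨾ (c 0# 1# _ ⨾ (!₁ 0# π₀ ⊗₁ !₁ 1# π₁) ⨾ (w A ⊗₁ id) ⨾ coe unitˡₒ) ⨾ d B'
      ≡⟨ trans (cong (_⨾ d B') (sym (pullʳ₄ refl))) (trans (⨾-assoc _ _ _) (⨾-assoc _ _ _)) ⟩
    χ-term A B' (D₀₁ h) ⨾ ((w A ⊗₁ id) ⨾ (coe unitˡₒ ⨾ d B'))
      ≡⟨ cong (χ-term A B' (D₀₁ h) ⨾_) (trans (cong ((w A ⊗₁ id) ⨾_) (sym (unitˡₘ (d B'))))
           (trans (sym (⨾-assoc _ _ _)) (cong (_⨾ coe unitˡₒ) (trans (⊗-fuse _ _ _ _) (idʳ _ ⟨⊗⟩ idˡ _))))) ⟩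
    χ-term A B' (D₀₁ h) ⨾ ((w A ⊗₁ d B') ⨾ coe unitˡₒ) ∎
    where e = proj₂ (D₀₁ h)

  !∇⨾d : ∀ {A} → !₁ 1# ∇ ⨾ d A ≡ (!₁ 1# π₀ ⨾ d A) +ₕ (!₁ 1# π₁ ⨾ d A)
  !∇⨾d = trans (d-natural ∇) (trans (⨾-distribˡ _ _ _) (cong₂ _+ₕ_ (sym (d-natural π₀)) (sym (d-natural π₁))))

  coe-Summand : ∀ {r} A B' {x y : Decomp r} (p : x ≡ y) →
                coe (cong (Summand A B') p) ≡ tr {A = A} (cong left p) ⊗₁ tr {A = B'} (cong right p)
  coe-Summand A B' refl = sym ⊗-id

  c⨾χ-term⊗χ-term : ∀ {m A} a₁ a₂ a₃ a₄ t u (h : m ≡ t + u)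
    (e₁ : a₁ + a₃ ≡ t) (e₂ : a₂ + a₄ ≡ u) (e : (a₁ + a₂) + (a₃ + a₄) ≡ m) →
    tr h ⨾ c t u (A ⊕ A) ⨾ (χ-term A A ((a₁ , a₃) , e₁) ⊗₁ χ-term A A ((a₂ , a₄) , e₂))
      ≡ χ-term A A ((a₁ + a₂ , a₃ + a₄) , e) ⨾ (c a₁ a₂ A ⊗₁ c a₃ a₄ A) ⨾ mid
  c⨾χ-term⊗χ-term {m} {A} a₁ a₂ a₃ a₄ _ _ h refl refl e = begin
    tr h ⨾ c (a₁ + a₃) (a₂ + a₄) X ⨾ ((id ⨾ c a₁ a₃ X ⨾ Π₁₃) ⊗₁ (id ⨾ c a₂ a₄ X ⨾ Π₂₄))
      ≡⟨ cong (tr h ⨾ c (a₁ + a₃) (a₂ + a₄) X ⨾_)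
              (trans (cong (_⨾ Π₁₃) (idˡ _) ⟨⊗⟩ cong (_⨾ Π₂₄) (idˡ _)) (⊗-comp _ _ _ _)) ⟩
    tr h ⨾ c (a₁ + a₃) (a₂ + a₄) X ⨾ ((c a₁ a₃ X ⊗₁ c a₂ a₄ X) ⨾ (Π₁₃ ⊗₁ Π₂₄))
      ≡⟨ sym (⨾-assoc _ _ _) ⟩
    tr h ⨾ c (a₁ + a₃) (a₂ + a₄) X ⨾ (c a₁ a₃ X ⊗₁ c a₂ a₄ X) ⨾ (Π₁₃ ⊗₁ Π₂₄)
      ≡⟨ cong (_⨾ (Π₁₃ ⊗₁ Π₂₄)) (trans (pullʳ (c-interchange a₁ a₂ a₃ a₄ X e')) (sym (pullʳ₄ refl))) ⟩
    tr h ⨾ tr e' ⨾ c (a₁ + a₂) (a₃ + a₄) X ⨾ (c a₁ a₂ X ⊗₁ c a₃ a₄ X) ⨾ mid ⨾ (Π₁₃ ⊗₁ Π₂₄)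
      ≡⟨ trans (pullʳ (sym (mid-natural _ _ _ _))) (sym (⨾-assoc _ _ _)) ⟩
    tr h ⨾ tr e' ⨾ c (a₁ + a₂) (a₃ + a₄) X ⨾ (c a₁ a₂ X ⊗₁ c a₃ a₄ X)
      ⨾ ((!₁ a₁ π₀ ⊗₁ !₁ a₂ π₀) ⊗₁ (!₁ a₃ π₁ ⊗₁ !₁ a₄ π₁)) ⨾ mid
      ≡⟨ cong (_⨾ mid) (trans (pullʳ c⊗c-natural) (sym (⨾-assoc _ _ _))) ⟩
    tr h ⨾ tr e' ⨾ c (a₁ + a₂) (a₃ + a₄) X ⨾ (!₁ (a₁ + a₂) π₀ ⊗₁ !₁ (a₃ + a₄) π₁) ⨾ (c a₁ a₂ A ⊗₁ c a₃ a₄ A) ⨾ mid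
      ≡⟨ cong (λ f → f ⨾ c (a₁ + a₂) (a₃ + a₄) X ⨾ (!₁ (a₁ + a₂) π₀ ⊗₁ !₁ (a₃ + a₄) π₁) ⨾ (c a₁ a₂ A ⊗₁ c a₃ a₄ A) ⨾ mid)
              (tr-⨾ _ _ _) ⟩
    χ-term A A ((a₁ + a₂ , a₃ + a₄) , e) ⨾ (c a₁ a₂ A ⊗₁ c a₃ a₄ A) ⨾ mid ∎
    where
    X = A ⊕ A
    Π₁₃ = !₁ a₁ π₀ ⊗₁ !₁ a₃ π₁
    Π₂₄ = !₁ a₂ π₀ ⊗₁ !₁ a₄ π₁

    e' : (a₁ + a₃) + (a₂ + a₄) ≡ (a₁ + a₂) + (a₃ + a₄)
    e' = trans (sym h) (sym e)

    c⊗c-natural : (c a₁ a₂ X ⊗₁ c a₃ a₄ X) ⨾ ((!₁ a₁ π₀ ⊗₁ !₁ a₂ π₀) ⊗₁ (!₁ a₃ π₁ ⊗₁ !₁ a₄ π₁))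
                  ≡ (!₁ (a₁ + a₂) π₀ ⊗₁ !₁ (a₃ + a₄) π₁) ⨾ (c a₁ a₂ A ⊗₁ c a₃ a₄ A)
    c⊗c-natural = trans (⊗-fuse _ _ _ _)
      (trans (sym (c-natural a₁ a₂ π₀) ⟨⊗⟩ sym (c-natural a₃ a₄ π₁)) (⊗-comp _ _ _ _))

module Proof {ℓᵣ o ℓ} (R : FASSemiring ℓᵣ) (C : AdditiveCategory o ℓ)
    (M : StrictSymmetricMonoidal C) (B : FiniteBiproducts C)
    (G : GradedCoalgebraModality R C M)
    (isoχ : ∀ r A B' → AdditiveCategory.IsIso C (Construction.χ⊗ R C M B G r A B'))
    (isoI : AdditiveCategory.IsIso C (Construction.χI R C M B G)) where
  open FASSemiring R
  open AdditiveCategory C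
  open StrictSymmetricMonoidal M
  open FiniteBiproducts B
  open GradedCoalgebraModality G
  open Construction R C M B G using (Summand; Bigsum; ιD; χ-term; χ⊗)
  open CategoryLemmas C
  open BiproductLemmas C B
  open MonoidalLemmas C M
  open TensorBiproductLemmas C M B
  open Decompositions R
  open ModalityLemmas R C M G
  open ChiLemmas R C M B G
  open ≡-Reasoning

  c̄ : ∀ r s A → Hom (!₀ r A ⊗₀ !₀ s A) (!₀ (r + s) A)
  c̄ = Construction.c̄ R C M B G isoχ

  w̄ : ∀ A → Hom I (!₀ 0# A)
  w̄ = Construction.w̄ R C M B G isoI

  χ⁻¹ : ∀ r A B' → Hom (Bigsum r A B') (!₀ r (A ⊕ B'))
  χ⁻¹ r A B' = proj₁ (isoχ r A B')

  χ⨾χ⁻¹ : ∀ r A B' → χ⊗ r A B' ⨾ χ⁻¹ r A B' ≡ id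
  χ⨾χ⁻¹ r A B' = proj₁ (proj₂ (isoχ r A B'))

  χ⁻¹⨾χ : ∀ r A B' → χ⁻¹ r A B' ⨾ χ⊗ r A B' ≡ id
  χ⁻¹⨾χ r A B' = proj₂ (proj₂ (isoχ r A B'))

  χI⁻¹ : Hom I (!₀ 0# 𝟘)
  χI⁻¹ = proj₁ isoI

  χI⨾χI⁻¹ : w 𝟘 ⨾ χI⁻¹ ≡ id
  χI⨾χI⁻¹ = proj₁ (proj₂ isoI)

  χI⁻¹⨾χI : χI⁻¹ ⨾ w 𝟘 ≡ id
  χI⁻¹⨾χI = proj₂ (proj₂ isoI)

  χ-ext : ∀ {X} r A B' (U V : Hom X (!₀ r (A ⊕ B'))) →
          (∀ y → U ⨾ χ-term A B' y ≡ V ⨾ χ-term A B' y) → U ≡ V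
  χ-ext r A B' U V eq = begin
    U                                  ≡⟨ sym (trans (pullʳ (χ⨾χ⁻¹ r A B')) (idʳ U)) ⟩
    U ⨾ χ⊗ r A B' ⨾ χ⁻¹ r A B'         ≡⟨ cong (_⨾ χ⁻¹ r A B') U⨾χ≡V⨾χ ⟩
    V ⨾ χ⊗ r A B' ⨾ χ⁻¹ r A B'         ≡⟨ trans (pullʳ (χ⨾χ⁻¹ r A B')) (idʳ V) ⟩
    V                                  ∎
    where
    U⨾χ≡V⨾χ : U ⨾ χ⊗ r A B' ≡ V ⨾ χ⊗ r A B'
    U⨾χ≡V⨾χ = Bigsum-ext r A B' _ _ λ y →
      trans (pullʳ (χ⊗⨾πD r A B' y)) (trans (eq y) (sym (pullʳ (χ⊗⨾πD r A B' y))))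

  χ-ext-⊗ : ∀ {X Z} r A B' (U V : Hom X (Z ⊗₀ !₀ r (A ⊕ B'))) →
            (∀ y → U ⨾ (id ⊗₁ χ-term A B' y) ≡ V ⨾ (id ⊗₁ χ-term A B' y)) → U ≡ V
  χ-ext-⊗ r A B' U V eq = begin
    U                                              ≡⟨ sym (cancel U) ⟩
    U ⨾ (id ⊗₁ χ⊗ r A B') ⨾ (id ⊗₁ χ⁻¹ r A B')     ≡⟨ cong (_⨾ (id ⊗₁ χ⁻¹ r A B')) U⨾χ≡V⨾χ ⟩
    V ⨾ (id ⊗₁ χ⊗ r A B') ⨾ (id ⊗₁ χ⁻¹ r A B')     ≡⟨ cancel V ⟩
    V                                              ∎
    where
    cancel : ∀ W → W ⨾ (id ⊗₁ χ⊗ r A B') ⨾ (id ⊗₁ χ⁻¹ r A B') ≡ W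
    cancel W = trans (pullʳ (trans (id⊗-fuse _ _) (trans (cong (id ⊗₁_) (χ⨾χ⁻¹ r A B')) ⊗-id))) (idʳ W)

    component : ∀ W i → W ⨾ (id ⊗₁ χ⊗ r A B') ⨾ (id ⊗₁ π (Summands r A B') i)
                        ≡ W ⨾ (id ⊗₁ χ-term A B' (decomp r i))
    component W i = pullʳ (trans (id⊗-fuse _ _) (cong (id ⊗₁_)
      (trans (cong (χ⊗ r A B' ⨾_) (sym (πD-decomp r A B' i))) (χ⊗⨾πD r A B' (decomp r i)))))

    U⨾χ≡V⨾χ : U ⨾ (id ⊗₁ χ⊗ r A B') ≡ V ⨾ (id ⊗₁ χ⊗ r A B')
    U⨾χ≡V⨾χ = ⊗⨁-ext _ _ λ i →
      trans (component U i) (trans (eq (decomp r i)) (sym (component V i)))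

  inj : ∀ r A B' (x : Decomp r) → Hom (Summand A B' x) (!₀ r (A ⊕ B'))
  inj r A B' x = ιD r A B' x ⨾ χ⁻¹ r A B'

  inj⨾χ-term-via-πD : ∀ r A B' x y → inj r A B' x ⨾ χ-term A B' y ≡ ιD r A B' x ⨾ πD r A B' y
  inj⨾χ-term-via-πD r A B' x y = begin
    ιD r A B' x ⨾ χ⁻¹ r A B' ⨾ χ-term A B' y
      ≡⟨ cong (ιD r A B' x ⨾ χ⁻¹ r A B' ⨾_) (sym (χ⊗⨾πD r A B' y)) ⟩
    ιD r A B' x ⨾ χ⁻¹ r A B' ⨾ (χ⊗ r A B' ⨾ πD r A B' y)
      ≡⟨ pullʳ (trans (sym (⨾-assoc _ _ _))
           (trans (cong (_⨾ πD r A B' y) (χ⁻¹⨾χ r A B')) (idˡ _))) ⟩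
    ιD r A B' x ⨾ πD r A B' y ∎

  inj⨾χ-term : ∀ r A B' x y (p : x ≡ y) → inj r A B' x ⨾ χ-term A B' y ≡ coe (cong (Summand A B') p)
  inj⨾χ-term r A B' x .x refl = trans (inj⨾χ-term-via-πD r A B' x x) (ιD⨾πD r A B' x)

  inj⨾χ-term-≢ : ∀ r A B' x y → x ≢ y → inj r A B' x ⨾ χ-term A B' y ≡ 0ₕ
  inj⨾χ-term-≢ r A B' x y x≢y = trans (inj⨾χ-term-via-πD r A B' x y) (ιD⨾πD-≢ r A B' x y x≢y)

  inj-natural : ∀ r {A B' C' D'} (f : Hom A C') (g : Hom B' D') (x : Decomp r) →
    (!₁ (left x) f ⊗₁ !₁ (right x) g) ⨾ inj r C' D' x ≡ inj r A B' x ⨾ !₁ r (f ⊕₁ g)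
  inj-natural r {A} {B'} {C'} {D'} f g x = χ-ext r C' D' _ _ λ y → begin
    F x ⨾ inj r C' D' x ⨾ χ-term C' D' y        ≡⟨ ⨾-assoc _ _ _ ⟩
    F x ⨾ (inj r C' D' x ⨾ χ-term C' D' y)      ≡⟨ kronecker y (Decomp-≟ r x y) ⟩
    inj r A B' x ⨾ χ-term A B' y ⨾ F y          ≡⟨ pullʳ (sym (χ-term-natural f g y)) ⟩
    inj r A B' x ⨾ (!₁ r (f ⊕₁ g) ⨾ χ-term C' D' y) ≡⟨ sym (⨾-assoc _ _ _) ⟩
    inj r A B' x ⨾ !₁ r (f ⊕₁ g) ⨾ χ-term C' D' y ∎
    where
    F : ∀ y → Hom (Summand A B' y) (Summand C' D' y)
    F y = !₁ (left y) f ⊗₁ !₁ (right y) g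

    kronecker : ∀ y → Dec (x ≡ y) → F x ⨾ (inj r C' D' x ⨾ χ-term C' D' y) ≡ inj r A B' x ⨾ χ-term A B' y ⨾ F y
    kronecker y (yes refl) = begin
      F x ⨾ (inj r C' D' x ⨾ χ-term C' D' x)   ≡⟨ cong (F x ⨾_) (inj⨾χ-term r C' D' x x refl) ⟩
      F x ⨾ id                                 ≡⟨ idʳ _ ⟩
      F x                                      ≡⟨ sym (idˡ _) ⟩
      id ⨾ F x                                 ≡⟨ cong (_⨾ F x) (sym (inj⨾χ-term r A B' x x refl)) ⟩
      inj r A B' x ⨾ χ-term A B' x ⨾ F x       ∎
    kronecker y (no x≢y) = begin
      F x ⨾ (inj r C' D' x ⨾ χ-term C' D' y)
        ≡⟨ cong (F x ⨾_) (inj⨾χ-term-≢ r C' D' x y x≢y) ⟩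
      F x ⨾ 0ₕ
        ≡⟨ ⨾-zeroʳ _ ⟩
      0ₕ
        ≡⟨ sym (⨾-zeroˡ _) ⟩
      0ₕ ⨾ F y
        ≡⟨ cong (_⨾ F y) (sym (inj⨾χ-term-≢ r A B' x y x≢y)) ⟩
      inj r A B' x ⨾ χ-term A B' y ⨾ F y ∎

  inj-natural-⨾ : ∀ r {A B' C' D' E} (f : Hom A C') (g : Hom B' D') (x : Decomp r) (h : Hom (C' ⊕ D') E) →
    (!₁ (left x) f ⊗₁ !₁ (right x) g) ⨾ (inj r C' D' x ⨾ !₁ r h) ≡ inj r A B' x ⨾ !₁ r (f ⊕₁ g ⨾ h)
  inj-natural-⨾ r f g x h = begin
    (!₁ (left x) f ⊗₁ !₁ (right x) g) ⨾ (inj r _ _ x ⨾ !₁ r h)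
      ≡⟨ sym (⨾-assoc _ _ _) ⟩
    (!₁ (left x) f ⊗₁ !₁ (right x) g) ⨾ inj r _ _ x ⨾ !₁ r h
      ≡⟨ cong (_⨾ !₁ r h) (inj-natural r f g x) ⟩
    inj r _ _ x ⨾ !₁ r (f ⊕₁ g) ⨾ !₁ r h
      ≡⟨ pullʳ (sym (!-comp r _ _)) ⟩
    inj r _ _ x ⨾ !₁ r (f ⊕₁ g ⨾ h) ∎

  inj-retract : ∀ r A B' x {Y} (k : Hom (Summand A B' x) Y) → inj r A B' x ⨾ (χ-term A B' x ⨾ k) ≡ k
  inj-retract r A B' x k =
    trans (sym (⨾-assoc _ _ _)) (trans (cong (_⨾ k) (inj⨾χ-term r A B' x x refl)) (idˡ k))

  c̄-natural : ∀ r s {A B'} (f : Hom A B') → (!₁ r f ⊗₁ !₁ s f) ⨾ c̄ r s B' ≡ c̄ r s A ⨾ !₁ (r + s) f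
  c̄-natural r s f = begin
    (!₁ r f ⊗₁ !₁ s f) ⨾ (inj _ _ _ x ⨾ !₁ (r + s) ∇)
      ≡⟨ inj-natural-⨾ (r + s) f f x ∇ ⟩
    inj _ _ _ x ⨾ !₁ (r + s) (f ⊕₁ f ⨾ ∇)
      ≡⟨ cong (λ h → inj _ _ _ x ⨾ !₁ (r + s) h) (sym (∇-natural f)) ⟩
    inj _ _ _ x ⨾ !₁ (r + s) (∇ ⨾ f)
      ≡⟨ trans (cong (inj _ _ _ x ⨾_) (!-comp _ _ _)) (sym (⨾-assoc _ _ _)) ⟩
    inj _ _ _ x ⨾ !₁ (r + s) ∇ ⨾ !₁ (r + s) f ∎
    where x = pairD r s

  w̄-natural : ∀ {A B'} (f : Hom A B') → w̄ A ⨾ !₁ 0# f ≡ w̄ B'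
  w̄-natural f = pullʳ (trans (sym (!-comp 0# _ _)) (cong (!₁ 0#) (⨾-zeroˡ f)))

  w̄⨾w : ∀ A → w̄ A ⨾ w A ≡ id
  w̄⨾w A = trans (pullʳ (w-natural _)) χI⁻¹⨾χI

  !-0-zero : ∀ {A B'} → !₁ 0# (0ₕ {A} {B'}) ≡ w A ⨾ w̄ B'
  !-0-zero {A} {B'} = begin
    !₁ 0# 0ₕ
      ≡⟨ cong (!₁ 0#) (sym (⨾-zeroˡ {A} {𝟘} {B'} 0ₕ)) ⟩
    !₁ 0# (0ₕ {A} {𝟘} ⨾ 0ₕ)
      ≡⟨ !-comp 0# _ _ ⟩
    !₁ 0# (0ₕ {A} {𝟘}) ⨾ !₁ 0# 0ₕ
      ≡⟨ cong (_⨾ !₁ 0# 0ₕ) (sym (trans (pullʳ χI⨾χI⁻¹) (idʳ _))) ⟩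
    !₁ 0# (0ₕ {A} {𝟘}) ⨾ w 𝟘 ⨾ χI⁻¹ ⨾ !₁ 0# 0ₕ
      ≡⟨ cong (λ h → h ⨾ χI⁻¹ ⨾ !₁ 0# 0ₕ) (w-natural _) ⟩
    w A ⨾ χI⁻¹ ⨾ !₁ 0# 0ₕ
      ≡⟨ ⨾-assoc _ _ _ ⟩
    w A ⨾ w̄ B' ∎

  c̄-unitʳ : ∀ r A → (id ⊗₁ w̄ A) ⨾ c̄ r 0# A ⨾ tr (+-identityʳ r) ≡ coe unitʳₒ
  c̄-unitʳ r A = begin
    (id ⊗₁ (χI⁻¹ ⨾ !₁ 0# 0ₕ)) ⨾ (inj _ _ _ x ⨾ !₁ (r + 0#) ∇) ⨾ tr (+-identityʳ r)
      ≡⟨ cong (λ h → h ⨾ (inj _ _ _ x ⨾ !₁ (r + 0#) ∇) ⨾ tr (+-identityʳ r))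
              (trans (sym (idʳ _) ⟨⊗⟩ refl) (trans (⊗-comp _ _ _ _) (cong (λ h → (id ⊗₁ χI⁻¹) ⨾ (h ⊗₁ !₁ 0# 0ₕ)) (sym (!-id r))))) ⟩
    (id ⊗₁ χI⁻¹) ⨾ (!₁ r id ⊗₁ !₁ 0# 0ₕ) ⨾ (inj _ _ _ x ⨾ !₁ (r + 0#) ∇) ⨾ tr (+-identityʳ r)
      ≡⟨ cong (_⨾ tr (+-identityʳ r)) (pullʳ (inj-natural-⨾ (r + 0#) id 0ₕ x ∇)) ⟩
    (id ⊗₁ χI⁻¹) ⨾ (inj _ _ _ x ⨾ !₁ (r + 0#) (id ⊕₁ 0ₕ ⨾ ∇)) ⨾ tr (+-identityʳ r)
      ≡⟨ cong (λ h → (id ⊗₁ χI⁻¹) ⨾ (inj _ _ _ x ⨾ !₁ (r + 0#) h) ⨾ tr (+-identityʳ r)) id⊕0⨾∇ ⟩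
    (id ⊗₁ χI⁻¹) ⨾ (inj _ _ _ x ⨾ !₁ (r + 0#) π₀) ⨾ tr (+-identityʳ r)
      ≡⟨ pullʳ (pullʳ (sym (tr-natural (+-identityʳ r) π₀))) ⟩
    (id ⊗₁ χI⁻¹) ⨾ (inj _ _ _ x ⨾ (tr (+-identityʳ r) ⨾ !₁ r π₀))
      ≡⟨ cong (λ h → (id ⊗₁ χI⁻¹) ⨾ (inj _ _ _ x ⨾ h)) (c-counitʳ-natural r π₀ π₁) ⟩
    (id ⊗₁ χI⁻¹) ⨾ (inj _ _ _ x ⨾ (c r 0# _ ⨾ (!₁ r π₀ ⊗₁ !₁ 0# π₁) ⨾ (id ⊗₁ w 𝟘) ⨾ coe unitʳₒ))
      ≡⟨ cong (λ h → (id ⊗₁ χI⁻¹) ⨾ (inj _ _ _ x ⨾ (h ⨾ (id ⊗₁ w 𝟘) ⨾ coe unitʳₒ))) (sym (χ-term-pairD r 0# A 𝟘)) ⟩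
    (id ⊗₁ χI⁻¹) ⨾ (inj _ _ _ x ⨾ (χ-term A 𝟘 x ⨾ (id ⊗₁ w 𝟘) ⨾ coe unitʳₒ))
      ≡⟨ cong ((id ⊗₁ χI⁻¹) ⨾_) (trans (cong (inj _ _ _ x ⨾_) (⨾-assoc _ _ _)) (inj-retract _ _ _ x _)) ⟩
    (id ⊗₁ χI⁻¹) ⨾ ((id ⊗₁ w 𝟘) ⨾ coe unitʳₒ)
      ≡⟨ trans (sym (⨾-assoc _ _ _)) (cong (_⨾ coe unitʳₒ) (trans (id⊗-fuse _ _) (trans (cong (id ⊗₁_) χI⁻¹⨾χI) ⊗-id))) ⟩
    id ⨾ coe unitʳₒ
      ≡⟨ idˡ _ ⟩
    coe unitʳₒ ∎
    where
    x = pairD r 0#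
    id⊕0⨾∇ : id {A} ⊕₁ 0ₕ {𝟘} {A} ⨾ ∇ ≡ π₀
    id⊕0⨾∇ = trans (∇-components _ _) (trans (cong₂ _+ₕ_ (idʳ _) (⨾-zeroʳ _)) (+ₕ-identityʳ _))

  c̄-unitˡ : ∀ r A → (w̄ A ⊗₁ id) ⨾ c̄ 0# r A ⨾ tr (+-identityˡ r) ≡ coe unitˡₒ
  c̄-unitˡ r A = begin
    ((χI⁻¹ ⨾ !₁ 0# 0ₕ) ⊗₁ id) ⨾ (inj _ _ _ x ⨾ !₁ (0# + r) ∇) ⨾ tr (+-identityˡ r)
      ≡⟨ cong (λ h → h ⨾ (inj _ _ _ x ⨾ !₁ (0# + r) ∇) ⨾ tr (+-identityˡ r))
              (trans (refl ⟨⊗⟩ sym (idʳ _)) (trans (⊗-comp _ _ _ _) (cong (λ h → (χI⁻¹ ⊗₁ id) ⨾ (!₁ 0# 0ₕ ⊗₁ h)) (sym (!-id r))))) ⟩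
    (χI⁻¹ ⊗₁ id) ⨾ (!₁ 0# 0ₕ ⊗₁ !₁ r id) ⨾ (inj _ _ _ x ⨾ !₁ (0# + r) ∇) ⨾ tr (+-identityˡ r)
      ≡⟨ cong (_⨾ tr (+-identityˡ r)) (pullʳ (inj-natural-⨾ (0# + r) 0ₕ id x ∇)) ⟩
    (χI⁻¹ ⊗₁ id) ⨾ (inj _ _ _ x ⨾ !₁ (0# + r) (0ₕ ⊕₁ id ⨾ ∇)) ⨾ tr (+-identityˡ r)
      ≡⟨ cong (λ h → (χI⁻¹ ⊗₁ id) ⨾ (inj _ _ _ x ⨾ !₁ (0# + r) h) ⨾ tr (+-identityˡ r)) 0⊕id⨾∇ ⟩
    (χI⁻¹ ⊗₁ id) ⨾ (inj _ _ _ x ⨾ !₁ (0# + r) π₁) ⨾ tr (+-identityˡ r)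
      ≡⟨ pullʳ (pullʳ (sym (tr-natural (+-identityˡ r) π₁))) ⟩
    (χI⁻¹ ⊗₁ id) ⨾ (inj _ _ _ x ⨾ (tr (+-identityˡ r) ⨾ !₁ r π₁))
      ≡⟨ cong (λ h → (χI⁻¹ ⊗₁ id) ⨾ (inj _ _ _ x ⨾ h)) (c-counitˡ-natural r π₀ π₁) ⟩
    (χI⁻¹ ⊗₁ id) ⨾ (inj _ _ _ x ⨾ (c 0# r _ ⨾ (!₁ 0# π₀ ⊗₁ !₁ r π₁) ⨾ (w 𝟘 ⊗₁ id) ⨾ coe unitˡₒ))
      ≡⟨ cong (λ h → (χI⁻¹ ⊗₁ id) ⨾ (inj _ _ _ x ⨾ (h ⨾ (w 𝟘 ⊗₁ id) ⨾ coe unitˡₒ))) (sym (χ-term-pairD 0# r 𝟘 A)) ⟩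
    (χI⁻¹ ⊗₁ id) ⨾ (inj _ _ _ x ⨾ (χ-term 𝟘 A x ⨾ (w 𝟘 ⊗₁ id) ⨾ coe unitˡₒ))
      ≡⟨ cong ((χI⁻¹ ⊗₁ id) ⨾_) (trans (cong (inj _ _ _ x ⨾_) (⨾-assoc _ _ _)) (inj-retract _ _ _ x _)) ⟩
    (χI⁻¹ ⊗₁ id) ⨾ ((w 𝟘 ⊗₁ id) ⨾ coe unitˡₒ)
      ≡⟨ trans (sym (⨾-assoc _ _ _)) (cong (_⨾ coe unitˡₒ) (trans (⊗id-fuse _ _) (trans (cong (_⊗₁ id) χI⁻¹⨾χI) ⊗-id))) ⟩
    id ⨾ coe unitˡₒ
      ≡⟨ idˡ _ ⟩
    coe unitˡₒ ∎
    where
    x = pairD 0# r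
    0⊕id⨾∇ : 0ₕ {𝟘} {A} ⊕₁ id {A} ⨾ ∇ ≡ π₁
    0⊕id⨾∇ = trans (∇-components _ _) (trans (cong₂ _+ₕ_ (⨾-zeroʳ _) (idʳ _)) (+ₕ-identityˡ _))

  c̄⨾w : ∀ A → c̄ 0# 0# A ⨾ tr (+-identityˡ 0#) ⨾ w A ≡ (w A ⊗₁ w A) ⨾ coe unitˡₒ
  c̄⨾w A = begin
    inj _ _ _ x ⨾ !₁ (0# + 0#) ∇ ⨾ tr (+-identityˡ 0#) ⨾ w A
      ≡⟨ cong (_⨾ w A) (pullʳ (sym (tr-natural _ ∇))) ⟩
    inj _ _ _ x ⨾ (tr (+-identityˡ 0#) ⨾ !₁ 0# ∇) ⨾ w A
      ≡⟨ pullʳ (pullʳ (w-natural ∇)) ⟩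
    inj _ _ _ x ⨾ (tr (+-identityˡ 0#) ⨾ w (A ⊕ A))
      ≡⟨ cong (inj _ _ _ x ⨾_) (w-comultiplicative (A ⊕ A)) ⟩
    inj _ _ _ x ⨾ (c 0# 0# _ ⨾ (w _ ⊗₁ w _) ⨾ coe unitˡₒ)
      ≡⟨ cong (λ h → inj _ _ _ x ⨾ (h ⨾ coe unitˡₒ)) (cong (c 0# 0# _ ⨾_) (sym (trans (⊗-fuse _ _ _ _) (w-natural _ ⟨⊗⟩ w-natural _)))) ⟩
    inj _ _ _ x ⨾ (c 0# 0# _ ⨾ ((!₁ 0# π₀ ⊗₁ !₁ 0# π₁) ⨾ (w A ⊗₁ w A)) ⨾ coe unitˡₒ)
      ≡⟨ cong (λ h → inj _ _ _ x ⨾ (h ⨾ coe unitˡₒ))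
              (trans (sym (⨾-assoc _ _ _)) (cong (_⨾ (w A ⊗₁ w A)) (sym (χ-term-pairD 0# 0# A A)))) ⟩
    inj _ _ _ x ⨾ (χ-term A A x ⨾ (w A ⊗₁ w A) ⨾ coe unitˡₒ)
      ≡⟨ trans (cong (inj _ _ _ x ⨾_) (⨾-assoc _ _ _)) (inj-retract _ _ _ x _) ⟩
    (w A ⊗₁ w A) ⨾ coe unitˡₒ ∎
    where x = pairD 0# 0#

  w̄⨾c : ∀ A → w̄ A ⨾ tr (sym (+-identityˡ 0#)) ⨾ c 0# 0# A ≡ coe (sym unitˡₒ) ⨾ (w̄ A ⊗₁ w̄ A)
  w̄⨾c A = begin
    χI⁻¹ ⨾ !₁ 0# 0ₕ ⨾ tr (sym (+-identityˡ 0#)) ⨾ c 0# 0# A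
      ≡⟨ cong (_⨾ c 0# 0# A) (trans (pullʳ (sym (tr-natural _ 0ₕ))) (sym (⨾-assoc _ _ _))) ⟩
    χI⁻¹ ⨾ tr (sym (+-identityˡ 0#)) ⨾ !₁ (0# + 0#) 0ₕ ⨾ c 0# 0# A
      ≡⟨ trans (pullʳ (c-natural 0# 0# 0ₕ)) (sym (⨾-assoc _ _ _)) ⟩
    u ⨾ (!₁ 0# 0ₕ ⊗₁ !₁ 0# 0ₕ)
      ≡⟨ cong (_⨾ (!₁ 0# 0ₕ ⊗₁ !₁ 0# 0ₕ)) (inverse-unique u⨾φ φ⨾φ') ⟩
    coe (sym unitˡₒ) ⨾ (χI⁻¹ ⊗₁ χI⁻¹) ⨾ (!₁ 0# 0ₕ ⊗₁ !₁ 0# 0ₕ)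
      ≡⟨ pullʳ (⊗-fuse _ _ _ _) ⟩
    coe (sym unitˡₒ) ⨾ (w̄ A ⊗₁ w̄ A) ∎
    where
    u : Hom I (!₀ 0# 𝟘 ⊗₀ !₀ 0# 𝟘)
    u = χI⁻¹ ⨾ tr (sym (+-identityˡ 0#)) ⨾ c 0# 0# 𝟘

    u⨾φ : u ⨾ ((w 𝟘 ⊗₁ w 𝟘) ⨾ coe unitˡₒ) ≡ id
    u⨾φ = begin
      χI⁻¹ ⨾ tr (sym (+-identityˡ 0#)) ⨾ c 0# 0# 𝟘 ⨾ ((w 𝟘 ⊗₁ w 𝟘) ⨾ coe unitˡₒ)
        ≡⟨ pullʳ (trans (sym (⨾-assoc _ _ _)) (sym (w-comultiplicative 𝟘))) ⟩
      χI⁻¹ ⨾ tr (sym (+-identityˡ 0#)) ⨾ (tr (+-identityˡ 0#) ⨾ w 𝟘)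
        ≡⟨ pullʳ (trans (sym (⨾-assoc _ _ _)) (trans (cong (_⨾ w 𝟘) (tr-⨾ _ _ refl)) (idˡ _))) ⟩
      χI⁻¹ ⨾ w 𝟘
        ≡⟨ χI⁻¹⨾χI ⟩
      id ∎

    φ⨾φ' : (w 𝟘 ⊗₁ w 𝟘) ⨾ coe unitˡₒ ⨾ (coe (sym unitˡₒ) ⨾ (χI⁻¹ ⊗₁ χI⁻¹)) ≡ id
    φ⨾φ' = begin
      (w 𝟘 ⊗₁ w 𝟘) ⨾ coe unitˡₒ ⨾ (coe (sym unitˡₒ) ⨾ (χI⁻¹ ⊗₁ χI⁻¹))
        ≡⟨ pullʳ (trans (sym (⨾-assoc _ _ _)) (trans (cong (_⨾ (χI⁻¹ ⊗₁ χI⁻¹)) (coe-inverseʳ unitˡₒ)) (idˡ _))) ⟩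
      (w 𝟘 ⊗₁ w 𝟘) ⨾ (χI⁻¹ ⊗₁ χI⁻¹)
        ≡⟨ trans (⊗-fuse _ _ _ _) (trans (χI⨾χI⁻¹ ⟨⊗⟩ χI⨾χI⁻¹) ⊗-id) ⟩
      id ∎

  Δ-term : ∀ r A (x : Decomp r) → Hom (!₀ r A) (!₀ r (A ⊕ A))
  Δ-term r A ((s , t) , e) = tr (sym e) ⨾ c s t A ⨾ inj r A A ((s , t) , e)

  Δ-term⨾χ-term-≢ : ∀ r A x y → x ≢ y → Δ-term r A x ⨾ χ-term A A y ≡ 0ₕ
  Δ-term⨾χ-term-≢ r A ((s , t) , e) y x≢y = trans (pullʳ (inj⨾χ-term-≢ r A A _ y x≢y)) (⨾-zeroʳ _)

  !Δ⨾χ-term : ∀ r A y → !₁ r (Δ {A}) ⨾ χ-term A A y ≡ Δ-term r A y ⨾ χ-term A A y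
  !Δ⨾χ-term r A y@((s , t) , e) = begin
    !₁ r Δ ⨾ χ-along π₀ π₁ y
      ≡⟨ !⨾χ-along Δ π₀ π₁ y ⟩
    χ-along (Δ ⨾ π₀) (Δ ⨾ π₁) y
      ≡⟨ cong₂ (λ f g → χ-along f g y) (⟨,⟩⨾π₀ id id) (⟨,⟩⨾π₁ id id) ⟩
    tr (sym e) ⨾ c s t A ⨾ (!₁ s id ⊗₁ !₁ t id)
      ≡⟨ trans (cong (tr (sym e) ⨾ c s t A ⨾_) (trans (!-id s ⟨⊗⟩ !-id t) ⊗-id)) (idʳ _) ⟩
    tr (sym e) ⨾ c s t A
      ≡⟨ sym (trans (pullʳ (inj⨾χ-term r A A y y refl)) (idʳ _)) ⟩
    Δ-term r A y ⨾ χ-term A A y ∎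

  !-Δ : ∀ r A → !₁ r (Δ {A}) ≡ Σₕ (dec r) (λ i → Δ-term r A (decomp r i))
  !-Δ r A = χ-ext r A A _ _ λ y → begin
    !₁ r Δ ⨾ χ-term A A y
      ≡⟨ !Δ⨾χ-term r A y ⟩
    Δ-term r A y ⨾ χ-term A A y
      ≡⟨ sym (Σₕ-Decomp-single r (λ z → Δ-term r A z ⨾ χ-term A A y) y
           (λ z z≢y → Δ-term⨾χ-term-≢ r A z y z≢y)) ⟩
    Σₕ (dec r) (λ i → Δ-term r A (decomp r i) ⨾ χ-term A A y)
      ≡⟨ sym (⨾-distribʳ-Σₕ (dec r) _ _) ⟩
    Σₕ (dec r) (λ i → Δ-term r A (decomp r i)) ⨾ χ-term A A y ∎

  additive-term : ∀ {r A B'} (f g : Hom A B') → Decomp r → Hom (!₀ r A) (!₀ r B')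
  additive-term {A = A} {B'} f g ((s , t) , e) =
    tr (sym e) ⨾ c s t A ⨾ (!₁ s f ⊗₁ !₁ t g) ⨾ c̄ s t B' ⨾ tr e

  Δ-term⨾! : ∀ {r A B'} (f g : Hom A B') (x : Decomp r) →
             Δ-term r A x ⨾ !₁ r (f ⊕₁ g ⨾ ∇) ≡ additive-term f g x
  Δ-term⨾! {A = A} {B'} f g x@((s , t) , refl) = begin
    id ⨾ c s t A ⨾ inj _ A A x ⨾ !₁ (s + t) (f ⊕₁ g ⨾ ∇)
      ≡⟨ pullʳ (sym (inj-natural-⨾ (s + t) f g x ∇)) ⟩
    id ⨾ c s t A ⨾ ((!₁ s f ⊗₁ !₁ t g) ⨾ c̄ s t B')
      ≡⟨ sym (trans (idʳ _) (⨾-assoc _ _ _)) ⟩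
    id ⨾ c s t A ⨾ (!₁ s f ⊗₁ !₁ t g) ⨾ c̄ s t B' ⨾ id ∎

  !-+ : ∀ r {A B'} (f g : Hom A B') →
        !₁ r (f +ₕ g) ≡ Σₕ (dec r) (λ i → additive-term f g (decomp r i))
  !-+ r {A} f g = begin
    !₁ r (f +ₕ g)
      ≡⟨ cong (!₁ r) (+ₕ-via-∇ f g) ⟩
    !₁ r (Δ ⨾ (f ⊕₁ g ⨾ ∇))
      ≡⟨ !-comp r _ _ ⟩
    !₁ r Δ ⨾ !₁ r (f ⊕₁ g ⨾ ∇)
      ≡⟨ cong (_⨾ !₁ r (f ⊕₁ g ⨾ ∇)) (!-Δ r A) ⟩
    Σₕ (dec r) (λ i → Δ-term r A (decomp r i)) ⨾ !₁ r (f ⊕₁ g ⨾ ∇)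
      ≡⟨ ⨾-distribʳ-Σₕ (dec r) _ _ ⟩
    Σₕ (dec r) (λ i → Δ-term r A (decomp r i) ⨾ !₁ r (f ⊕₁ g ⨾ ∇))
      ≡⟨ Σₕ-cong (dec r) (λ i → Δ-term⨾! f g (decomp r i)) ⟩
    Σₕ (dec r) (λ i → additive-term f g (decomp r i)) ∎

  σ⨾inj : ∀ r s A → σ ⨾ inj (s + r) A A (pairD s r)
                    ≡ inj (r + s) A A (pairD r s) ⨾ tr (+-comm r s) ⨾ !₁ (s + r) ⊕-swap
  σ⨾inj r s A = χ-ext (s + r) A A _ _ λ y → begin
    σ ⨾ inj _ A A x' ⨾ χ-term A A y
      ≡⟨ ⨾-assoc _ _ _ ⟩
    σ ⨾ (inj _ A A x' ⨾ χ-term A A y)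
      ≡⟨ kronecker y (Decomp-≟ _ x' y) ⟩
    inj _ A A x ⨾ χ-term A A (y' y) ⨾ σ
      ≡⟨ pullʳ (sym (swapped y)) ⟩
    inj _ A A x ⨾ (tr (+-comm r s) ⨾ (!₁ (s + r) ⊕-swap ⨾ χ-term A A y))
      ≡⟨ sym (trans (⨾-assoc _ _ _) (⨾-assoc _ _ _)) ⟩
    inj _ A A x ⨾ tr (+-comm r s) ⨾ !₁ (s + r) ⊕-swap ⨾ χ-term A A y ∎
    where
    x' = pairD s r
    x  = pairD r s

    y' : Decomp (s + r) → Decomp (r + s)
    y' y = proj₁ (swapD y) , trans (proj₂ (swapD y)) (sym (+-comm r s))

    swapped : ∀ y → tr (+-comm r s) ⨾ (!₁ (s + r) ⊕-swap ⨾ χ-term A A y) ≡ χ-term A A (y' y) ⨾ σ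
    swapped y = begin
      tr (+-comm r s) ⨾ (!₁ (s + r) ⊕-swap ⨾ χ-along π₀ π₁ y)
        ≡⟨ cong (tr (+-comm r s) ⨾_) (trans (!⨾χ-along ⊕-swap π₀ π₁ y)
             (cong₂ (λ f g → χ-along f g y) (⟨,⟩⨾π₀ _ _) (⟨,⟩⨾π₁ _ _))) ⟩
      tr (+-comm r s) ⨾ χ-along π₁ π₀ y
        ≡⟨ cong (tr (+-comm r s) ⨾_) (sym (χ-along-swapD⨾σ π₀ π₁ y)) ⟩
      tr (+-comm r s) ⨾ (χ-term A A (swapD y) ⨾ σ)
        ≡⟨ trans (sym (⨾-assoc _ _ _)) (cong (_⨾ σ) (tr⨾χ-term (+-comm r s) (swapD y))) ⟩
      χ-term A A (y' y) ⨾ σ ∎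

    kronecker : ∀ y → Dec (x' ≡ y) → σ ⨾ (inj _ A A x' ⨾ χ-term A A y) ≡ inj _ A A x ⨾ χ-term A A (y' y) ⨾ σ
    kronecker y (yes p) = begin
      σ ⨾ (inj _ A A x' ⨾ χ-term A A y)
        ≡⟨ cong (σ ⨾_) (trans (inj⨾χ-term _ A A x' y p) (coe-Summand A A p)) ⟩
      σ ⨾ (tr (cong left p) ⊗₁ tr (cong right p))
        ≡⟨ sym (σ-natural _ _) ⟩
      (tr (cong right p) ⊗₁ tr (cong left p)) ⨾ σ
        ≡⟨ cong (_⨾ σ) (sym (trans (inj⨾χ-term _ A A x (y' y) q) (trans (coe-Summand A A q)
             (tr-irrelevant _ _ ⟨⊗⟩ tr-irrelevant _ _)))) ⟩
      inj _ A A x ⨾ χ-term A A (y' y) ⨾ σ ∎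
      where q = Decomp-≡ (cong right p) (cong left p)
    kronecker y (no x'≢y) = begin
      σ ⨾ (inj _ A A x' ⨾ χ-term A A y)
        ≡⟨ cong (σ ⨾_) (inj⨾χ-term-≢ _ A A x' y x'≢y) ⟩
      σ ⨾ 0ₕ
        ≡⟨ ⨾-zeroʳ σ ⟩
      0ₕ
        ≡⟨ sym (⨾-zeroˡ σ) ⟩
      0ₕ ⨾ σ
        ≡⟨ cong (_⨾ σ) (sym (inj⨾χ-term-≢ _ A A x (y' y)
             (λ q → x'≢y (Decomp-≡ (cong right q) (cong left q))))) ⟩
      inj _ A A x ⨾ χ-term A A (y' y) ⨾ σ ∎

  c̄-comm : ∀ r s A → σ ⨾ c̄ s r A ≡ c̄ r s A ⨾ tr (+-comm r s)
  c̄-comm r s A = begin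
    σ ⨾ (inj _ A A (pairD s r) ⨾ !₁ (s + r) ∇)
      ≡⟨ sym (⨾-assoc _ _ _) ⟩
    σ ⨾ inj _ A A (pairD s r) ⨾ !₁ (s + r) ∇
      ≡⟨ cong (_⨾ !₁ (s + r) ∇) (σ⨾inj r s A) ⟩
    inj _ A A (pairD r s) ⨾ tr (+-comm r s) ⨾ !₁ (s + r) ⊕-swap ⨾ !₁ (s + r) ∇
      ≡⟨ pullʳ (trans (sym (!-comp _ _ _)) (cong (!₁ (s + r)) ⊕-swap⨾∇)) ⟩
    inj _ A A (pairD r s) ⨾ tr (+-comm r s) ⨾ !₁ (s + r) ∇
      ≡⟨ pullʳ (tr-natural _ ∇) ⟩
    inj _ A A (pairD r s) ⨾ (!₁ (r + s) ∇ ⨾ tr (+-comm r s))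
      ≡⟨ sym (⨾-assoc _ _ _) ⟩
    inj _ A A (pairD r s) ⨾ !₁ (r + s) ∇ ⨾ tr (+-comm r s) ∎

  inj⨾χ-term⨾ : ∀ {r A B' Y} (x y : Decomp r) → x ≡ y →
    (e₁ : left x ≡ left y) (e₂ : right x ≡ right y) (k : Hom (Summand A B' y) Y) →
    inj r A B' x ⨾ χ-term A B' y ⨾ k ≡ (tr e₁ ⊗₁ tr e₂) ⨾ k
  inj⨾χ-term⨾ x y p e₁ e₂ k = cong (_⨾ k)
    (trans (inj⨾χ-term _ _ _ x y p) (trans (coe-Summand _ _ p) (tr-irrelevant _ e₁ ⟨⊗⟩ tr-irrelevant _ e₂)))

  inj⨾χ-term⨾-≢ : ∀ {r A B' Y} (x y : Decomp r) → x ≢ y → (k : Hom (Summand A B' y) Y) →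
    inj r A B' x ⨾ χ-term A B' y ⨾ k ≡ 0ₕ
  inj⨾χ-term⨾-≢ x y x≢y k = trans (cong (_⨾ k) (inj⨾χ-term-≢ _ _ _ x y x≢y)) (⨾-zeroˡ k)

  c̄⨾d-as-sum : ∀ r s A (h : r + s ≡ 1#) →
    c̄ r s A ⨾ tr h ⨾ d A
      ≡ (inj _ A A (pairD r s) ⨾ χ-term A A (D₁₀ h) ⨾ ((d A ⊗₁ w A) ⨾ coe unitʳₒ))
        +ₕ (inj _ A A (pairD r s) ⨾ χ-term A A (D₀₁ h) ⨾ ((w A ⊗₁ d A) ⨾ coe unitˡₒ))
  c̄⨾d-as-sum r s A h = begin
    inj _ A A x ⨾ !₁ (r + s) ∇ ⨾ tr h ⨾ d A
      ≡⟨ cong (_⨾ d A) (pullʳ (sym (tr-natural h ∇))) ⟩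
    inj _ A A x ⨾ (tr h ⨾ !₁ 1# ∇) ⨾ d A
      ≡⟨ pullʳ (pullʳ !∇⨾d) ⟩
    inj _ A A x ⨾ (tr h ⨾ ((!₁ 1# π₀ ⨾ d A) +ₕ (!₁ 1# π₁ ⨾ d A)))
      ≡⟨ cong (inj _ A A x ⨾_) (trans (⨾-distribˡ _ _ _) (cong₂ _+ₕ_
           (trans (sym (⨾-assoc _ _ _)) (tr⨾!π₀⨾d h)) (trans (sym (⨾-assoc _ _ _)) (tr⨾!π₁⨾d h)))) ⟩
    inj _ A A x ⨾ ((χ-term A A (D₁₀ h) ⨾ ((d A ⊗₁ w A) ⨾ coe unitʳₒ))
                    +ₕ (χ-term A A (D₀₁ h) ⨾ ((w A ⊗₁ d A) ⨾ coe unitˡₒ)))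
      ≡⟨ trans (⨾-distribˡ _ _ _) (cong₂ _+ₕ_ (sym (⨾-assoc _ _ _)) (sym (⨾-assoc _ _ _))) ⟩
    (inj _ A A x ⨾ χ-term A A (D₁₀ h) ⨾ ((d A ⊗₁ w A) ⨾ coe unitʳₒ))
      +ₕ (inj _ A A x ⨾ χ-term A A (D₀₁ h) ⨾ ((w A ⊗₁ d A) ⨾ coe unitˡₒ)) ∎
    where x = pairD r s

  c̄⨾d-01 : ∀ r s A (h : r + s ≡ 1#) (e0 : r ≡ 0#) (e1 : s ≡ 1#) → s ≢ 0# →
    c̄ r s A ⨾ tr h ⨾ d A ≡ (tr e0 ⊗₁ tr e1) ⨾ (w A ⊗₁ d A) ⨾ coe unitˡₒ
  c̄⨾d-01 r s A h e0 e1 s≢0 = trans (c̄⨾d-as-sum r s A h) (trans (cong₂ _+ₕ_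
    (inj⨾χ-term⨾-≢ (pairD r s) (D₁₀ h) (λ p → s≢0 (cong right p)) _)
    (trans (inj⨾χ-term⨾ (pairD r s) (D₀₁ h) (Decomp-≡ e0 e1) e0 e1 _) (sym (⨾-assoc _ _ _))))
    (+ₕ-identityˡ _))

  c̄⨾d-10 : ∀ r s A (h : r + s ≡ 1#) (e1 : r ≡ 1#) (e0 : s ≡ 0#) → r ≢ 0# →
    c̄ r s A ⨾ tr h ⨾ d A ≡ (tr e1 ⊗₁ tr e0) ⨾ (d A ⊗₁ w A) ⨾ coe unitʳₒ
  c̄⨾d-10 r s A h e1 e0 r≢0 = trans (c̄⨾d-as-sum r s A h) (trans (cong₂ _+ₕ_
    (trans (inj⨾χ-term⨾ (pairD r s) (D₁₀ h) (Decomp-≡ e1 e0) e1 e0 _) (sym (⨾-assoc _ _ _)))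
    (inj⨾χ-term⨾-≢ (pairD r s) (D₀₁ h) (λ p → r≢0 (cong left p)) _))
    (+ₕ-identityʳ _))

  c̄⨾d-both : ∀ r s A (h : r + s ≡ 1#) (r0 : r ≡ 0#) (s1 : s ≡ 1#) (r1 : r ≡ 1#) (s0 : s ≡ 0#) →
    c̄ r s A ⨾ tr h ⨾ d A
      ≡ ((tr r0 ⊗₁ tr s1) ⨾ (w A ⊗₁ d A) ⨾ coe unitˡₒ) +ₕ ((tr r1 ⊗₁ tr s0) ⨾ (d A ⊗₁ w A) ⨾ coe unitʳₒ)
  c̄⨾d-both r s A h r0 s1 r1 s0 = trans (c̄⨾d-as-sum r s A h) (trans (cong₂ _+ₕ_
    (trans (inj⨾χ-term⨾ (pairD r s) (D₁₀ h) (Decomp-≡ r1 s0) r1 s0 _) (sym (⨾-assoc _ _ _)))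
    (trans (inj⨾χ-term⨾ (pairD r s) (D₀₁ h) (Decomp-≡ r0 s1) r0 s1 _) (sym (⨾-assoc _ _ _))))
    (+ₕ-comm _ _))

  c̄⨾d-none : ∀ r s A (h : r + s ≡ 1#) → r ≢ 0# → s ≢ 0# → c̄ r s A ⨾ tr h ⨾ d A ≡ 0ₕ
  c̄⨾d-none r s A h r≢0 s≢0 = trans (c̄⨾d-as-sum r s A h) (trans (cong₂ _+ₕ_
    (inj⨾χ-term⨾-≢ (pairD r s) (D₁₀ h) (λ p → s≢0 (cong right p)) _)
    (inj⨾χ-term⨾-≢ (pairD r s) (D₀₁ h) (λ p → r≢0 (cong left p)) _))
    (+ₕ-identityˡ _))

  -- For r ≠ 0 the summands (r , 0) and (0 , r) of !_r (𝟘 ⊕ 𝟘) are distinct, yet the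
  -- symmetry exchanges their χ-components; so σ, hence id, on !_r 𝟘 ⊗ !_0 𝟘 vanishes.
  !𝟘-id-zero : ∀ r → r ≢ 0# → id { !₀ r 𝟘} ≡ 0ₕ
  !𝟘-id-zero r r≢0 = begin
    id
      ≡⟨ sym (tr-⨾ (sym ρ) ρ refl) ⟩
    tr (sym ρ) ⨾ tr ρ
      ≡⟨ cong (tr (sym ρ) ⨾_) (sym (c-counitʳ r 𝟘)) ⟩
    tr (sym ρ) ⨾ (c r 0# 𝟘 ⨾ (id ⊗₁ w 𝟘) ⨾ coe unitʳₒ)
      ≡⟨ cong (λ f → tr (sym ρ) ⨾ (f ⨾ (id ⊗₁ w 𝟘) ⨾ coe unitʳₒ))
           (trans (sym (idʳ _)) (trans (cong (c r 0# 𝟘 ⨾_) id≡0) (⨾-zeroʳ _))) ⟩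
    tr (sym ρ) ⨾ (0ₕ ⨾ (id ⊗₁ w 𝟘) ⨾ coe unitʳₒ)
      ≡⟨ cong (tr (sym ρ) ⨾_) (trans (cong (_⨾ coe unitʳₒ) (⨾-zeroˡ _)) (⨾-zeroˡ _)) ⟩
    tr (sym ρ) ⨾ 0ₕ
      ≡⟨ ⨾-zeroʳ _ ⟩
    0ₕ ∎
    where
    ρ = +-identityʳ r
    y₁ y₂ : Decomp r
    y₁ = ((r , 0#) , ρ)
    y₂ = ((0# , r) , +-identityˡ r)

    χ-term⨾σ : χ-term 𝟘 𝟘 y₁ ⨾ σ ≡ χ-term 𝟘 𝟘 y₂
    χ-term⨾σ = trans (χ-along⨾σ π₀ π₁ y₁) (cong₂ (λ t f → t ⨾ c 0# r _ ⨾ f) (tr-irrelevant _ _)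
      (cong (!₁ 0#) (trans (into-𝟘-zero π₁) (sym (into-𝟘-zero π₀)))
        ⟨⊗⟩ cong (!₁ r) (trans (into-𝟘-zero π₀) (sym (into-𝟘-zero π₁)))))

    σ≡0 : σ { !₀ r 𝟘} { !₀ 0# 𝟘} ≡ 0ₕ
    σ≡0 = begin
      σ                                            ≡⟨ sym (idˡ σ) ⟩
      id ⨾ σ
        ≡⟨ cong (_⨾ σ) (sym (inj⨾χ-term r 𝟘 𝟘 y₁ y₁ refl)) ⟩
      inj r 𝟘 𝟘 y₁ ⨾ χ-term 𝟘 𝟘 y₁ ⨾ σ
        ≡⟨ pullʳ χ-term⨾σ ⟩
      inj r 𝟘 𝟘 y₁ ⨾ χ-term 𝟘 𝟘 y₂
        ≡⟨ inj⨾χ-term-≢ r 𝟘 𝟘 y₁ y₂ (λ p → r≢0 (cong left p)) ⟩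
      0ₕ ∎

    id≡0 : id { !₀ r 𝟘 ⊗₀ !₀ 0# 𝟘} ≡ 0ₕ
    id≡0 = trans (sym σ-invol) (trans (cong (_⨾ σ) σ≡0) (⨾-zeroˡ σ))

  !-0-nonzero : ∀ r {A B'} → r ≢ 0# → !₁ r (0ₕ {A} {B'}) ≡ 0ₕ
  !-0-nonzero r {A} {B'} r≢0 = begin
    !₁ r 0ₕ
      ≡⟨ cong (!₁ r) (sym (⨾-zeroˡ {A} {𝟘} {B'} 0ₕ)) ⟩
    !₁ r (0ₕ {A} {𝟘} ⨾ 0ₕ)
      ≡⟨ !-comp r _ _ ⟩
    !₁ r (0ₕ {A} {𝟘}) ⨾ !₁ r 0ₕ
      ≡⟨ cong (!₁ r (0ₕ {A} {𝟘}) ⨾_) (sym (idˡ _)) ⟩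
    !₁ r (0ₕ {A} {𝟘}) ⨾ (id ⨾ !₁ r 0ₕ)
      ≡⟨ cong (λ f → !₁ r (0ₕ {A} {𝟘}) ⨾ (f ⨾ !₁ r 0ₕ)) (!𝟘-id-zero r r≢0) ⟩
    !₁ r (0ₕ {A} {𝟘}) ⨾ (0ₕ ⨾ !₁ r 0ₕ)
      ≡⟨ trans (cong (!₁ r (0ₕ {A} {𝟘}) ⨾_) (⨾-zeroˡ _)) (⨾-zeroʳ _) ⟩
    0ₕ ∎

  module Associativity (r s t : Carrier) (A : Obj) where
    m₁ m₂ : Carrier
    m₁ = (r + s) + t
    m₂ = r + (s + t)
    k : m₂ ≡ m₁
    k = sym (+-assoc r s t)

    inj-rs : Hom (!₀ r A ⊗₀ !₀ s A) (!₀ (r + s) (A ⊕ A))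
    inj-rs = inj (r + s) A A (pairD r s)

    inj-st : Hom (!₀ s A ⊗₀ !₀ t A) (!₀ (s + t) (A ⊕ A))
    inj-st = inj (s + t) A A (pairD s t)

    injˡ₃ : Hom ((!₀ r A ⊗₀ !₀ s A) ⊗₀ !₀ t A) (!₀ m₁ ((A ⊕ A) ⊕ A))
    injˡ₃ = (inj-rs ⊗₁ id) ⨾ inj m₁ (A ⊕ A) A (pairD (r + s) t)

    injʳ₃ : Hom ((!₀ r A ⊗₀ !₀ s A) ⊗₀ !₀ t A) (!₀ m₂ (A ⊕ (A ⊕ A)))
    injʳ₃ = α⇒ ⨾ (id ⊗₁ inj-st) ⨾ inj m₂ A (A ⊕ A) (pairD r (s + t))

    -- Both sides of the (a , (u , v))-component of inj₃-agree are the identity (up to regrading)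
    -- when (a , u , v) = (r , s , t) and 0 otherwise; matching the cases uses that R is cancellative.
    module Component (a b : Carrier) (e : a + b ≡ m₁) (u v : Carrier) (e₂ : u + v ≡ b) where
      y : Decomp m₁
      y = ((a , b) , e)

      z : Decomp b
      z = ((u , v) , e₂)

      yˡ : Decomp m₁
      yˡ = ((a + u , v) , trans (+-assoc a u v) (trans (cong (a +_) e₂) e))

      yʳ : Decomp m₂
      yʳ = ((a , b) , trans e (sym k))

      z' : pairD r (s + t) ≡ yʳ → Decomp (s + t)
      z' p = ((u , v) , trans e₂ (sym (cong right p)))

      LHS RHS : Hom ((!₀ r A ⊗₀ !₀ s A) ⊗₀ !₀ t A) (!₀ a A ⊗₀ (!₀ u A ⊗₀ !₀ v A))
      LHS = injˡ₃ ⨾ !₁ m₁ ⊕-assoc ⨾ χ-term A (A ⊕ A) y ⨾ (id ⊗₁ χ-term A A z)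
      RHS = injʳ₃ ⨾ tr k ⨾ χ-term A (A ⊕ A) y ⨾ (id ⊗₁ χ-term A A z)

      LHS-via-yˡ : LHS ≡ (inj-rs ⊗₁ id) ⨾ (inj m₁ (A ⊕ A) A (pairD (r + s) t) ⨾ χ-term (A ⊕ A) A yˡ)
                          ⨾ (χ-term A A (pairD a u) ⊗₁ id) ⨾ α⇒
      LHS-via-yˡ = begin
        injˡ₃ ⨾ !₁ m₁ ⊕-assoc ⨾ χ-term A (A ⊕ A) y ⨾ (id ⊗₁ χ-term A A z)
          ≡⟨ pullʳ₃ (⊕-assoc⨾χ-term₃ a b u v e e₂ _) ⟩
        injˡ₃ ⨾ (χ-term (A ⊕ A) A yˡ ⨾ (χ-term A A (pairD a u) ⊗₁ id) ⨾ α⇒)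
          ≡⟨ sym (pullʳ₃ refl) ⟩
        injˡ₃ ⨾ χ-term (A ⊕ A) A yˡ ⨾ (χ-term A A (pairD a u) ⊗₁ id) ⨾ α⇒
          ≡⟨ cong (λ f → f ⨾ (χ-term A A (pairD a u) ⊗₁ id) ⨾ α⇒) (⨾-assoc _ _ _) ⟩
        (inj-rs ⊗₁ id) ⨾ (inj m₁ (A ⊕ A) A (pairD (r + s) t) ⨾ χ-term (A ⊕ A) A yˡ)
          ⨾ (χ-term A A (pairD a u) ⊗₁ id) ⨾ α⇒ ∎

      LHS-zero : pairD (r + s) t ≢ yˡ → LHS ≡ 0ₕ
      LHS-zero ne = begin
        LHS
          ≡⟨ LHS-via-yˡ ⟩
        (inj-rs ⊗₁ id) ⨾ (inj m₁ (A ⊕ A) A (pairD (r + s) t) ⨾ χ-term (A ⊕ A) A yˡ) ⨾ (χ-term A A (pairD a u) ⊗₁ id) ⨾ α⇒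
          ≡⟨ cong (λ f → (inj-rs ⊗₁ id) ⨾ f ⨾ (χ-term A A (pairD a u) ⊗₁ id) ⨾ α⇒) (inj⨾χ-term-≢ _ _ _ _ yˡ ne) ⟩
        (inj-rs ⊗₁ id) ⨾ 0ₕ ⨾ (χ-term A A (pairD a u) ⊗₁ id) ⨾ α⇒
          ≡⟨ trans (cong (λ f → f ⨾ (χ-term A A (pairD a u) ⊗₁ id) ⨾ α⇒) (⨾-zeroʳ _))
                   (trans (cong (_⨾ α⇒) (⨾-zeroˡ _)) (⨾-zeroˡ _)) ⟩
        0ₕ ∎

      LHS-value : (p : pairD (r + s) t ≡ yˡ) →
        LHS ≡ ((inj-rs ⨾ χ-term A A ((a , u) , sym (cong left p))) ⊗₁ tr (cong right p)) ⨾ α⇒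
      LHS-value p = begin
        LHS
          ≡⟨ LHS-via-yˡ ⟩
        (inj-rs ⊗₁ id) ⨾ (inj m₁ (A ⊕ A) A (pairD (r + s) t) ⨾ χ-term (A ⊕ A) A yˡ) ⨾ (χ-term A A (pairD a u) ⊗₁ id) ⨾ α⇒
          ≡⟨ cong (λ f → (inj-rs ⊗₁ id) ⨾ f ⨾ (χ-term A A (pairD a u) ⊗₁ id) ⨾ α⇒)
                  (trans (inj⨾χ-term _ _ _ _ yˡ p) (coe-Summand _ _ p)) ⟩
        (inj-rs ⊗₁ id) ⨾ (tr (cong left p) ⊗₁ tr (cong right p)) ⨾ (χ-term A A (pairD a u) ⊗₁ id) ⨾ α⇒
          ≡⟨ cong (_⨾ α⇒) (trans (cong (_⨾ (χ-term A A (pairD a u) ⊗₁ id)) (⊗-fuse _ _ _ _)) (trans (⊗-fuse _ _ _ _)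
               (⨾-assoc _ _ _ ⟨⊗⟩ idʳ _))) ⟩
        ((inj-rs ⨾ (tr (cong left p) ⨾ χ-term A A (pairD a u))) ⊗₁ (id ⨾ tr (cong right p))) ⨾ α⇒
          ≡⟨ cong (_⨾ α⇒) (cong (inj-rs ⨾_) (tr⨾χ-term (cong left p) (pairD a u)) ⟨⊗⟩ idˡ _) ⟩
        ((inj-rs ⨾ χ-term A A ((a , u) , sym (cong left p))) ⊗₁ tr (cong right p)) ⨾ α⇒ ∎

      RHS-via-yʳ : RHS ≡ α⇒ ⨾ (id ⊗₁ inj-st) ⨾ (inj m₂ A (A ⊕ A) (pairD r (s + t)) ⨾ χ-term A (A ⊕ A) yʳ)
                           ⨾ (id ⊗₁ χ-term A A z)
      RHS-via-yʳ = cong (_⨾ (id ⊗₁ χ-term A A z)) (trans (pullʳ (tr⨾χ-term k y)) (⨾-assoc _ _ _))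

      RHS-zero : pairD r (s + t) ≢ yʳ → RHS ≡ 0ₕ
      RHS-zero ne = begin
        RHS
          ≡⟨ RHS-via-yʳ ⟩
        α⇒ ⨾ (id ⊗₁ inj-st) ⨾ (inj m₂ A (A ⊕ A) (pairD r (s + t)) ⨾ χ-term A (A ⊕ A) yʳ) ⨾ (id ⊗₁ χ-term A A z)
          ≡⟨ cong (λ f → α⇒ ⨾ (id ⊗₁ inj-st) ⨾ f ⨾ (id ⊗₁ χ-term A A z)) (inj⨾χ-term-≢ _ _ _ _ yʳ ne) ⟩
        α⇒ ⨾ (id ⊗₁ inj-st) ⨾ 0ₕ ⨾ (id ⊗₁ χ-term A A z)
          ≡⟨ trans (cong (_⨾ (id ⊗₁ χ-term A A z)) (⨾-zeroʳ _)) (⨾-zeroˡ _) ⟩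
        0ₕ ∎

      RHS-value : (p : pairD r (s + t) ≡ yʳ) → RHS ≡ α⇒ ⨾ (tr (cong left p) ⊗₁ (inj-st ⨾ χ-term A A (z' p)))
      RHS-value p = begin
        RHS
          ≡⟨ RHS-via-yʳ ⟩
        α⇒ ⨾ (id ⊗₁ inj-st) ⨾ (inj m₂ A (A ⊕ A) (pairD r (s + t)) ⨾ χ-term A (A ⊕ A) yʳ) ⨾ (id ⊗₁ χ-term A A z)
          ≡⟨ cong (λ f → α⇒ ⨾ (id ⊗₁ inj-st) ⨾ f ⨾ (id ⊗₁ χ-term A A z))
                  (trans (inj⨾χ-term _ _ _ _ yʳ p) (coe-Summand _ _ p)) ⟩
        α⇒ ⨾ (id ⊗₁ inj-st) ⨾ (tr (cong left p) ⊗₁ tr (cong right p)) ⨾ (id ⊗₁ χ-term A A z)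
          ≡⟨ pullʳ₃ (trans (cong (_⨾ (id ⊗₁ χ-term A A z)) (⊗-fuse _ _ _ _)) (⊗-fuse _ _ _ _)) ⟩
        α⇒ ⨾ ((id ⨾ tr (cong left p) ⨾ id) ⊗₁ (inj-st ⨾ tr (cong right p) ⨾ χ-term A A z))
          ≡⟨ cong (α⇒ ⨾_) (trans (cong (_⨾ id) (idˡ _)) (idʳ _) ⟨⊗⟩ pullʳ (tr⨾χ-term (cong right p) z)) ⟩
        α⇒ ⨾ (tr (cong left p) ⊗₁ (inj-st ⨾ χ-term A A (z' p))) ∎

      LHS≡RHS : LHS ≡ RHS
      LHS≡RHS with Decomp-≟ m₂ (pairD r (s + t)) yʳ
      ... | no np = trans (LHS≡0 (Decomp-≟ m₁ (pairD (r + s) t) yˡ)) (sym (RHS-zero np))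
        where
        LHS≡0 : Dec (pairD (r + s) t ≡ yˡ) → LHS ≡ 0ₕ
        LHS≡0 (no ne)  = LHS-zero ne
        LHS≡0 (yes p₁) with Decomp-≟ (r + s) (pairD r s) ((a , u) , sym (cong left p₁))
        ... | no ne   = trans (LHS-value p₁) (trans (cong (λ f → (f ⊗₁ tr (cong right p₁)) ⨾ α⇒) (inj⨾χ-term-≢ _ _ _ _ _ ne))
                               (trans (cong (_⨾ α⇒) (⊗-zeroˡ _)) (⨾-zeroˡ _)))
        ... | yes p₂  = contradiction (Decomp-≡ (cong left p₂)
                          (trans (cong₂ _+_ (cong right p₂) (cong right p₁)) e₂)) np
      ... | yes p with Decomp-≟ (s + t) (pairD s t) (z' p)
      ...   | no np' = trans (LHS≡0 (Decomp-≟ m₁ (pairD (r + s) t) yˡ)) (sym RHS≡0)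
        where
        RHS≡0 : RHS ≡ 0ₕ
        RHS≡0 = trans (RHS-value p) (trans (cong (λ f → α⇒ ⨾ (tr (cong left p) ⊗₁ f)) (inj⨾χ-term-≢ _ _ _ _ _ np'))
                  (trans (cong (α⇒ ⨾_) (⊗-zeroʳ _)) (⨾-zeroʳ _)))
        LHS≡0 : Dec (pairD (r + s) t ≡ yˡ) → LHS ≡ 0ₕ
        LHS≡0 (no ne)  = LHS-zero ne
        LHS≡0 (yes p₁) = contradiction (Decomp-≡ s≡u (cong right p₁)) np'
          where
          s≡u : s ≡ u
          s≡u = +-cancelˡ r s u (trans (cong left p₁) (cong (_+ u) (sym (cong left p))))
      ...   | yes p' = begin
        LHS
          ≡⟨ LHS-value p₁ ⟩
        ((inj-rs ⨾ χ-term A A ((a , u) , sym (cong left p₁))) ⊗₁ tr (cong right p₁)) ⨾ α⇒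
          ≡⟨ cong (λ f → (f ⊗₁ tr (cong right p₁)) ⨾ α⇒) (trans (inj⨾χ-term _ _ _ _ _ p₂) (coe-Summand _ _ p₂)) ⟩
        ((tr (cong left p₂) ⊗₁ tr (cong right p₂)) ⊗₁ tr (cong right p₁)) ⨾ α⇒
          ≡⟨ assocₘ _ _ _ ⟩
        α⇒ ⨾ (tr (cong left p₂) ⊗₁ (tr (cong right p₂) ⊗₁ tr (cong right p₁)))
          ≡⟨ cong (α⇒ ⨾_) (tr-irrelevant _ _ ⟨⊗⟩ sym (trans (inj⨾χ-term _ _ _ _ _ p') (trans (coe-Summand _ _ p')
               (tr-irrelevant _ _ ⟨⊗⟩ tr-irrelevant _ _)))) ⟩
        α⇒ ⨾ (tr (cong left p) ⊗₁ (inj-st ⨾ χ-term A A (z' p)))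
          ≡⟨ sym (RHS-value p) ⟩
        RHS ∎
        where
        p₁ : pairD (r + s) t ≡ yˡ
        p₁ = Decomp-≡ (cong₂ _+_ (cong left p) (cong left p')) (cong right p')
        p₂ : pairD r s ≡ ((a , u) , sym (cong left p₁))
        p₂ = Decomp-≡ (cong left p) (cong left p')

    inj₃-agree : injˡ₃ ⨾ !₁ m₁ ⊕-assoc ≡ injʳ₃ ⨾ tr k
    inj₃-agree = χ-ext m₁ A (A ⊕ A) _ _ λ { ((a , b) , e) →
                 χ-ext-⊗ b A A _ _ λ { ((u , v) , e₂) → Component.LHS≡RHS a b e u v e₂ } }

  c̄-assoc : ∀ r s t A →
    (c̄ r s A ⊗₁ id) ⨾ c̄ (r + s) t A ≡ α⇒ ⨾ (id ⊗₁ c̄ s t A) ⨾ c̄ r (s + t) A ⨾ tr (sym (+-assoc r s t))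
  c̄-assoc r s t A = begin
    ((inj-rs ⨾ !₁ (r + s) ∇) ⊗₁ id) ⨾ c̄ (r + s) t A
      ≡⟨ cong (_⨾ c̄ (r + s) t A) (trans (refl ⟨⊗⟩ trans (sym (!-id t)) (sym (idˡ _))) (⊗-comp _ _ _ _)) ⟩
    (inj-rs ⊗₁ id) ⨾ (!₁ (r + s) ∇ ⊗₁ !₁ t id) ⨾ (inj m₁ A A (pairD (r + s) t) ⨾ !₁ m₁ ∇)
      ≡⟨ trans (pullʳ (inj-natural-⨾ _ ∇ id _ ∇)) (sym (⨾-assoc _ _ _)) ⟩
    injˡ₃ ⨾ !₁ m₁ (∇ ⊕₁ id ⨾ ∇)
      ≡⟨ cong (λ f → injˡ₃ ⨾ !₁ m₁ f) (sym ⊕-assoc⨾∇) ⟩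
    injˡ₃ ⨾ !₁ m₁ (⊕-assoc ⨾ (id ⊕₁ ∇ ⨾ ∇))
      ≡⟨ trans (cong (injˡ₃ ⨾_) (!-comp m₁ _ _)) (sym (⨾-assoc _ _ _)) ⟩
    injˡ₃ ⨾ !₁ m₁ ⊕-assoc ⨾ !₁ m₁ (id ⊕₁ ∇ ⨾ ∇)
      ≡⟨ cong (_⨾ !₁ m₁ (id ⊕₁ ∇ ⨾ ∇)) inj₃-agree ⟩
    injʳ₃ ⨾ tr k ⨾ !₁ m₁ (id ⊕₁ ∇ ⨾ ∇)
      ≡⟨ trans (pullʳ (tr-natural k _)) (sym (⨾-assoc _ _ _)) ⟩
    injʳ₃ ⨾ !₁ m₂ (id ⊕₁ ∇ ⨾ ∇) ⨾ tr k
      ≡⟨ cong (_⨾ tr k) (pullʳ (sym (inj-natural-⨾ _ id ∇ _ ∇))) ⟩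
    α⇒ ⨾ (id ⊗₁ inj-st) ⨾ ((!₁ r id ⊗₁ !₁ (s + t) ∇) ⨾ c̄ r (s + t) A) ⨾ tr k
      ≡⟨ cong (_⨾ tr k) (trans (sym (⨾-assoc _ _ _)) (cong (_⨾ c̄ r (s + t) A)
           (pullʳ (trans (⊗-fuse _ _ _ _) (trans (idˡ _) (!-id r) ⟨⊗⟩ refl))))) ⟩
    α⇒ ⨾ (id ⊗₁ c̄ s t A) ⨾ c̄ r (s + t) A ⨾ tr k ∎
    where open Associativity r s t A

  inj⨾!∇ : ∀ {m} a b A (e : a + b ≡ m) → inj m A A ((a , b) , e) ⨾ !₁ m ∇ ≡ c̄ a b A ⨾ tr e
  inj⨾!∇ a b A refl = sym (idʳ _)

  Quad-≡ : ∀ {r s t u} {a₁ a₂ a₃ a₄ b₁ b₂ b₃ b₄ : Carrier}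
    {e₁ : a₁ + a₂ ≡ r} {e₂ : a₃ + a₄ ≡ s} {e₃ : a₁ + a₃ ≡ t} {e₄ : a₂ + a₄ ≡ u}
    {e₁' : b₁ + b₂ ≡ r} {e₂' : b₃ + b₄ ≡ s} {e₃' : b₁ + b₃ ≡ t} {e₄' : b₂ + b₄ ≡ u} →
    a₁ ≡ b₁ → a₂ ≡ b₂ → a₃ ≡ b₃ → a₄ ≡ b₄ →
    _≡_ {A = Quad R r s t u}
      (record { qa = a₁ ; qb = a₂ ; qc = a₃ ; qd = a₄ ; eab = e₁  ; ecd = e₂  ; eac = e₃  ; ebd = e₄ })
      (record { qa = b₁ ; qb = b₂ ; qc = b₃ ; qd = b₄ ; eab = e₁' ; ecd = e₂' ; eac = e₃' ; ebd = e₄' })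
  Quad-≡ {e₁ = e₁} {e₂} {e₃} {e₄} {e₁'} {e₂'} {e₃'} {e₄'} refl refl refl refl
    rewrite uip e₁ e₁' | uip e₂ e₂' | uip e₃ e₃' | uip e₄ e₄' = refl

  -- Expanding !∇ = χ ; χ⁻¹ ; !∇ on both tensor factors writes c̄_{r,s} ; c_{t,u} as a double sum
  -- over decompositions y₁ of t and y₂ of u; the (y₁ , y₂) term survives exactly when y₁ and y₂
  -- come from an index (a , b , c , d) of the bimonoid law, where it is that law's summand.
  module Bimonoid (r s t u : Carrier) (A : Obj) (h : r + s ≡ t + u) where
    x : Decomp (r + s)
    x = pairD r s

    split : Hom (!₀ r A ⊗₀ !₀ s A) (!₀ t (A ⊕ A) ⊗₀ !₀ u (A ⊕ A))
    split = inj (r + s) A A x ⨾ tr h ⨾ c t u (A ⊕ A)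

    merge : ∀ m (y : Decomp m) → Hom (Summand A A y) (!₀ m A)
    merge m y = inj m A A y ⨾ !₁ m ∇

    term : Decomp t → Decomp u → Hom (!₀ r A ⊗₀ !₀ s A) (!₀ t A ⊗₀ !₀ u A)
    term y₁ y₂ = split ⨾ (χ-term A A y₁ ⊗₁ χ-term A A y₂) ⨾ (merge t y₁ ⊗₁ merge u y₂)

    combine : Decomp t → Decomp u → Decomp (r + s)
    combine ((a₁ , a₃) , e₁) ((a₂ , a₄) , e₂) =
      ((a₁ + a₂ , a₃ + a₄) , trans (+-interchange a₁ a₂ a₃ a₄) (trans (cong₂ _+_ e₁ e₂) (sym h)))

    term-via-combine : ∀ y₁ y₂ →
      term y₁ y₂ ≡ inj (r + s) A A x ⨾ χ-term A A (combine y₁ y₂)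
                   ⨾ (c (left y₁) (left y₂) A ⊗₁ c (right y₁) (right y₂) A) ⨾ mid ⨾ (merge t y₁ ⊗₁ merge u y₂)
    term-via-combine y₁@((a₁ , a₃) , e₁) y₂@((a₂ , a₄) , e₂) = cong (_⨾ (merge t y₁ ⊗₁ merge u y₂))
      (trans (pullʳ₃ (c⨾χ-term⊗χ-term a₁ a₂ a₃ a₄ t u h e₁ e₂ _)) (sym (pullʳ₃ refl)))

    N : ∀ m → Hom (Bigsum m A A) (!₀ m A)
    N m = χ⁻¹ m A A ⨾ !₁ m ∇

    !∇-via-χ : ∀ m → !₁ m (∇ {A}) ≡ χ⊗ m A A ⨾ N m
    !∇-via-χ m = sym (trans (sym (⨾-assoc _ _ _)) (trans (cong (_⨾ !₁ m ∇) (χ⨾χ⁻¹ m A A)) (idˡ _)))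

    c̄⨾c-as-Σ : c̄ r s A ⨾ tr h ⨾ c t u A ≡ Σₕ (dec t) (λ i → Σₕ (dec u) (λ j → term (decomp t i) (decomp u j)))
    c̄⨾c-as-Σ = begin
      inj (r + s) A A x ⨾ !₁ (r + s) ∇ ⨾ tr h ⨾ c t u A
        ≡⟨ trans (cong (_⨾ c t u A) (trans (pullʳ (sym (tr-natural h ∇))) (sym (⨾-assoc _ _ _))))
                 (trans (pullʳ (c-natural t u ∇)) (sym (⨾-assoc _ _ _))) ⟩
      split ⨾ (!₁ t ∇ ⊗₁ !₁ u ∇)
        ≡⟨ cong (split ⨾_) (trans (!∇-via-χ t ⟨⊗⟩ !∇-via-χ u) (⊗-comp _ _ _ _)) ⟩
      split ⨾ ((χ⊗ t A A ⊗₁ χ⊗ u A A) ⨾ (N t ⊗₁ N u))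
        ≡⟨ sym (⨾-assoc _ _ _) ⟩
      split ⨾ (χ⊗ t A A ⊗₁ χ⊗ u A A) ⨾ (N t ⊗₁ N u)
        ≡⟨ cong (λ f → split ⨾ f ⨾ (N t ⊗₁ N u)) (trans (χ⊗-as-Σ t A A ⟨⊗⟩ χ⊗-as-Σ u A A)
             (trans (⊗-distribʳ-Σₕ (dec t) _ _) (Σₕ-cong (dec t) (λ i → ⊗-distribˡ-Σₕ (dec u) _ _)))) ⟩
      split ⨾ Σₕ (dec t) (λ i → Σₕ (dec u) (λ j → K (decomp t i) (decomp u j))) ⨾ (N t ⊗₁ N u)
        ≡⟨ trans (cong (_⨾ (N t ⊗₁ N u)) (trans (⨾-distribˡ-Σₕ (dec t) split _)
                   (Σₕ-cong (dec t) (λ i → ⨾-distribˡ-Σₕ (dec u) split _))))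
                 (trans (⨾-distribʳ-Σₕ (dec t) _ _) (Σₕ-cong (dec t) (λ i → ⨾-distribʳ-Σₕ (dec u) _ _))) ⟩
      Σₕ (dec t) (λ i → Σₕ (dec u) (λ j → split ⨾ K (decomp t i) (decomp u j) ⨾ (N t ⊗₁ N u)))
        ≡⟨ Σₕ-cong (dec t) (λ i → Σₕ-cong (dec u) (λ j → K-term (decomp t i) (decomp u j))) ⟩
      Σₕ (dec t) (λ i → Σₕ (dec u) (λ j → term (decomp t i) (decomp u j))) ∎
      where
      K : ∀ y₁ y₂ → Hom (!₀ t (A ⊕ A) ⊗₀ !₀ u (A ⊕ A)) (Bigsum t A A ⊗₀ Bigsum u A A)
      K y₁ y₂ = (χ-term A A y₁ ⨾ ιD t A A y₁) ⊗₁ (χ-term A A y₂ ⨾ ιD u A A y₂)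

      K-term : ∀ y₁ y₂ → split ⨾ K y₁ y₂ ⨾ (N t ⊗₁ N u) ≡ term y₁ y₂
      K-term y₁ y₂ = begin
        split ⨾ ((χ-term A A y₁ ⨾ ιD t A A y₁) ⊗₁ (χ-term A A y₂ ⨾ ιD u A A y₂)) ⨾ (N t ⊗₁ N u)
          ≡⟨ cong (λ f → split ⨾ f ⨾ (N t ⊗₁ N u)) (⊗-comp _ _ _ _) ⟩
        split ⨾ ((χ-term A A y₁ ⊗₁ χ-term A A y₂) ⨾ (ιD t A A y₁ ⊗₁ ιD u A A y₂)) ⨾ (N t ⊗₁ N u)
          ≡⟨ trans (cong (_⨾ (N t ⊗₁ N u)) (sym (⨾-assoc _ _ _))) (pullʳ (⊗-fuse _ _ _ _)) ⟩
        split ⨾ (χ-term A A y₁ ⊗₁ χ-term A A y₂) ⨾ ((ιD t A A y₁ ⨾ N t) ⊗₁ (ιD u A A y₂ ⨾ N u))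
          ≡⟨ cong (split ⨾ (χ-term A A y₁ ⊗₁ χ-term A A y₂) ⨾_) (sym (⨾-assoc _ _ _) ⟨⊗⟩ sym (⨾-assoc _ _ _)) ⟩
        term y₁ y₂ ∎

    bimonoid-term : Quad R r s t u → Hom (!₀ r A ⊗₀ !₀ s A) (!₀ t A ⊗₀ !₀ u A)
    bimonoid-term q = (tr (sym (Quad.eab q)) ⊗₁ tr (sym (Quad.ecd q)))
      ⨾ (c (Quad.qa q) (Quad.qb q) A ⊗₁ c (Quad.qc q) (Quad.qd q) A)
      ⨾ mid
      ⨾ (c̄ (Quad.qa q) (Quad.qc q) A ⊗₁ c̄ (Quad.qb q) (Quad.qd q) A)
      ⨾ (tr (Quad.eac q) ⊗₁ tr (Quad.ebd q))

    t-part : Quad R r s t u → Decomp t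
    t-part q = ((Quad.qa q , Quad.qc q) , Quad.eac q)

    u-part : Quad R r s t u → Decomp u
    u-part q = ((Quad.qb q , Quad.qd q) , Quad.ebd q)

    term-on-Quad : ∀ q → term (t-part q) (u-part q) ≡ bimonoid-term q
    term-on-Quad q = begin
      term (t-part q) (u-part q)
        ≡⟨ term-via-combine (t-part q) (u-part q) ⟩
      inj (r + s) A A x ⨾ χ-term A A (combine (t-part q) (u-part q)) ⨾ (c qa qb A ⊗₁ c qc qd A) ⨾ mid
        ⨾ (merge t (t-part q) ⊗₁ merge u (u-part q))
        ≡⟨ cong₂ (λ f g → f ⨾ (c qa qb A ⊗₁ c qc qd A) ⨾ mid ⨾ g)
             (trans (inj⨾χ-term _ A A x _ x≡) (trans (coe-Summand A A x≡) (tr-irrelevant _ _ ⟨⊗⟩ tr-irrelevant _ _)))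
             (trans (inj⨾!∇ _ _ A (Quad.eac q) ⟨⊗⟩ inj⨾!∇ _ _ A (Quad.ebd q)) (⊗-comp _ _ _ _)) ⟩
      (tr (sym (Quad.eab q)) ⊗₁ tr (sym (Quad.ecd q))) ⨾ (c qa qb A ⊗₁ c qc qd A) ⨾ mid
        ⨾ ((c̄ qa qc A ⊗₁ c̄ qb qd A) ⨾ (tr (Quad.eac q) ⊗₁ tr (Quad.ebd q)))
        ≡⟨ sym (⨾-assoc _ _ _) ⟩
      bimonoid-term q ∎
      where
      open Quad q
      x≡ : x ≡ combine (t-part q) (u-part q)
      x≡ = Decomp-≡ (sym eab) (sym ecd)

    term-off-Quad : ∀ y₁ y₂ → (term y₁ y₂ ≡ 0ₕ) ⊎ (Σ (Quad R r s t u) λ q → (t-part q ≡ y₁) × (u-part q ≡ y₂))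
    term-off-Quad y₁@((a₁ , a₃) , e₁) y₂@((a₂ , a₄) , e₂) with Decomp-≟ (r + s) x (combine y₁ y₂)
    ... | yes p = inj₂ (record { qa = a₁ ; qb = a₂ ; qc = a₃ ; qd = a₄
                               ; eab = sym (cong left p) ; ecd = sym (cong right p) ; eac = e₁ ; ebd = e₂ }
                       , refl , refl)
    ... | no ne = inj₁ (begin
      term y₁ y₂
        ≡⟨ term-via-combine y₁ y₂ ⟩
      inj (r + s) A A x ⨾ χ-term A A (combine y₁ y₂) ⨾ (c a₁ a₂ A ⊗₁ c a₃ a₄ A) ⨾ mid ⨾ (merge t y₁ ⊗₁ merge u y₂)
        ≡⟨ cong (λ f → f ⨾ (c a₁ a₂ A ⊗₁ c a₃ a₄ A) ⨾ mid ⨾ (merge t y₁ ⊗₁ merge u y₂)) (inj⨾χ-term-≢ _ A A x _ ne) ⟩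
      0ₕ ⨾ (c a₁ a₂ A ⊗₁ c a₃ a₄ A) ⨾ mid ⨾ (merge t y₁ ⊗₁ merge u y₂)
        ≡⟨ trans (cong (λ f → f ⨾ mid ⨾ (merge t y₁ ⊗₁ merge u y₂)) (⨾-zeroˡ _))
                 (trans (cong (_⨾ (merge t y₁ ⊗₁ merge u y₂)) (⨾-zeroˡ _)) (⨾-zeroˡ _)) ⟩
      0ₕ ∎)

    ρ : Quad R r s t u → Fin (dec t) × Fin (dec u)
    ρ q = (index t (t-part q) , index u (u-part q))

    ρ-injective : ∀ q q' → ρ q ≡ ρ q' → q ≡ q'
    ρ-injective q q' eq = Quad-≡ (cong left e₁) (cong left e₂) (cong right e₁) (cong right e₂)
      where
      e₁ = index-injective t (cong proj₁ eq)
      e₂ = index-injective u (cong proj₂ eq)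

    term-on-ρ : ∀ q → term (decomp t (proj₁ (ρ q))) (decomp u (proj₂ (ρ q))) ≡ bimonoid-term q
    term-on-ρ q = trans (cong₂ term (decomp-index t (t-part q)) (decomp-index u (u-part q))) (term-on-Quad q)

    term-off-ρ : ∀ i j → (term (decomp t i) (decomp u j) ≡ 0ₕ) ⊎ (Σ (Quad R r s t u) λ q → ρ q ≡ (i , j))
    term-off-ρ i j with term-off-Quad (decomp t i) (decomp u j)
    ... | inj₁ vanishes = inj₁ vanishes
    ... | inj₂ (q , e₁ , e₂) = inj₂ (q , cong₂ _,_ (trans (cong (index t) e₁) (index-decomp t i))
                                                  (trans (cong (index u) e₂) (index-decomp u j)))

  bimonoid : ∀ r s t u A (h : r + s ≡ t + u) (n : ℕ) (e : Fin n ↔ Quad R r s t u) →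
    c̄ r s A ⨾ tr h ⨾ c t u A ≡ Σₕ n (λ i → Bimonoid.bimonoid-term r s t u A h (Inverse.to e i))
  bimonoid r s t u A h n e = trans c̄⨾c-as-Σ (sym (Σₕ-reindex n e bimonoid-term (dec t) (dec u)
    (λ i j → term (decomp t i) (decomp u j)) ρ ρ-injective term-on-ρ term-off-ρ))
    where open Bimonoid r s t u A h

proposition4p6 : ∀ {a o ℓ} (R : FASSemiring a) (C : AdditiveCategory o ℓ)
    (M : StrictSymmetricMonoidal C) (B : FiniteBiproducts C)
    (G : GradedCoalgebraModality R C M)
    (isoχ : ∀ r A B' → AdditiveCategory.IsIso C (Construction.χ⊗ R C M B G r A B'))
    (isoI : AdditiveCategory.IsIso C (Construction.χI R C M B G)) →
    IsGradedAdditiveBialgebraModality R C M G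
      (Construction.c̄ R C M B G isoχ) (Construction.w̄ R C M B G isoI)
proposition4p6 R C M B G isoχ isoI = record
  { c̄-natural   = c̄-natural
  ; w̄-natural   = w̄-natural
  ; c̄-assoc     = c̄-assoc
  ; c̄-unitˡ     = c̄-unitˡ
  ; c̄-unitʳ     = c̄-unitʳ
  ; c̄-comm      = c̄-comm
  ; bimonoid    = bimonoid
  ; w̄⨾w         = w̄⨾w
  ; w̄⨾c         = w̄⨾c
  ; c̄⨾w         = c̄⨾w
  ; c̄⨾d-01      = c̄⨾d-01
  ; c̄⨾d-10      = c̄⨾d-10
  ; c̄⨾d-both    = c̄⨾d-both
  ; c̄⨾d-none    = c̄⨾d-none
  ; !-+         = !-+
  ; !-0-zero    = !-0-zero
  ; !-0-nonzero = !-0-nonzero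
  }
  where open Proof R C M B G isoχ isoI
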